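{- There is a natural isomorphism $\epsilon\colon\mathcal L\mathcal R\to\mathrm{id}_{\mathbf{CBC}}$ whose component at a cartesian bicategory $\mathcal B$ is the functor $\epsilon_{\mathcal B}\colon\mathcal L\mathcal R(\mathcal B)\to\mathcal B$ which is the identity on objects and sends $R\in\mathrm{Hom}_{\mathcal B}(X\otimes Y,I)$ (a morphism $X\to Y$ of $\mathcal L\mathcal R(\mathcal B)$) to the composite $\rho_X^{ -1};(\mathrm{id}_X\otimes(e_Y^*;d_Y));(R\otimes\mathrm{id}_Y);\lambda_Y\colon X\to Y$ (associators omitted), where $\rho,\lambda$ are the right and left unitors of $\mathcal B$. Its inverse $\epsilon_{\mathcal B}^{ -1}$ sends $S\colon X\to Y$ in $\mathcal B$ to $(S\otimes\mathrm{id}_Y);d_Y^*;e_Y\in\mathrm{Hom}_{\mathcal B}(X\otimes Y,I)$.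
   Context: Composition diagrammatic ($;$). Cartesian bicategory: poset-enriched symmetric monoidal $(\mathcal B,\otimes,I)$ with, for each $X$, a cocommutative comonoid $d_X\colon X\to X\otimes X$, $e_X\colon X\to I$ having right adjoints $d_X^*,e_X^*$ ($\mathrm{id}\le d;d^*$, $d^*;d\le\mathrm{id}$, same for $e$), satisfying Frobenius $(d_X\otimes\mathrm{id});(\mathrm{id}\otimes d_X^*)=d_X^*;d_X$, with every $R\colon X\to Y$ satisfying $R;d_Y\le d_X;(R\otimes R)$ and $R;e_Y\le e_X$, and comonoids coherent with $\otimes$ ($e_{X\otimes Y}=e_X\otimes e_Y$, $d_{X\otimes Y}=(d_X\otimes d_Y);(\mathrm{id}\otimes\sigma\otimes\mathrm{id})$ up to coherence isos). Maps: $f$ with $f;d_Y=d_X;(f\otimes f)$, $f;e_Y=e_X$, forming cartesian $\mathrm{Map}(\mathcal B)$. $\mathbf{CBC}$: strict monoidal functors preserving order and $d,e,d^*,e^*$. $\mathbf{InfSL}$: meet-semilattices with top. $\mathcal R(\mathcal B)=\mathrm{Hom}_{\mathcal B}(-,I)\colon\mathrm{Map}(\mathcal B)^{op}\to\mathbf{InfSL}$ (top $e_X$, meet $d_X;(R\otimes S)$, action $f\mapsto(U\mapsto f;U)$) is an elementary existential doctrine with $\delta_A=d_A^*;e_A$ and $\exists_\pi$ along $\pi\colon X\otimes A\to A$ given by $U\mapsto (e_X^*\otimes\mathrm{id}_A);U$; $\mathcal R(F)=(F\restriction_{\mathrm{Map}},U\mapsto F(U))$. For an elementary existential doctrine $P\colon\mathcal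 C^{op}\to\mathbf{InfSL}$ (with $\delta_A$, left adjoints $\exists_\pi$ to $P_\pi=P(\pi)$ along projections), $\mathcal L(P)=\mathcal A_P$ has objects of $\mathcal C$, $\mathrm{Hom}(X,Y)=P(X\times Y)$, identity $\delta_X$, composite $\exists_{\langle\pi_1,\pi_3\rangle}(P_{\langle\pi_1,\pi_2\rangle}f\wedge P_{\langle\pi_2,\pi_3\rangle}g)$, tensor $P_{\langle\pi_1,\pi_3\rangle}f\wedge P_{\langle\pi_2,\pi_4\rangle}g$, and remaining structure transported along the graph functor $\Gamma_P(f)=P_{f\times\mathrm{id}_Y}(\delta_Y)$; for a morphism $(F,b)$ of doctrines, $\mathcal L(F,b)$ sends $r\in P(X\times Y)$ to $b_{X\times Y}(r)$. Thus $\mathcal L\mathcal R(\mathcal B)$ has the objects of $\mathcal B$ and morphisms $X\to Y$ the elements of $\mathrm{Hom}_{\mathcal B}(X\otimes Y,I)$. -}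

module Defs where

open import Level using (Level; _⊔_; suc)
open import Relation.Binary.PropositionalEquality using (_≡_; refl; sym; trans; cong; subst₂)

-- Cartesian bicategories (Carboni–Walters), composition diagrammatic (_⨾_).
-- Poset-enriched symmetric monoidal category, hom-equality is _≡_,
-- hom-order _≤_ is a partial order (antisymmetric w.r.t. _≡_).

record CartesianBicategory (o ℓ r : Level) : Set (suc (o ⊔ ℓ ⊔ r)) where
  infixr 9 _⨾_
  infixr 10 _⊗₀_ _⊗₁_
  infix 4 _≤_
  field
    Obj : Set o
    Hom : Obj → Obj → Set ℓ
    _≤_ : ∀ {A B} → Hom A B → Hom A B → Set r
    id  : ∀ A → Hom A A
    _⨾_ : ∀ {A B C} → Hom A B → Hom B C → Hom A C

    idˡ   : ∀ {A B} (f : Hom A B) → id A ⨾ f ≡ f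
    idʳ   : ∀ {A B} (f : Hom A B) → f ⨾ id B ≡ f
    assoc : ∀ {A B C D} (f : Hom A B) (g : Hom B C) (h : Hom C D) →
            (f ⨾ g) ⨾ h ≡ f ⨾ (g ⨾ h)

    ≤-refl    : ∀ {A B} (f : Hom A B) → f ≤ f
    ≤-trans   : ∀ {A B} {f g h : Hom A B} → f ≤ g → g ≤ h → f ≤ h
    ≤-antisym : ∀ {A B} {f g : Hom A B} → f ≤ g → g ≤ f → f ≡ g
    ⨾-mono    : ∀ {A B C} {f f' : Hom A B} {g g' : Hom B C} →
                f ≤ f' → g ≤ g' → f ⨾ g ≤ f' ⨾ g'

    _⊗₀_ : Obj → Obj → Obj
    I    : Obj
    _⊗₁_ : ∀ {A B C D} → Hom A B → Hom C D → Hom (A ⊗₀ C) (B ⊗₀ D)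
    ⊗-id   : ∀ A B → id A ⊗₁ id B ≡ id (A ⊗₀ B)
    ⊗-⨾    : ∀ {A B C A' B' C'} (f : Hom A B) (g : Hom B C)
               (f' : Hom A' B') (g' : Hom B' C') →
             (f ⨾ g) ⊗₁ (f' ⨾ g') ≡ (f ⊗₁ f') ⨾ (g ⊗₁ g')
    ⊗-mono : ∀ {A B C D} {f f' : Hom A B} {g g' : Hom C D} →
             f ≤ f' → g ≤ g' → f ⊗₁ g ≤ f' ⊗₁ g'

    α⇒ : ∀ A B C → Hom ((A ⊗₀ B) ⊗₀ C) (A ⊗₀ (B ⊗₀ C))
    α⇐ : ∀ A B C → Hom (A ⊗₀ (B ⊗₀ C)) ((A ⊗₀ B) ⊗₀ C)
    unitˡ⇒ : ∀ A → Hom (I ⊗₀ A) A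
    unitˡ⇐ : ∀ A → Hom A (I ⊗₀ A)
    unitʳ⇒ : ∀ A → Hom (A ⊗₀ I) A
    unitʳ⇐ : ∀ A → Hom A (A ⊗₀ I)
    braid  : ∀ A B → Hom (A ⊗₀ B) (B ⊗₀ A)

    α-iso₁ : ∀ A B C → α⇒ A B C ⨾ α⇐ A B C ≡ id _
    α-iso₂ : ∀ A B C → α⇐ A B C ⨾ α⇒ A B C ≡ id _
    unitˡ-iso₁ : ∀ A → unitˡ⇒ A ⨾ unitˡ⇐ A ≡ id _
    unitˡ-iso₂ : ∀ A → unitˡ⇐ A ⨾ unitˡ⇒ A ≡ id _
    unitʳ-iso₁ : ∀ A → unitʳ⇒ A ⨾ unitʳ⇐ A ≡ id _
    unitʳ-iso₂ : ∀ A → unitʳ⇐ A ⨾ unitʳ⇒ A ≡ id _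
    braid-inv  : ∀ A B → braid A B ⨾ braid B A ≡ id _

    α-natural : ∀ {A A' B B' C C'} (f : Hom A A') (g : Hom B B') (h : Hom C C') →
                ((f ⊗₁ g) ⊗₁ h) ⨾ α⇒ A' B' C' ≡ α⇒ A B C ⨾ (f ⊗₁ (g ⊗₁ h))
    unitˡ-natural : ∀ {A B} (f : Hom A B) → (id I ⊗₁ f) ⨾ unitˡ⇒ B ≡ unitˡ⇒ A ⨾ f
    unitʳ-natural : ∀ {A B} (f : Hom A B) → (f ⊗₁ id I) ⨾ unitʳ⇒ B ≡ unitʳ⇒ A ⨾ f
    braid-natural : ∀ {A A' B B'} (f : Hom A A') (g : Hom B B') →
                    (f ⊗₁ g) ⨾ braid A' B' ≡ braid A B ⨾ (g ⊗₁ f)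

    pentagon : ∀ A B C D →
      (α⇒ A B C ⊗₁ id D) ⨾ α⇒ A (B ⊗₀ C) D ⨾ (id A ⊗₁ α⇒ B C D)
        ≡ α⇒ (A ⊗₀ B) C D ⨾ α⇒ A B (C ⊗₀ D)
    triangle : ∀ A B →
      α⇒ A I B ⨾ (id A ⊗₁ unitˡ⇒ B) ≡ unitʳ⇒ A ⊗₁ id B
    hexagon : ∀ A B C →
      α⇒ A B C ⨾ braid A (B ⊗₀ C) ⨾ α⇒ B C A
        ≡ (braid A B ⊗₁ id C) ⨾ α⇒ B A C ⨾ (id B ⊗₁ braid A C)

    d  : ∀ X → Hom X (X ⊗₀ X)
    e  : ∀ X → Hom X I
    d* : ∀ X → Hom (X ⊗₀ X) X
    e* : ∀ X → Hom I X

    d-assoc : ∀ X → d X ⨾ (d X ⊗₁ id X) ⨾ α⇒ X X X ≡ d X ⨾ (id X ⊗₁ d X)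
    d-unitˡ : ∀ X → d X ⨾ (e X ⊗₁ id X) ⨾ unitˡ⇒ X ≡ id X
    d-unitʳ : ∀ X → d X ⨾ (id X ⊗₁ e X) ⨾ unitʳ⇒ X ≡ id X
    d-comm  : ∀ X → d X ⨾ braid X X ≡ d X

    d-unit   : ∀ X → id X ≤ d X ⨾ d* X
    d-counit : ∀ X → d* X ⨾ d X ≤ id (X ⊗₀ X)
    e-unit   : ∀ X → id X ≤ e X ⨾ e* X
    e-counit : ∀ X → e* X ⨾ e X ≤ id I

    frobenius : ∀ X →
      (d X ⊗₁ id X) ⨾ α⇒ X X X ⨾ (id X ⊗₁ d* X) ≡ d* X ⨾ d X

    d-lax : ∀ {X Y} (R : Hom X Y) → R ⨾ d Y ≤ d X ⨾ (R ⊗₁ R)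
    e-lax : ∀ {X Y} (R : Hom X Y) → R ⨾ e Y ≤ e X

    e-⊗ : ∀ X Y → e (X ⊗₀ Y) ≡ (e X ⊗₁ e Y) ⨾ unitˡ⇒ I
    d-⊗ : ∀ X Y → d (X ⊗₀ Y) ≡
      (d X ⊗₁ d Y) ⨾ α⇒ X X (Y ⊗₀ Y) ⨾ (id X ⊗₁ α⇐ X Y Y)
        ⨾ (id X ⊗₁ (braid X Y ⊗₁ id Y)) ⨾ (id X ⊗₁ α⇒ Y X Y) ⨾ α⇐ X Y (X ⊗₀ Y)

module _ {o ℓ r o' ℓ' r' : Level}
         (B : CartesianBicategory o ℓ r) (B' : CartesianBicategory o' ℓ' r') where
  private
    module B = CartesianBicategory B
    module B' = CartesianBicategory B'

  cast : ∀ {A A' C C'} → A ≡ A' → C ≡ C' → B'.Hom A C → B'.Hom A' C'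
  cast p q f = subst₂ B'.Hom p q f

  record CBCMorphism : Set (o ⊔ ℓ ⊔ r ⊔ o' ⊔ ℓ' ⊔ r') where
    field
      F₀ : B.Obj → B'.Obj
      F₁ : ∀ {A C} → B.Hom A C → B'.Hom (F₀ A) (F₀ C)
      F-id : ∀ A → F₁ (B.id A) ≡ B'.id (F₀ A)
      F-⨾  : ∀ {A C D} (f : B.Hom A C) (g : B.Hom C D) → F₁ (f B.⨾ g) ≡ F₁ f B'.⨾ F₁ g
      F-mono : ∀ {A C} {f g : B.Hom A C} → f B.≤ g → F₁ f B'.≤ F₁ g
      F-⊗₀ : ∀ A C → F₀ (A B.⊗₀ C) ≡ F₀ A B'.⊗₀ F₀ C
      F-I  : F₀ B.I ≡ B'.I
      F-⊗₁ : ∀ {A C A' C'} (f : B.Hom A C) (g : B.Hom A' C') →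
             cast (F-⊗₀ A A') (F-⊗₀ C C') (F₁ (f B.⊗₁ g)) ≡ F₁ f B'.⊗₁ F₁ g
      F-α  : ∀ A C D →
             cast (trans (F-⊗₀ (A B.⊗₀ C) D) (cong (B'._⊗₀ F₀ D) (F-⊗₀ A C)))
                  (trans (F-⊗₀ A (C B.⊗₀ D)) (cong (F₀ A B'.⊗₀_) (F-⊗₀ C D)))
                  (F₁ (B.α⇒ A C D))
               ≡ B'.α⇒ (F₀ A) (F₀ C) (F₀ D)
      F-unitˡ : ∀ A →
             cast (trans (F-⊗₀ B.I A) (cong (B'._⊗₀ F₀ A) F-I)) refl (F₁ (B.unitˡ⇒ A))
               ≡ B'.unitˡ⇒ (F₀ A)
      F-unitʳ : ∀ A →
             cast (trans (F-⊗₀ A B.I) (cong (F₀ A B'.⊗₀_) F-I)) refl (F₁ (B.unitʳ⇒ A))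
               ≡ B'.unitʳ⇒ (F₀ A)
      F-d  : ∀ X → cast refl (F-⊗₀ X X) (F₁ (B.d X)) ≡ B'.d (F₀ X)
      F-e  : ∀ X → cast refl F-I (F₁ (B.e X)) ≡ B'.e (F₀ X)
      F-d* : ∀ X → cast (F-⊗₀ X X) refl (F₁ (B.d* X)) ≡ B'.d* (F₀ X)
      F-e* : ∀ X → cast F-I refl (F₁ (B.e* X)) ≡ B'.e* (F₀ X)

-- The construction LR(B), written out in terms of B.
-- Objects: those of B; morphisms X → Y: elements of Hom_B(X ⊗ Y, I).

module LRConstruction {o ℓ r : Level} (B : CartesianBicategory o ℓ r) where
  open CartesianBicategory B

  π₁ : ∀ {X Y} → Hom (X ⊗₀ Y) X
  π₁ {X} {Y} = (id X ⊗₁ e Y) ⨾ unitʳ⇒ X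

  π₂ : ∀ {X Y} → Hom (X ⊗₀ Y) Y
  π₂ {X} {Y} = (e X ⊗₁ id Y) ⨾ unitˡ⇒ Y

  ⟨_,_⟩ : ∀ {Z X Y} → Hom Z X → Hom Z Y → Hom Z (X ⊗₀ Y)
  ⟨_,_⟩ {Z} f g = d Z ⨾ (f ⊗₁ g)

  -- the doctrine R(B) = Hom_B(-, I)
  reindex : ∀ {X Y} → Hom X Y → Hom Y I → Hom X I
  reindex f U = f ⨾ U

  meet : ∀ {X} → Hom X I → Hom X I → Hom X I
  meet {X} R S = d X ⨾ (R ⊗₁ S) ⨾ unitˡ⇒ I

  -- ∃ along the projection π₂ : X ⊗ A → A
  ∃π : ∀ {X A} → Hom (X ⊗₀ A) I → Hom A I
  ∃π {X} {A} U = unitˡ⇐ A ⨾ (e* X ⊗₁ id A) ⨾ U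

  δ : ∀ A → Hom (A ⊗₀ A) I
  δ A = d* A ⨾ e A

  HomLR : Obj → Obj → Set ℓ
  HomLR X Y = Hom (X ⊗₀ Y) I

  idLR : ∀ X → HomLR X X
  idLR X = δ X

  -- composite ∃_{⟨π₁,π₃⟩}(P_{⟨π₁,π₂⟩} f ∧ P_{⟨π₂,π₃⟩} g), on X ⊗ (Y ⊗ Z);
  -- ∃ along ⟨π₁,π₃⟩ = θ⁻¹ ⨾ π₂ is computed as ∃_{π₂} ∘ P_θ.
  compLR : ∀ {X Y Z} → HomLR X Y → HomLR Y Z → HomLR X Z
  compLR {X} {Y} {Z} f g = ∃π {Y} {X ⊗₀ Z} (reindex θ conj)
    where
    p₁ : Hom (X ⊗₀ (Y ⊗₀ Z)) X
    p₁ = π₁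
    p₂ : Hom (X ⊗₀ (Y ⊗₀ Z)) Y
    p₂ = π₂ ⨾ π₁
    p₃ : Hom (X ⊗₀ (Y ⊗₀ Z)) Z
    p₃ = π₂ ⨾ π₂
    conj : Hom (X ⊗₀ (Y ⊗₀ Z)) I
    conj = meet (reindex ⟨ p₁ , p₂ ⟩ f) (reindex ⟨ p₂ , p₃ ⟩ g)
    θ : Hom (Y ⊗₀ (X ⊗₀ Z)) (X ⊗₀ (Y ⊗₀ Z))
    θ = ⟨ π₂ ⨾ π₁ , ⟨ π₁ , π₂ ⨾ π₂ ⟩ ⟩

  tensorLR : ∀ {X X' Y Y'} → HomLR X Y → HomLR X' Y' → HomLR (X ⊗₀ X') (Y ⊗₀ Y')
  tensorLR {X} {X'} {Y} {Y'} f g =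
    meet (reindex ⟨ q₁ , q₃ ⟩ f) (reindex ⟨ q₂ , q₄ ⟩ g)
    where
    q₁ : Hom ((X ⊗₀ X') ⊗₀ (Y ⊗₀ Y')) X
    q₁ = π₁ ⨾ π₁
    q₂ : Hom ((X ⊗₀ X') ⊗₀ (Y ⊗₀ Y')) X'
    q₂ = π₁ ⨾ π₂
    q₃ : Hom ((X ⊗₀ X') ⊗₀ (Y ⊗₀ Y')) Y
    q₃ = π₂ ⨾ π₁
    q₄ : Hom ((X ⊗₀ X') ⊗₀ (Y ⊗₀ Y')) Y'
    q₄ = π₂ ⨾ π₂

  Γ : ∀ {X Y} → Hom X Y → HomLR X Y
  Γ {X} {Y} f = reindex (f ⊗₁ id Y) (δ Y)

  converse : ∀ {X Y} → HomLR X Y → HomLR Y X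
  converse {X} {Y} R = braid Y X ⨾ R

  dLR : ∀ X → HomLR X (X ⊗₀ X)
  dLR X = Γ (d X)
  eLR : ∀ X → HomLR X I
  eLR X = Γ (e X)
  d*LR : ∀ X → HomLR (X ⊗₀ X) X
  d*LR X = converse (Γ (d X))
  e*LR : ∀ X → HomLR I X
  e*LR X = converse (Γ (e X))

  LRmor : ∀ {o' ℓ' r'} {B' : CartesianBicategory o' ℓ' r'} (F : CBCMorphism B B') →
          ∀ {X Y} → HomLR X Y →
          CartesianBicategory.Hom B'
            (CartesianBicategory._⊗₀_ B' (CBCMorphism.F₀ F X) (CBCMorphism.F₀ F Y))
            (CartesianBicategory.I B')
  LRmor {B' = B'} F {X} {Y} R = cast B B' (F-⊗₀ X Y) F-I (F₁ R)
    where open CBCMorphism F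

  ε : ∀ {X Y} → HomLR X Y → Hom X Y
  ε {X} {Y} R =
    unitʳ⇐ X ⨾ (id X ⊗₁ (e* Y ⨾ d Y)) ⨾ α⇐ X Y Y ⨾ (R ⊗₁ id Y) ⨾ unitˡ⇒ Y

  ε⁻¹ : ∀ {X Y} → Hom X Y → HomLR X Y
  ε⁻¹ {X} {Y} S = (S ⊗₁ id Y) ⨾ d* Y ⨾ e Y

record EpsilonNatIso {o ℓ r : Level} (B : CartesianBicategory o ℓ r) : Set (suc (o ⊔ ℓ ⊔ r)) where
  open CartesianBicategory B
  open LRConstruction B
  field
    ε⁻¹-ε : ∀ {X Y} (R : HomLR X Y) → ε⁻¹ (ε R) ≡ R
    ε-ε⁻¹ : ∀ {X Y} (S : Hom X Y) → ε (ε⁻¹ S) ≡ S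
    ε-id   : ∀ X → ε (idLR X) ≡ id X
    ε-comp : ∀ {X Y Z} (f : HomLR X Y) (g : HomLR Y Z) → ε (compLR f g) ≡ ε f ⨾ ε g
    ε-mono   : ∀ {X Y} {R R' : HomLR X Y} → R ≤ R' → ε R ≤ ε R'
    ε⁻¹-mono : ∀ {X Y} {S S' : Hom X Y} → S ≤ S' → ε⁻¹ S ≤ ε⁻¹ S'
    -- strict monoidal (unit I and ⊗₀ preserved definitionally)
    ε-⊗      : ∀ {X X' Y Y'} (f : HomLR X Y) (g : HomLR X' Y') →
               ε (tensorLR f g) ≡ ε f ⊗₁ ε g
    ε-α      : ∀ X Y Z → ε (Γ (α⇒ X Y Z)) ≡ α⇒ X Y Z
    ε-unitˡ  : ∀ X → ε (Γ (unitˡ⇒ X)) ≡ unitˡ⇒ X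
    ε-unitʳ  : ∀ X → ε (Γ (unitʳ⇒ X)) ≡ unitʳ⇒ X
    ε-braid  : ∀ X Y → ε (Γ (braid X Y)) ≡ braid X Y
    ε-d  : ∀ X → ε (dLR X) ≡ d X
    ε-e  : ∀ X → ε (eLR X) ≡ e X
    ε-d* : ∀ X → ε (d*LR X) ≡ d* X
    ε-e* : ∀ X → ε (e*LR X) ≡ e* X
    natural : (B' : CartesianBicategory o ℓ r) (F : CBCMorphism B B') →
              ∀ {X Y} (R : HomLR X Y) →
              CBCMorphism.F₁ F (ε R) ≡ LRConstruction.ε B' (LRmor F R)

{-# OPTIONS --safe #-}
module Submission where

-- Frobenius makes every object of a cartesian bicategory self-dual, with cup e* ⨾ d and cap d* ⨾ e
-- satisfying the zigzag equations. ε and ε⁻¹ are the two transpositions along this duality, hence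
-- mutually inverse, and ε ((S ⊗ id) ⨾ R) ≡ S ⨾ ε R. The operations of LR(B) are reindexings along
-- maps of B, and maps (comonoid homomorphisms) form a cartesian category whose product is ⊗, so
-- comparing projections identifies those reindexings with explicit shuffles of tensor factors.
-- Consequently composing ε⁻¹ S with R in LR(B) is (S ⊗ id) ⨾ R, the tensor of ε⁻¹ S and ε⁻¹ T is
-- ε⁻¹ (S ⊗ T), and every structure morphism of LR(B) is ε⁻¹ of the one in B; so ε preserves all
-- structure. Naturality holds because a morphism of cartesian bicategories preserves every factor
-- of ε strictly.

open import Defs
open import Level using (Level)
open import Relation.Binary.PropositionalEquality
open import Data.Product using (_×_; _,_; proj₂)

module MonoidalLemmas {o ℓ r : Level} (𝔹 : CartesianBicategory o ℓ r) where
  open CartesianBicategory 𝔹 public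
  open ≡-Reasoning

  private variable
    A C D E X A' C' D' : Obj

  λ⇒ : ∀ A → Hom (I ⊗₀ A) A
  λ⇒ = unitˡ⇒
  λ⇐ : ∀ A → Hom A (I ⊗₀ A)
  λ⇐ = unitˡ⇐
  ρ⇒ : ∀ A → Hom (A ⊗₀ I) A
  ρ⇒ = unitʳ⇒
  ρ⇐ : ∀ A → Hom A (A ⊗₀ I)
  ρ⇐ = unitʳ⇐

  pullˡ : {f : Hom A C} {g : Hom C D} {h : Hom A D} {k : Hom D E} →
         f ⨾ g ≡ h → f ⨾ g ⨾ k ≡ h ⨾ k
  pullˡ {f = f} {g} {h} {k} p = trans (sym (assoc f g k)) (cong (_⨾ k) p)

  pullˡ³ : {P Q R S T : Obj} {f : Hom P Q} {g : Hom Q R} {h : Hom R S} {i : Hom P S} {k : Hom S T} →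
          f ⨾ g ⨾ h ≡ i → f ⨾ g ⨾ h ⨾ k ≡ i ⨾ k
  pullˡ³ {f = f} {g} {h} {i} {k} p = trans (cong (f ⨾_) (sym (assoc g h k))) (pullˡ p)

  ⨾-congˡ : {a a' : Hom A C} {t : Hom C D} → a ≡ a' → a ⨾ t ≡ a' ⨾ t
  ⨾-congˡ refl = refl

  ⨾-congʳ : {t : Hom A C} {a a' : Hom C D} → a ≡ a' → t ⨾ a ≡ t ⨾ a'
  ⨾-congʳ refl = refl

  cancelˡ : {f : Hom A C} {g : Hom C A} {k : Hom A D} → f ⨾ g ≡ id A → f ⨾ g ⨾ k ≡ k
  cancelˡ {k = k} p = trans (pullˡ p) (idˡ k)

  assoc² : {P Q R S T : Obj} {a : Hom P Q} {b : Hom Q R} {c : Hom R S} {p : Hom S T} → (a ⨾ b ⨾ c) ⨾ p ≡ a ⨾ b ⨾ c ⨾ p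
  assoc² = trans (assoc _ _ _) (cong (_ ⨾_) (assoc _ _ _))

  assoc³ : {P Q R S T U : Obj} {a : Hom P Q} {b : Hom Q R} {c : Hom R S} {c' : Hom S T} {p : Hom T U} →
        (a ⨾ b ⨾ c ⨾ c') ⨾ p ≡ a ⨾ b ⨾ c ⨾ c' ⨾ p
  assoc³ = trans (assoc _ _ _) (cong (_ ⨾_) assoc²)

  assoc⁴ : {P Q R S T U V : Obj} {a : Hom P Q} {b : Hom Q R} {c : Hom R S} {c' : Hom S T} {c'' : Hom T U} {p : Hom U V} →
        (a ⨾ b ⨾ c ⨾ c' ⨾ c'') ⨾ p ≡ a ⨾ b ⨾ c ⨾ c' ⨾ c'' ⨾ p
  assoc⁴ = trans (assoc _ _ _) (cong (_ ⨾_) assoc³)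

  assoc⁵ : {P Q R S T U V W' : Obj} {a : Hom P Q} {b : Hom Q R} {c : Hom R S} {c₁ : Hom S T} {c₂ : Hom T U} {c₃ : Hom U V} {p : Hom V W'} →
        (a ⨾ b ⨾ c ⨾ c₁ ⨾ c₂ ⨾ c₃) ⨾ p ≡ a ⨾ b ⨾ c ⨾ c₁ ⨾ c₂ ⨾ c₃ ⨾ p
  assoc⁵ = trans (assoc _ _ _) (cong (_ ⨾_) assoc⁴)

  assoc²ˡ : {P Q R S T : Obj} {a : Hom P Q} {b : Hom Q R} {p : Hom R S} {q : Hom S T} → ((a ⨾ b) ⨾ p) ⨾ q ≡ a ⨾ b ⨾ p ⨾ q
  assoc²ˡ = trans (assoc _ _ _) (assoc _ _ _)

  prepend : {P Q R S : Obj} {t : Hom P Q} {s : Hom Q R} {k : Hom R S} {k' : Hom Q S} {k'' : Hom P S} →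
         s ⨾ k ≡ k' → t ⨾ k' ≡ k'' → t ⨾ s ⨾ k ≡ k''
  prepend {t = t} p q = trans (cong (t ⨾_) p) q

  id⊗id : id A ⊗₁ id C ≡ id (A ⊗₀ C)
  id⊗id = ⊗-id _ _

  ⊗id-⨾ : (f : Hom A C) (g : Hom C D) → (f ⊗₁ id X) ⨾ (g ⊗₁ id X) ≡ (f ⨾ g) ⊗₁ id X
  ⊗id-⨾ {X = X} f g = trans (sym (⊗-⨾ f g (id X) (id X))) (cong ((f ⨾ g) ⊗₁_) (idˡ (id X)))

  id⊗-⨾ : (f : Hom A C) (g : Hom C D) → (id X ⊗₁ f) ⨾ (id X ⊗₁ g) ≡ id X ⊗₁ (f ⨾ g)
  id⊗-⨾ {X = X} f g = trans (sym (⊗-⨾ (id X) (id X) f g)) (cong (_⊗₁ (f ⨾ g)) (idˡ (id X)))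

  ⊗id-distrib : (a : Hom A C) (b : Hom C D) → (a ⨾ b) ⊗₁ id X ≡ (a ⊗₁ id X) ⨾ (b ⊗₁ id X)
  ⊗id-distrib a b = sym (⊗id-⨾ a b)

  id⊗-distrib : (a : Hom A C) (b : Hom C D) → id X ⊗₁ (a ⨾ b) ≡ (id X ⊗₁ a) ⨾ (id X ⊗₁ b)
  id⊗-distrib a b = sym (id⊗-⨾ a b)

  ⊗-⨾ˡ : (a : Hom A C) (b : Hom C D) (g : Hom E X) → (a ⨾ b) ⊗₁ g ≡ (a ⊗₁ id E) ⨾ (b ⊗₁ g)
  ⊗-⨾ˡ a b g = trans (cong ((a ⨾ b) ⊗₁_) (sym (idˡ g))) (⊗-⨾ a b (id _) g)

  serialize₁₂ : (f : Hom A C) (g : Hom D E) → f ⊗₁ g ≡ (f ⊗₁ id D) ⨾ (id C ⊗₁ g)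
  serialize₁₂ f g = trans (cong₂ _⊗₁_ (sym (idʳ f)) (sym (idˡ g))) (⊗-⨾ f (id _) (id _) g)

  serialize₂₁ : (f : Hom A C) (g : Hom D E) → f ⊗₁ g ≡ (id A ⊗₁ g) ⨾ (f ⊗₁ id E)
  serialize₂₁ f g = trans (cong₂ _⊗₁_ (sym (idˡ f)) (sym (idʳ g))) (⊗-⨾ (id _) f g (id _))

  interchange : (f : Hom A C) (g : Hom D E) → (f ⊗₁ id D) ⨾ (id C ⊗₁ g) ≡ (id A ⊗₁ g) ⨾ (f ⊗₁ id E)
  interchange f g = trans (sym (serialize₁₂ f g)) (serialize₂₁ f g)

  Iso : Hom A C → Hom C A → Set ℓ
  Iso i j = (i ⨾ j ≡ id _) × (j ⨾ i ≡ id _)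

  iso-sym : {i : Hom A C} {j : Hom C A} → Iso i j → Iso j i
  iso-sym (p , q) = q , p

  iso-cancelˡ : {i : Hom A C} {j : Hom C A} {f g : Hom C D} → Iso i j → i ⨾ f ≡ i ⨾ g → f ≡ g
  iso-cancelˡ {i = i} {j} {f} {g} (p , q) e = begin
    f ≡⟨ sym (cancelˡ q) ⟩
    j ⨾ i ⨾ f ≡⟨ cong (j ⨾_) e ⟩
    j ⨾ i ⨾ g ≡⟨ cancelˡ q ⟩
    g ∎

  iso-cancelʳ : {i : Hom A C} {j : Hom C A} {f g : Hom D A} → Iso i j → f ⨾ i ≡ g ⨾ i → f ≡ g
  iso-cancelʳ {i = i} {j} {f} {g} (p , q) e = begin
    f ≡⟨ sym (idʳ f) ⟩
    f ⨾ id _ ≡⟨ cong (f ⨾_) (sym p) ⟩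
    f ⨾ i ⨾ j ≡⟨ sym (assoc f i j) ⟩
    (f ⨾ i) ⨾ j ≡⟨ cong (_⨾ j) e ⟩
    (g ⨾ i) ⨾ j ≡⟨ assoc g i j ⟩
    g ⨾ i ⨾ j ≡⟨ cong (g ⨾_) p ⟩
    g ⨾ id _ ≡⟨ idʳ g ⟩
    g ∎

  inverse-unique : {f : Hom A C} {i : Hom C A} {j : Hom A C} → Iso i j → f ⨾ i ≡ id A → f ≡ j
  inverse-unique {f = f} {i} {j} (p , q) e' = begin
    f ≡⟨ sym (idʳ f) ⟩ f ⨾ id _ ≡⟨ cong (f ⨾_) (sym p) ⟩ f ⨾ i ⨾ j ≡⟨ pullˡ e' ⟩ id _ ⨾ j ≡⟨ idˡ j ⟩ j ∎

  iso-swap : {i : Hom A C} {i' : Hom C A} {j : Hom D E} {j' : Hom E D}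
         {a : Hom A D} {b : Hom C E} → Iso i i' → Iso j j' →
         a ⨾ j ≡ i ⨾ b → i' ⨾ a ≡ b ⨾ j'
  iso-swap {i = i} {i'} {j} {j'} {a} {b} (p , q) (p' , q') e = begin
    i' ⨾ a ≡⟨ cong (i' ⨾_) (sym (idʳ a)) ⟩
    i' ⨾ a ⨾ id _ ≡⟨ cong (λ z → i' ⨾ a ⨾ z) (sym p') ⟩
    i' ⨾ a ⨾ j ⨾ j' ≡⟨ cong (i' ⨾_) (sym (assoc a j j')) ⟩
    i' ⨾ (a ⨾ j) ⨾ j' ≡⟨ cong (λ z → i' ⨾ z ⨾ j') e ⟩
    i' ⨾ (i ⨾ b) ⨾ j' ≡⟨ cong (i' ⨾_) (assoc i b j') ⟩
    i' ⨾ i ⨾ b ⨾ j' ≡⟨ cancelˡ q ⟩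
    b ⨾ j' ∎

  iso-⊗ : {i : Hom A C} {i' : Hom C A} {j : Hom D E} {j' : Hom E D} →
          Iso i i' → Iso j j' → Iso (i ⊗₁ j) (i' ⊗₁ j')
  iso-⊗ {i = i} {i'} {j} {j'} (p , q) (p' , q') =
    trans (sym (⊗-⨾ i i' j j')) (trans (cong₂ _⊗₁_ p p') id⊗id) ,
    trans (sym (⊗-⨾ i' i j' j)) (trans (cong₂ _⊗₁_ q q') id⊗id)

  iso-id : Iso (id A) (id A)
  iso-id = idˡ _ , idˡ _

  isoα : Iso (α⇒ A C D) (α⇐ A C D)
  isoα = α-iso₁ _ _ _ , α-iso₂ _ _ _

  isoα⇐ : Iso (α⇐ A C D) (α⇒ A C D)
  isoα⇐ = iso-sym isoα

  isoλ : Iso (λ⇒ A) (λ⇐ A)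
  isoλ = unitˡ-iso₁ _ , unitˡ-iso₂ _

  isoρ : Iso (ρ⇒ A) (ρ⇐ A)
  isoρ = unitʳ-iso₁ _ , unitʳ-iso₂ _

  isob : Iso (braid A C) (braid C A)
  isob = braid-inv _ _ , braid-inv _ _

  α⇐-natural : (f : Hom A A') (g : Hom C C') (h : Hom D E) →
               (f ⊗₁ (g ⊗₁ h)) ⨾ α⇐ A' C' E ≡ α⇐ A C D ⨾ ((f ⊗₁ g) ⊗₁ h)
  α⇐-natural f g h = sym (iso-swap isoα isoα (α-natural f g h))

  α⇐-natural-id : (f : Hom A A') → (f ⊗₁ id (C ⊗₀ D)) ⨾ α⇐ A' C D ≡ α⇐ A C D ⨾ ((f ⊗₁ id C) ⊗₁ id D)
  α⇐-natural-id {C = C} {D} f = trans (cong (λ z → (f ⊗₁ z) ⨾ _) (sym id⊗id)) (α⇐-natural f (id C) (id D))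

  α⇒-natural-id : (f : Hom A A') → ((f ⊗₁ id C) ⊗₁ id D) ⨾ α⇒ A' C D ≡ α⇒ A C D ⨾ (f ⊗₁ id (C ⊗₀ D))
  α⇒-natural-id {C = C} {D} f = trans (α-natural f (id C) (id D)) (cong (λ z → _ ⨾ (f ⊗₁ z)) id⊗id)

  λ⇐-natural : (f : Hom A C) → f ⨾ λ⇐ C ≡ λ⇐ A ⨾ (id I ⊗₁ f)
  λ⇐-natural f = sym (iso-swap isoλ isoλ (unitˡ-natural f))

  ρ⇐-natural : (f : Hom A C) → f ⨾ ρ⇐ C ≡ ρ⇐ A ⨾ (f ⊗₁ id I)
  ρ⇐-natural f = sym (iso-swap isoρ isoρ (unitʳ-natural f))

  I⊗-injective : {f g : Hom A C} → id I ⊗₁ f ≡ id I ⊗₁ g → f ≡ g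
  I⊗-injective {f = f} {g} e = iso-cancelˡ isoλ (trans (sym (unitˡ-natural f)) (trans (cong (_⨾ λ⇒ _) e) (unitˡ-natural g)))

  ⊗I-injective : {f g : Hom A C} → f ⊗₁ id I ≡ g ⊗₁ id I → f ≡ g
  ⊗I-injective {f = f} {g} e = iso-cancelˡ isoρ (trans (sym (unitʳ-natural f)) (trans (cong (_⨾ ρ⇒ _) e) (unitʳ-natural g)))

  -- Kelly: after I ⊗ -, which is faithful, both sides agree by the pentagon at (I, I, A, C) and
  -- two triangles.
  α⇒-λ⇒ : ∀ A C → α⇒ I A C ⨾ λ⇒ (A ⊗₀ C) ≡ λ⇒ A ⊗₁ id C
  α⇒-λ⇒ A C = I⊗-injective (iso-cancelˡ isoα (iso-cancelˡ (iso-⊗ isoα iso-id) main))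
    where
    P1 : Hom (((I ⊗₀ I) ⊗₀ A) ⊗₀ C) ((I ⊗₀ (I ⊗₀ A)) ⊗₀ C)
    P1 = α⇒ I I A ⊗₁ id C
    P2 : Hom ((I ⊗₀ (I ⊗₀ A)) ⊗₀ C) (I ⊗₀ ((I ⊗₀ A) ⊗₀ C))
    P2 = α⇒ I (I ⊗₀ A) C
    main : P1 ⨾ P2 ⨾ (id I ⊗₁ (α⇒ I A C ⨾ λ⇒ (A ⊗₀ C)))
         ≡ P1 ⨾ P2 ⨾ (id I ⊗₁ (λ⇒ A ⊗₁ id C))
    main = begin
      P1 ⨾ P2 ⨾ (id I ⊗₁ (α⇒ I A C ⨾ λ⇒ (A ⊗₀ C)))
        ≡⟨ cong (λ z → P1 ⨾ P2 ⨾ z) (sym (id⊗-⨾ _ _)) ⟩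
      P1 ⨾ P2 ⨾ (id I ⊗₁ α⇒ I A C) ⨾ (id I ⊗₁ λ⇒ (A ⊗₀ C))
        ≡⟨ cong (P1 ⨾_) (sym (assoc _ _ _)) ⟩
      P1 ⨾ (P2 ⨾ (id I ⊗₁ α⇒ I A C)) ⨾ (id I ⊗₁ λ⇒ (A ⊗₀ C))
        ≡⟨ sym (assoc _ _ _) ⟩
      (P1 ⨾ P2 ⨾ (id I ⊗₁ α⇒ I A C)) ⨾ (id I ⊗₁ λ⇒ (A ⊗₀ C))
        ≡⟨ cong (_⨾ (id I ⊗₁ λ⇒ (A ⊗₀ C))) (pentagon I I A C) ⟩
      (α⇒ (I ⊗₀ I) A C ⨾ α⇒ I I (A ⊗₀ C)) ⨾ (id I ⊗₁ λ⇒ (A ⊗₀ C))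
        ≡⟨ assoc _ _ _ ⟩
      α⇒ (I ⊗₀ I) A C ⨾ α⇒ I I (A ⊗₀ C) ⨾ (id I ⊗₁ λ⇒ (A ⊗₀ C))
        ≡⟨ cong (α⇒ (I ⊗₀ I) A C ⨾_) (triangle I (A ⊗₀ C)) ⟩
      α⇒ (I ⊗₀ I) A C ⨾ (ρ⇒ I ⊗₁ id (A ⊗₀ C))
        ≡⟨ cong (λ z → α⇒ (I ⊗₀ I) A C ⨾ (ρ⇒ I ⊗₁ z)) (sym id⊗id) ⟩
      α⇒ (I ⊗₀ I) A C ⨾ (ρ⇒ I ⊗₁ (id A ⊗₁ id C))
        ≡⟨ sym (α-natural _ _ _) ⟩
      ((ρ⇒ I ⊗₁ id A) ⊗₁ id C) ⨾ α⇒ I A C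
        ≡⟨ cong (λ z → (z ⊗₁ id C) ⨾ α⇒ I A C) (sym (triangle I A)) ⟩
      ((α⇒ I I A ⨾ (id I ⊗₁ λ⇒ A)) ⊗₁ id C) ⨾ α⇒ I A C
        ≡⟨ cong (_⨾ α⇒ I A C) (sym (⊗id-⨾ _ _)) ⟩
      (P1 ⨾ ((id I ⊗₁ λ⇒ A) ⊗₁ id C)) ⨾ α⇒ I A C
        ≡⟨ assoc _ _ _ ⟩
      P1 ⨾ ((id I ⊗₁ λ⇒ A) ⊗₁ id C) ⨾ α⇒ I A C
        ≡⟨ cong (P1 ⨾_) (α-natural _ _ _) ⟩
      P1 ⨾ P2 ⨾ (id I ⊗₁ (λ⇒ A ⊗₁ id C)) ∎

  α⇐-λ⇒ : ∀ A C → α⇐ I A C ⨾ (λ⇒ A ⊗₁ id C) ≡ λ⇒ (A ⊗₀ C)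
  α⇐-λ⇒ A C = trans (cong (α⇐ I A C ⨾_) (sym (α⇒-λ⇒ A C))) (cancelˡ (α-iso₂ _ _ _))

  λ⇐-α⇐ : ∀ A C → λ⇐ (A ⊗₀ C) ⨾ α⇐ I A C ≡ λ⇐ A ⊗₁ id C
  λ⇐-α⇐ A C = inverse-unique (iso-⊗ isoλ iso-id) (trans (assoc _ _ _) (trans (cong (λ⇐ (A ⊗₀ C) ⨾_) (α⇐-λ⇒ A C)) (unitˡ-iso₂ _)))

  λ⇒-I⊗ : ∀ A → λ⇒ (I ⊗₀ A) ≡ id I ⊗₁ λ⇒ A
  λ⇒-I⊗ A = sym (iso-cancelʳ isoλ (unitˡ-natural (λ⇒ A)))

  λ⇒I≡ρ⇒I : λ⇒ I ≡ ρ⇒ I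
  λ⇒I≡ρ⇒I = ⊗I-injective (begin
    λ⇒ I ⊗₁ id I ≡⟨ sym (α⇒-λ⇒ I I) ⟩
    α⇒ I I I ⨾ λ⇒ (I ⊗₀ I) ≡⟨ cong (α⇒ I I I ⨾_) (λ⇒-I⊗ I) ⟩
    α⇒ I I I ⨾ (id I ⊗₁ λ⇒ I) ≡⟨ triangle I I ⟩
    ρ⇒ I ⊗₁ id I ∎)

  ⊗-λ⇒I : (f : Hom A I) (g : Hom C I) → (f ⊗₁ g) ⨾ λ⇒ I ≡ (id A ⊗₁ g) ⨾ ρ⇒ A ⨾ f
  ⊗-λ⇒I {A} f g = begin
    (f ⊗₁ g) ⨾ λ⇒ I ≡⟨ trans (⨾-congˡ (serialize₂₁ f g)) (assoc _ _ _) ⟩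
    (id A ⊗₁ g) ⨾ (f ⊗₁ id I) ⨾ λ⇒ I ≡⟨ cong (λ z → (id A ⊗₁ g) ⨾ (f ⊗₁ id I) ⨾ z) λ⇒I≡ρ⇒I ⟩
    (id A ⊗₁ g) ⨾ (f ⊗₁ id I) ⨾ ρ⇒ I ≡⟨ cong ((id A ⊗₁ g) ⨾_) (unitʳ-natural f) ⟩
    (id A ⊗₁ g) ⨾ ρ⇒ A ⨾ f ∎

  triangle⇐ : ∀ X Y → (id X ⊗₁ λ⇐ Y) ⨾ α⇐ X I Y ≡ ρ⇐ X ⊗₁ id Y
  triangle⇐ X Y = inverse-unique (iso-⊗ isoρ iso-id) (begin
    ((id X ⊗₁ λ⇐ Y) ⨾ α⇐ X I Y) ⨾ (ρ⇒ X ⊗₁ id Y) ≡⟨ trans (assoc _ _ _) (cong (λ z → (id X ⊗₁ λ⇐ Y) ⨾ α⇐ X I Y ⨾ z) (sym (triangle X Y))) ⟩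
    (id X ⊗₁ λ⇐ Y) ⨾ α⇐ X I Y ⨾ α⇒ X I Y ⨾ (id X ⊗₁ λ⇒ Y) ≡⟨ cong ((id X ⊗₁ λ⇐ Y) ⨾_) (cancelˡ (α-iso₂ _ _ _)) ⟩
    (id X ⊗₁ λ⇐ Y) ⨾ (id X ⊗₁ λ⇒ Y) ≡⟨ trans (id⊗-⨾ _ _) (trans (cong (id X ⊗₁_) (unitˡ-iso₂ Y)) id⊗id) ⟩
    id _ ∎)

  pentagon⇐ : ∀ X Y Z W → α⇐ X (Y ⊗₀ Z) W ⨾ (α⇐ X Y Z ⊗₁ id W) ⨾ α⇒ (X ⊗₀ Y) Z W
                    ≡ (id X ⊗₁ α⇒ Y Z W) ⨾ α⇐ X Y (Z ⊗₀ W)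
  pentagon⇐ X Y Z W = iso-cancelˡ isoα (iso-cancelˡ (iso-⊗ isoα iso-id) (trans l (sym rr)))
    where
    a1 : Hom (((X ⊗₀ Y) ⊗₀ Z) ⊗₀ W) ((X ⊗₀ (Y ⊗₀ Z)) ⊗₀ W)
    a1 = α⇒ X Y Z ⊗₁ id W
    a2 : Hom ((X ⊗₀ (Y ⊗₀ Z)) ⊗₀ W) (X ⊗₀ ((Y ⊗₀ Z) ⊗₀ W))
    a2 = α⇒ X (Y ⊗₀ Z) W
    l : a1 ⨾ a2 ⨾ α⇐ X (Y ⊗₀ Z) W ⨾ (α⇐ X Y Z ⊗₁ id W) ⨾ α⇒ (X ⊗₀ Y) Z W ≡ α⇒ (X ⊗₀ Y) Z W
    l = trans (cong (a1 ⨾_) (cancelˡ (α-iso₁ _ _ _)))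
         (cancelˡ (trans (⊗id-⨾ _ _) (trans (cong (_⊗₁ id W) (α-iso₁ _ _ _)) id⊗id)))
    rr : a1 ⨾ a2 ⨾ (id X ⊗₁ α⇒ Y Z W) ⨾ α⇐ X Y (Z ⊗₀ W) ≡ α⇒ (X ⊗₀ Y) Z W
    rr = begin
      a1 ⨾ a2 ⨾ (id X ⊗₁ α⇒ Y Z W) ⨾ α⇐ X Y (Z ⊗₀ W) ≡⟨ pullˡ³ (pentagon X Y Z W) ⟩
      (α⇒ (X ⊗₀ Y) Z W ⨾ α⇒ X Y (Z ⊗₀ W)) ⨾ α⇐ X Y (Z ⊗₀ W) ≡⟨ trans (assoc _ _ _) (cong (α⇒ (X ⊗₀ Y) Z W ⨾_) (α-iso₁ _ _ _)) ⟩
      α⇒ (X ⊗₀ Y) Z W ⨾ id _ ≡⟨ idʳ _ ⟩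
      α⇒ (X ⊗₀ Y) Z W ∎

  slide : {P Q R M S N : Obj} {a : Hom P Q} {s : Hom Q R} {t : Hom R S}
          {s' : Hom P M} {b : Hom M R} {t' : Hom M N} {c : Hom N S} →
          a ⨾ s ≡ s' ⨾ b → b ⨾ t ≡ t' ⨾ c → a ⨾ (s ⨾ t) ≡ (s' ⨾ t') ⨾ c
  slide {a = a} {s} {t} {s'} {b} {t'} {c} p q = begin
    a ⨾ s ⨾ t ≡⟨ pullˡ p ⟩
    (s' ⨾ b) ⨾ t ≡⟨ assoc _ _ _ ⟩
    s' ⨾ b ⨾ t ≡⟨ cong (s' ⨾_) q ⟩
    s' ⨾ t' ⨾ c ≡⟨ sym (assoc _ _ _) ⟩
    (s' ⨾ t') ⨾ c ∎

  ⊗-slideʳ : {x : Hom C D} {y : Hom D E} {y' : Hom C D'} {x' : Hom D' E} (f : Hom A A') →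
             x ⨾ y ≡ y' ⨾ x' → (f ⊗₁ x) ⨾ (id A' ⊗₁ y) ≡ (id A ⊗₁ y') ⨾ (f ⊗₁ x')
  ⊗-slideʳ {x = x} {y} {y'} {x'} f p = begin
    (f ⊗₁ x) ⨾ (id _ ⊗₁ y) ≡⟨ sym (⊗-⨾ _ _ _ _) ⟩
    (f ⨾ id _) ⊗₁ (x ⨾ y) ≡⟨ cong₂ _⊗₁_ (trans (idʳ f) (sym (idˡ f))) p ⟩
    (id _ ⨾ f) ⊗₁ (y' ⨾ x') ≡⟨ ⊗-⨾ _ _ _ _ ⟩
    (id _ ⊗₁ y') ⨾ (f ⊗₁ x') ∎

  ⊗-slideˡ : {x : Hom C D} {y : Hom D E} {y' : Hom C D'} {x' : Hom D' E} (f : Hom A A') →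
             x ⨾ y ≡ y' ⨾ x' → (x ⊗₁ f) ⨾ (y ⊗₁ id A') ≡ (y' ⊗₁ id A) ⨾ (x' ⊗₁ f)
  ⊗-slideˡ {x = x} {y} {y'} {x'} f p = begin
    (x ⊗₁ f) ⨾ (y ⊗₁ id _) ≡⟨ sym (⊗-⨾ _ _ _ _) ⟩
    (x ⨾ y) ⊗₁ (f ⨾ id _) ≡⟨ cong₂ _⊗₁_ p (trans (idʳ f) (sym (idˡ f))) ⟩
    (y' ⨾ x') ⊗₁ (id _ ⨾ f) ≡⟨ ⊗-⨾ _ _ _ _ ⟩
    (y' ⊗₁ id _) ⨾ (x' ⊗₁ f) ∎

  σ : ∀ A C D E → Hom ((A ⊗₀ C) ⊗₀ (D ⊗₀ E)) ((A ⊗₀ D) ⊗₀ (C ⊗₀ E))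
  σ A C D E = α⇒ A C (D ⊗₀ E) ⨾ (id A ⊗₁ α⇐ C D E) ⨾ (id A ⊗₁ (braid C D ⊗₁ id E))
              ⨾ (id A ⊗₁ α⇒ D C E) ⨾ α⇐ A D (C ⊗₀ E)

  σ-natural : {A C D E A' C' D' E' : Obj} (f : Hom A A') (g : Hom C C') (h : Hom D D') (k : Hom E E') →
              ((f ⊗₁ g) ⊗₁ (h ⊗₁ k)) ⨾ σ A' C' D' E' ≡ σ A C D E ⨾ ((f ⊗₁ h) ⊗₁ (g ⊗₁ k))
  σ-natural f g h k =
    slide (α-natural f g (h ⊗₁ k))
   (slide (⊗-slideʳ f (α⇐-natural g h k))
   (slide (⊗-slideʳ f (⊗-slideˡ k (braid-natural g h)))
   (slide (⊗-slideʳ f (α-natural h g k))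
          (α⇐-natural f h (g ⊗₁ k)))))

module Adjoints {o ℓ r : Level} (𝔹 : CartesianBicategory o ℓ r) where
  open MonoidalLemmas 𝔹 public
  open ≡-Reasoning

  private variable
    A C D E X : Obj

  infixr 2 _≤⟨_⟩_ _≡≤⟨_⟩_
  infix 3 _∎≤
  _≤⟨_⟩_ : (f : Hom A C) {g h : Hom A C} → f ≤ g → g ≤ h → f ≤ h
  f ≤⟨ p ⟩ q = ≤-trans p q
  _≡≤⟨_⟩_ : (f : Hom A C) {g h : Hom A C} → f ≡ g → g ≤ h → f ≤ h
  f ≡≤⟨ refl ⟩ q = q
  _∎≤ : (f : Hom A C) → f ≤ f
  f ∎≤ = ≤-refl f

  ≤-pre : (h : Hom A C) {f g : Hom C D} → f ≤ g → h ⨾ f ≤ h ⨾ g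
  ≤-pre h p = ⨾-mono (≤-refl h) p

  ≤-post : (h : Hom C D) {f g : Hom A C} → f ≤ g → f ⨾ h ≤ g ⨾ h
  ≤-post h p = ⨾-mono p (≤-refl h)

  ≡⇒≤ : {f g : Hom A C} → f ≡ g → f ≤ g
  ≡⇒≤ {f = f} refl = ≤-refl f

  _⊣_ : Hom A C → Hom C A → Set r
  f ⊣ g = (id _ ≤ f ⨾ g) × (g ⨾ f ≤ id _)

  ⊣-unique : {f : Hom A C} {g g' : Hom C A} → f ⊣ g → f ⊣ g' → g ≡ g'
  ⊣-unique {f = f} {g} {g'} (u , c) (u' , c') = ≤-antisym (below c u') (below c' u)
    where
    below : {h h' : Hom _ _} → h ⨾ f ≤ id _ → id _ ≤ f ⨾ h' → h ≤ h'
    below {h} {h'} counit unit =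
      h ≡≤⟨ sym (idʳ h) ⟩
      h ⨾ id _ ≤⟨ ≤-pre h unit ⟩
      h ⨾ f ⨾ h' ≡≤⟨ sym (assoc h f h') ⟩
      (h ⨾ f) ⨾ h' ≤⟨ ≤-post h' counit ⟩
      id _ ⨾ h' ≡≤⟨ idˡ h' ⟩
      h' ∎≤

  ⊣-⨾ : {f : Hom A C} {g : Hom C A} {f' : Hom C D} {g' : Hom D C} →
          f ⊣ g → f' ⊣ g' → (f ⨾ f') ⊣ (g' ⨾ g)
  ⊣-⨾ {f = f} {g} {f'} {g'} (u , c) (u' , c') =
    (id _ ≤⟨ u ⟩
     f ⨾ g ≡≤⟨ cong (f ⨾_) (sym (idˡ g)) ⟩
     f ⨾ id _ ⨾ g ≤⟨ ≤-pre f (≤-post g u') ⟩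
     f ⨾ (f' ⨾ g') ⨾ g ≡≤⟨ trans (cong (f ⨾_) (assoc f' g' g)) (sym (assoc f f' (g' ⨾ g))) ⟩
     (f ⨾ f') ⨾ g' ⨾ g ∎≤) ,
    ((g' ⨾ g) ⨾ f ⨾ f' ≡≤⟨ trans (assoc g' g (f ⨾ f')) (cong (g' ⨾_) (sym (assoc g f f'))) ⟩
     g' ⨾ (g ⨾ f) ⨾ f' ≤⟨ ≤-pre g' (≤-post f' c) ⟩
     g' ⨾ id _ ⨾ f' ≡≤⟨ cong (g' ⨾_) (idˡ f') ⟩
     g' ⨾ f' ≤⟨ c' ⟩
     id _ ∎≤)

  ⊣-⊗ : {f : Hom A C} {g : Hom C A} {f' : Hom D E} {g' : Hom E D} →
          f ⊣ g → f' ⊣ g' → (f ⊗₁ f') ⊣ (g ⊗₁ g')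
  ⊣-⊗ {f = f} {g} {f'} {g'} (u , c) (u' , c') =
    (id _ ≡≤⟨ sym id⊗id ⟩
     id _ ⊗₁ id _ ≤⟨ ⊗-mono u u' ⟩
     (f ⨾ g) ⊗₁ (f' ⨾ g') ≡≤⟨ ⊗-⨾ f g f' g' ⟩
     (f ⊗₁ f') ⨾ (g ⊗₁ g') ∎≤) ,
    ((g ⊗₁ g') ⨾ (f ⊗₁ f') ≡≤⟨ sym (⊗-⨾ g f g' f') ⟩
     (g ⨾ f) ⊗₁ (g' ⨾ f') ≤⟨ ⊗-mono c c' ⟩
     id _ ⊗₁ id _ ≡≤⟨ id⊗id ⟩
     id _ ∎≤)

  iso⇒⊣ : {i : Hom A C} {j : Hom C A} → Iso i j → i ⊣ j
  iso⇒⊣ (p , q) = ≡⇒≤ (sym p) , ≡⇒≤ q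

  ⊣-resp-≡ : {f f' : Hom A C} {g : Hom C A} → f ≡ f' → f ⊣ g → f' ⊣ g
  ⊣-resp-≡ refl a = a

  ⊣-id : id A ⊣ id A
  ⊣-id = iso⇒⊣ iso-id

  d⊣d* : d X ⊣ d* X
  d⊣d* = d-unit _ , d-counit _

  e⊣e* : e X ⊣ e* X
  e⊣e* = e-unit _ , e-counit _

  -- Each law of d* is the mate of the corresponding law of d, since right adjoints compose and
  -- are unique.
  d*-unitʳ : ∀ X → ρ⇐ X ⨾ (id X ⊗₁ e* X) ⨾ d* X ≡ id X
  d*-unitʳ X = trans (sym (assoc _ _ _)) (sym (⊣-unique ⊣-id
             (⊣-resp-≡ (d-unitʳ X) (⊣-⨾ d⊣d* (⊣-⨾ (⊣-⊗ ⊣-id e⊣e*) (iso⇒⊣ isoρ))))))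

  d*-unitˡ : ∀ X → λ⇐ X ⨾ (e* X ⊗₁ id X) ⨾ d* X ≡ id X
  d*-unitˡ X = trans (sym (assoc _ _ _)) (sym (⊣-unique ⊣-id
             (⊣-resp-≡ (d-unitˡ X) (⊣-⨾ d⊣d* (⊣-⨾ (⊣-⊗ e⊣e* ⊣-id) (iso⇒⊣ isoλ))))))

  d*-comm : ∀ X → braid X X ⨾ d* X ≡ d* X
  d*-comm X = ⊣-unique (⊣-resp-≡ (d-comm X) (⊣-⨾ d⊣d* (iso⇒⊣ isob))) d⊣d*

  d*-assoc : ∀ X → α⇐ X X X ⨾ (d* X ⊗₁ id X) ⨾ d* X ≡ (id X ⊗₁ d* X) ⨾ d* X
  d*-assoc X = trans (sym (assoc _ _ _)) (⊣-unique
     (⊣-resp-≡ (d-assoc X) (⊣-⨾ d⊣d* (⊣-⨾ (⊣-⊗ d⊣d* ⊣-id) (iso⇒⊣ isoα))))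
     (⊣-⨾ d⊣d* (⊣-⊗ ⊣-id d⊣d*)))

module Maps {o ℓ r : Level} (𝔹 : CartesianBicategory o ℓ r) where
  open Adjoints 𝔹 public
  open LRConstruction 𝔹 public using (π₁; π₂; ⟨_,_⟩)
  open ≡-Reasoning

  private variable
    A C D E W X Y Z : Obj

  IsMap : Hom A C → Set ℓ
  IsMap {A} {C} f = (f ⨾ d C ≡ d A ⨾ (f ⊗₁ f)) × (f ⨾ e C ≡ e A)

  total : {f : Hom A C} → IsMap f → f ⨾ e C ≡ e A
  total = proj₂

  iso⇒map : {i : Hom A C} {j : Hom C A} → Iso i j → IsMap i
  iso⇒map {A} {C} {i} {j} (p , q) =
    ≤-antisym (d-lax i)
      (d A ⨾ (i ⊗₁ i) ≡≤⟨ sym (cancelˡ p) ⟩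
       i ⨾ j ⨾ d A ⨾ (i ⊗₁ i) ≤⟨ ≤-pre i (_ ≡≤⟨ sym (assoc _ _ _) ⟩ ≤-post (i ⊗₁ i) (d-lax j)) ⟩
       i ⨾ (d C ⨾ (j ⊗₁ j)) ⨾ (i ⊗₁ i) ≡≤⟨ cong (i ⨾_) (trans (assoc _ _ _)
            (cong (d C ⨾_) (trans (sym (⊗-⨾ j i j i)) (trans (cong₂ _⊗₁_ q q) id⊗id)))) ⟩
       i ⨾ d C ⨾ id _ ≡≤⟨ cong (i ⨾_) (idʳ _) ⟩
       i ⨾ d C ∎≤) ,
    ≤-antisym (e-lax i)
      (e A ≡≤⟨ sym (cancelˡ p) ⟩
       i ⨾ j ⨾ e A ≤⟨ ≤-pre i (e-lax j) ⟩
       i ⨾ e C ∎≤)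

  map-⨾ : {f : Hom A C} {g : Hom C D} → IsMap f → IsMap g → IsMap (f ⨾ g)
  map-⨾ {f = f} {g} (fd , fe) (gd , ge) =
    (begin
      (f ⨾ g) ⨾ d _ ≡⟨ assoc _ _ _ ⟩
      f ⨾ g ⨾ d _ ≡⟨ cong (f ⨾_) gd ⟩
      f ⨾ d _ ⨾ (g ⊗₁ g) ≡⟨ pullˡ fd ⟩
      (d _ ⨾ (f ⊗₁ f)) ⨾ (g ⊗₁ g) ≡⟨ trans (assoc _ _ _) (cong (d _ ⨾_) (sym (⊗-⨾ f g f g))) ⟩
      d _ ⨾ ((f ⨾ g) ⊗₁ (f ⨾ g)) ∎) ,
    trans (assoc _ _ _) (trans (cong (f ⨾_) ge) fe)

  map-id : IsMap (id A)
  map-id = iso⇒map iso-id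

  map-α : IsMap (α⇒ X Y Z)
  map-α = iso⇒map isoα

  map-α⇐ : IsMap (α⇐ X Y Z)
  map-α⇐ = iso⇒map isoα⇐

  map-braid : IsMap (braid X Y)
  map-braid = iso⇒map isob

  map-ρ : IsMap (ρ⇒ X)
  map-ρ = iso⇒map isoρ

  -- e I is idempotent and has the section d I ⨾ λ⇒ I.
  e-I : e I ≡ id I
  e-I = begin
    e I ≡⟨ sym (idˡ _) ⟩
    id I ⨾ e I ≡⟨ cong (_⨾ e I) (sym c-e) ⟩
    (c ⨾ e I) ⨾ e I ≡⟨ assoc _ _ _ ⟩
    c ⨾ e I ⨾ e I ≡⟨ cong (c ⨾_) ee ⟩
    c ⨾ e I ≡⟨ c-e ⟩
    id I ∎
    where
    u : Hom (I ⊗₀ I) I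
    u = λ⇒ I
    c : Hom I I
    c = d I ⨾ u
    ue : u ⨾ e I ≡ u ⨾ e I ⨾ e I
    ue = begin
      u ⨾ e I ≡⟨ proj₂ (iso⇒map isoλ) ⟩
      e (I ⊗₀ I) ≡⟨ e-⊗ I I ⟩
      (e I ⊗₁ e I) ⨾ u ≡⟨ cong (_⨾ u) (serialize₁₂ (e I) (e I)) ⟩
      ((e I ⊗₁ id I) ⨾ (id I ⊗₁ e I)) ⨾ u ≡⟨ trans (assoc _ _ _) (cong ((e I ⊗₁ id I) ⨾_) (unitˡ-natural (e I))) ⟩
      (e I ⊗₁ id I) ⨾ u ⨾ e I ≡⟨ cong (λ z → (e I ⊗₁ id I) ⨾ z ⨾ e I) λ⇒I≡ρ⇒I ⟩
      (e I ⊗₁ id I) ⨾ ρ⇒ I ⨾ e I ≡⟨ pullˡ (unitʳ-natural (e I)) ⟩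
      (ρ⇒ I ⨾ e I) ⨾ e I ≡⟨ cong (λ z → (z ⨾ e I) ⨾ e I) (sym λ⇒I≡ρ⇒I) ⟩
      (u ⨾ e I) ⨾ e I ≡⟨ assoc _ _ _ ⟩
      u ⨾ e I ⨾ e I ∎
    ee : e I ⨾ e I ≡ e I
    ee = sym (iso-cancelˡ isoλ ue)
    c-e : c ⨾ e I ≡ id I
    c-e = begin
      (d I ⨾ u) ⨾ e I ≡⟨ assoc _ _ _ ⟩
      d I ⨾ u ⨾ e I ≡⟨ cong (λ z → d I ⨾ z ⨾ e I) λ⇒I≡ρ⇒I ⟩
      d I ⨾ ρ⇒ I ⨾ e I ≡⟨ cong (d I ⨾_) (sym (unitʳ-natural (e I))) ⟩
      d I ⨾ (e I ⊗₁ id I) ⨾ ρ⇒ I ≡⟨ cong (λ z → d I ⨾ (e I ⊗₁ id I) ⨾ z) (sym λ⇒I≡ρ⇒I) ⟩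
      d I ⨾ (e I ⊗₁ id I) ⨾ u ≡⟨ d-unitˡ I ⟩
      id I ∎

  d-I : d I ≡ λ⇐ I
  d-I = inverse-unique isoλ (begin
    d I ⨾ λ⇒ I ≡⟨ cong (d I ⨾_) (sym (trans (⨾-congˡ id⊗id) (idˡ _))) ⟩
    d I ⨾ (id I ⊗₁ id I) ⨾ λ⇒ I ≡⟨ cong (λ z → d I ⨾ (z ⊗₁ id I) ⨾ λ⇒ I) (sym e-I) ⟩
    d I ⨾ (e I ⊗₁ id I) ⨾ λ⇒ I ≡⟨ d-unitˡ I ⟩
    id I ∎)

  d-unitʳ⇐ : ∀ X → d X ⨾ (id X ⊗₁ e X) ≡ ρ⇐ X
  d-unitʳ⇐ X = inverse-unique isoρ (trans (assoc _ _ _) (d-unitʳ X))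

  d-unitˡ⇐ : ∀ X → d X ⨾ (e X ⊗₁ id X) ≡ λ⇐ X
  d-unitˡ⇐ X = inverse-unique isoλ (trans (assoc _ _ _) (d-unitˡ X))

  braid-ρ⇒ : ∀ X → braid I X ⨾ ρ⇒ X ≡ λ⇒ X
  braid-ρ⇒ X = iso-cancelˡ (iso-sym isoλ) (begin
    λ⇐ X ⨾ braid I X ⨾ ρ⇒ X ≡⟨ ⨾-congˡ (sym (d-unitˡ⇐ X)) ⟩
    (d X ⨾ (e X ⊗₁ id X)) ⨾ braid I X ⨾ ρ⇒ X ≡⟨ assoc _ _ _ ⟩
    d X ⨾ (e X ⊗₁ id X) ⨾ braid I X ⨾ ρ⇒ X ≡⟨ cong (d X ⨾_) (pullˡ (braid-natural (e X) (id X))) ⟩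
    d X ⨾ (braid X X ⨾ (id X ⊗₁ e X)) ⨾ ρ⇒ X ≡⟨ cong (d X ⨾_) (assoc _ _ _) ⟩
    d X ⨾ braid X X ⨾ (id X ⊗₁ e X) ⨾ ρ⇒ X ≡⟨ pullˡ (d-comm X) ⟩
    d X ⨾ (id X ⊗₁ e X) ⨾ ρ⇒ X ≡⟨ d-unitʳ X ⟩
    id X ≡⟨ sym (unitˡ-iso₂ X) ⟩
    λ⇐ X ⨾ λ⇒ X ∎)

  braid-λ⇒ : ∀ X → braid X I ⨾ λ⇒ X ≡ ρ⇒ X
  braid-λ⇒ X = iso-cancelˡ (iso-sym isoρ) (begin
    ρ⇐ X ⨾ braid X I ⨾ λ⇒ X ≡⟨ ⨾-congˡ (sym (d-unitʳ⇐ X)) ⟩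
    (d X ⨾ (id X ⊗₁ e X)) ⨾ braid X I ⨾ λ⇒ X ≡⟨ assoc _ _ _ ⟩
    d X ⨾ (id X ⊗₁ e X) ⨾ braid X I ⨾ λ⇒ X ≡⟨ cong (d X ⨾_) (pullˡ (braid-natural (id X) (e X))) ⟩
    d X ⨾ (braid X X ⨾ (e X ⊗₁ id X)) ⨾ λ⇒ X ≡⟨ cong (d X ⨾_) (assoc _ _ _) ⟩
    d X ⨾ braid X X ⨾ (e X ⊗₁ id X) ⨾ λ⇒ X ≡⟨ pullˡ (d-comm X) ⟩
    d X ⨾ (e X ⊗₁ id X) ⨾ λ⇒ X ≡⟨ d-unitˡ X ⟩
    id X ≡⟨ sym (unitʳ-iso₂ X) ⟩
    ρ⇐ X ⨾ ρ⇒ X ∎)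

  braid-id⊗-ρ⇒ : (h : Hom A I) → braid A X ⨾ (id X ⊗₁ h) ⨾ ρ⇒ X ≡ (h ⊗₁ id X) ⨾ λ⇒ X
  braid-id⊗-ρ⇒ {X = X} h = trans (pullˡ (sym (braid-natural h (id X)))) (trans (assoc _ _ _) (cong ((h ⊗₁ id X) ⨾_) (braid-ρ⇒ X)))

  braid-I-I : braid I I ≡ id (I ⊗₀ I)
  braid-I-I = iso-cancelʳ isoρ (trans (braid-ρ⇒ I) (trans λ⇒I≡ρ⇒I (sym (idˡ _))))

  map-⊗ : {f : Hom A X} {g : Hom C Y} → IsMap f → IsMap g → IsMap (f ⊗₁ g)
  map-⊗ {A} {X} {C} {Y} {f} {g} (fd , fe) (gd , ge) =
    (begin
      (f ⊗₁ g) ⨾ d (X ⊗₀ Y) ≡⟨ cong ((f ⊗₁ g) ⨾_) (d-⊗ X Y) ⟩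
      (f ⊗₁ g) ⨾ (d X ⊗₁ d Y) ⨾ σ X X Y Y ≡⟨ pullˡ (sym (⊗-⨾ f (d X) g (d Y))) ⟩
      ((f ⨾ d X) ⊗₁ (g ⨾ d Y)) ⨾ σ X X Y Y ≡⟨ cong (_⨾ σ X X Y Y) (cong₂ _⊗₁_ fd gd) ⟩
      ((d A ⨾ (f ⊗₁ f)) ⊗₁ (d C ⨾ (g ⊗₁ g))) ⨾ σ X X Y Y ≡⟨ cong (_⨾ σ X X Y Y) (⊗-⨾ _ _ _ _) ⟩
      ((d A ⊗₁ d C) ⨾ ((f ⊗₁ f) ⊗₁ (g ⊗₁ g))) ⨾ σ X X Y Y ≡⟨ assoc _ _ _ ⟩
      (d A ⊗₁ d C) ⨾ ((f ⊗₁ f) ⊗₁ (g ⊗₁ g)) ⨾ σ X X Y Y ≡⟨ cong ((d A ⊗₁ d C) ⨾_) (σ-natural f f g g) ⟩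
      (d A ⊗₁ d C) ⨾ σ A A C C ⨾ ((f ⊗₁ g) ⊗₁ (f ⊗₁ g)) ≡⟨ sym (assoc _ _ _) ⟩
      ((d A ⊗₁ d C) ⨾ σ A A C C) ⨾ ((f ⊗₁ g) ⊗₁ (f ⊗₁ g)) ≡⟨ cong (_⨾ ((f ⊗₁ g) ⊗₁ (f ⊗₁ g))) (sym (d-⊗ A C)) ⟩
      d (A ⊗₀ C) ⨾ ((f ⊗₁ g) ⊗₁ (f ⊗₁ g)) ∎) ,
    (begin
      (f ⊗₁ g) ⨾ e (X ⊗₀ Y) ≡⟨ cong ((f ⊗₁ g) ⨾_) (e-⊗ X Y) ⟩
      (f ⊗₁ g) ⨾ (e X ⊗₁ e Y) ⨾ λ⇒ I ≡⟨ pullˡ (trans (sym (⊗-⨾ _ _ _ _)) (cong₂ _⊗₁_ fe ge)) ⟩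
      (e A ⊗₁ e C) ⨾ λ⇒ I ≡⟨ sym (e-⊗ A C) ⟩
      e (A ⊗₀ C) ∎)

  map-e : IsMap (e X)
  map-e {X} =
    (begin
      e X ⨾ d I ≡⟨ cong (e X ⨾_) d-I ⟩
      e X ⨾ λ⇐ I ≡⟨ λ⇐-natural (e X) ⟩
      λ⇐ X ⨾ (id I ⊗₁ e X) ≡⟨ cong (_⨾ (id I ⊗₁ e X)) (sym (d-unitˡ⇐ X)) ⟩
      (d X ⨾ (e X ⊗₁ id X)) ⨾ (id I ⊗₁ e X) ≡⟨ trans (assoc _ _ _) (cong (d X ⨾_) (sym (serialize₁₂ _ _))) ⟩
      d X ⨾ (e X ⊗₁ e X) ∎) ,
    trans (cong (e X ⨾_) e-I) (idʳ _)

  d-assoc⇐ : ∀ X → d X ⨾ (id X ⊗₁ d X) ⨾ α⇐ X X X ≡ d X ⨾ (d X ⊗₁ id X)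
  d-assoc⇐ X = begin
    d X ⨾ (id X ⊗₁ d X) ⨾ α⇐ X X X ≡⟨ pullˡ (sym (d-assoc X)) ⟩
    (d X ⨾ (d X ⊗₁ id X) ⨾ α⇒ X X X) ⨾ α⇐ X X X ≡⟨ trans (assoc _ _ _) (cong (d X ⨾_) (trans (assoc _ _ _) (cong ((d X ⊗₁ id X) ⨾_) (α-iso₁ X X X)))) ⟩
    d X ⨾ (d X ⊗₁ id X) ⨾ id _ ≡⟨ cong (d X ⨾_) (idʳ _) ⟩
    d X ⨾ (d X ⊗₁ id X) ∎

  d-reassoc⁴ : ∀ X → d X ⨾ (d X ⊗₁ d X) ⨾ α⇒ X X (X ⊗₀ X) ⨾ (id X ⊗₁ α⇐ X X X)
                   ≡ d X ⨾ (id X ⊗₁ (d X ⨾ (d X ⊗₁ id X)))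
  d-reassoc⁴ X = begin
    d X ⨾ (d X ⊗₁ d X) ⨾ α⇒ X X (X ⊗₀ X) ⨾ (id X ⊗₁ α⇐ X X X)
      ≡⟨ sym (assoc _ _ _) ⟩
    (d X ⨾ (d X ⊗₁ d X)) ⨾ α⇒ X X (X ⊗₀ X) ⨾ (id X ⊗₁ α⇐ X X X)
      ≡⟨ cong (λ z → (d X ⨾ z) ⨾ α⇒ X X (X ⊗₀ X) ⨾ (id X ⊗₁ α⇐ X X X)) (trans (serialize₁₂ _ _) (cong (λ z → (d X ⊗₁ id X) ⨾ (z ⊗₁ d X)) (sym id⊗id))) ⟩
    (d X ⨾ (d X ⊗₁ id X) ⨾ ((id X ⊗₁ id X) ⊗₁ d X)) ⨾ α⇒ X X (X ⊗₀ X) ⨾ (id X ⊗₁ α⇐ X X X)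
      ≡⟨ trans (assoc _ _ _) (cong (d X ⨾_) (trans (assoc _ _ _) (cong ((d X ⊗₁ id X) ⨾_) (pullˡ (α-natural _ _ _))))) ⟩
    d X ⨾ (d X ⊗₁ id X) ⨾ (α⇒ X X X ⨾ (id X ⊗₁ (id X ⊗₁ d X))) ⨾ (id X ⊗₁ α⇐ X X X)
      ≡⟨ cong (λ z → d X ⨾ (d X ⊗₁ id X) ⨾ z) (assoc _ _ _) ⟩
    d X ⨾ (d X ⊗₁ id X) ⨾ α⇒ X X X ⨾ (id X ⊗₁ (id X ⊗₁ d X)) ⨾ (id X ⊗₁ α⇐ X X X)
      ≡⟨ pullˡ³ (d-assoc X) ⟩
    (d X ⨾ (id X ⊗₁ d X)) ⨾ (id X ⊗₁ (id X ⊗₁ d X)) ⨾ (id X ⊗₁ α⇐ X X X)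
      ≡⟨ trans (assoc _ _ _) (cong (d X ⨾_) (trans (cong ((id X ⊗₁ d X) ⨾_) (id⊗-⨾ _ _)) (id⊗-⨾ _ _))) ⟩
    d X ⨾ (id X ⊗₁ (d X ⨾ (id X ⊗₁ d X) ⨾ α⇐ X X X))
      ≡⟨ cong (λ z → d X ⨾ (id X ⊗₁ z)) (d-assoc⇐ X) ⟩
    d X ⨾ (id X ⊗₁ (d X ⨾ (d X ⊗₁ id X))) ∎

  d-deterministic : ∀ X → d X ⨾ d (X ⊗₀ X) ≡ d X ⨾ (d X ⊗₁ d X)
  d-deterministic X = begin
    d X ⨾ d (X ⊗₀ X) ≡⟨ cong (d X ⨾_) (d-⊗ X X) ⟩
    d X ⨾ (d X ⊗₁ d X) ⨾ σ X X X X ≡⟨ sym (assoc _ _ _) ⟩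
    D2 ⨾ α⇒ X X (X ⊗₀ X) ⨾ (id X ⊗₁ α⇐ X X X) ⨾ (id X ⊗₁ (braid X X ⊗₁ id X)) ⨾ (id X ⊗₁ α⇒ X X X) ⨾ α⇐ X X (X ⊗₀ X)
      ≡⟨ trans (cong (D2 ⨾_) (sym (assoc _ _ _))) (sym (assoc _ _ _)) ⟩
    (D2 ⨾ α⇒ X X (X ⊗₀ X) ⨾ (id X ⊗₁ α⇐ X X X)) ⨾ (id X ⊗₁ (braid X X ⊗₁ id X)) ⨾ (id X ⊗₁ α⇒ X X X) ⨾ α⇐ X X (X ⊗₀ X)
      ≡⟨ cong (_⨾ ((id X ⊗₁ (braid X X ⊗₁ id X)) ⨾ (id X ⊗₁ α⇒ X X X) ⨾ α⇐ X X (X ⊗₀ X))) E1 ⟩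
    T ⨾ (id X ⊗₁ (braid X X ⊗₁ id X)) ⨾ (id X ⊗₁ α⇒ X X X) ⨾ α⇐ X X (X ⊗₀ X)
      ≡⟨ pullˡ E2 ⟩
    T ⨾ (id X ⊗₁ α⇒ X X X) ⨾ α⇐ X X (X ⊗₀ X)
      ≡⟨ cong (_⨾ ((id X ⊗₁ α⇒ X X X) ⨾ α⇐ X X (X ⊗₀ X))) (sym E1) ⟩
    (D2 ⨾ α⇒ X X (X ⊗₀ X) ⨾ (id X ⊗₁ α⇐ X X X)) ⨾ (id X ⊗₁ α⇒ X X X) ⨾ α⇐ X X (X ⊗₀ X)
      ≡⟨ trans (assoc _ _ _) (cong (D2 ⨾_) (trans (assoc _ _ _) (cong (α⇒ X X (X ⊗₀ X) ⨾_) (pullˡ (trans (id⊗-⨾ _ _) (trans (cong (id X ⊗₁_) (α-iso₂ X X X)) id⊗id)))))) ⟩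
    D2 ⨾ α⇒ X X (X ⊗₀ X) ⨾ id _ ⨾ α⇐ X X (X ⊗₀ X)
      ≡⟨ cong (D2 ⨾_) (trans (cong (α⇒ X X (X ⊗₀ X) ⨾_) (idˡ _)) (α-iso₁ _ _ _)) ⟩
    D2 ⨾ id _ ≡⟨ idʳ _ ⟩
    D2 ∎
    where
    D2 : Hom X ((X ⊗₀ X) ⊗₀ (X ⊗₀ X))
    D2 = d X ⨾ (d X ⊗₁ d X)
    T : Hom X (X ⊗₀ ((X ⊗₀ X) ⊗₀ X))
    T = d X ⨾ (id X ⊗₁ (d X ⨾ (d X ⊗₁ id X)))
    E1 : D2 ⨾ α⇒ X X (X ⊗₀ X) ⨾ (id X ⊗₁ α⇐ X X X) ≡ T
    E1 = trans (assoc _ _ _) (d-reassoc⁴ X)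
    E2 : T ⨾ (id X ⊗₁ (braid X X ⊗₁ id X)) ≡ T
    E2 = begin
      T ⨾ (id X ⊗₁ (braid X X ⊗₁ id X)) ≡⟨ trans (assoc _ _ _) (cong (d X ⨾_) (id⊗-⨾ _ _)) ⟩
      d X ⨾ (id X ⊗₁ ((d X ⨾ (d X ⊗₁ id X)) ⨾ (braid X X ⊗₁ id X)))
        ≡⟨ cong (λ z → d X ⨾ (id X ⊗₁ z)) (trans (assoc _ _ _) (cong (d X ⨾_) (trans (⊗id-⨾ _ _) (cong (_⊗₁ id X) (d-comm X))))) ⟩
      T ∎

  d-total : ∀ X → d X ⨾ e (X ⊗₀ X) ≡ e X
  d-total X = begin
    d X ⨾ e (X ⊗₀ X) ≡⟨ cong (d X ⨾_) (e-⊗ X X) ⟩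
    d X ⨾ (e X ⊗₁ e X) ⨾ λ⇒ I ≡⟨ cong (λ z → d X ⨾ z ⨾ λ⇒ I) (serialize₁₂ _ _) ⟩
    d X ⨾ ((e X ⊗₁ id X) ⨾ (id I ⊗₁ e X)) ⨾ λ⇒ I ≡⟨ cong (d X ⨾_) (trans (assoc _ _ _) (cong ((e X ⊗₁ id X) ⨾_) (unitˡ-natural (e X)))) ⟩
    d X ⨾ (e X ⊗₁ id X) ⨾ λ⇒ X ⨾ e X ≡⟨ trans (pullˡ³ (d-unitˡ X)) (idˡ _) ⟩
    e X ∎

  map-d : IsMap (d X)
  map-d {X} = d-deterministic X , d-total X

  map-π₁ : IsMap (π₁ {X} {Y})
  map-π₁ = map-⨾ (map-⊗ map-id map-e) (iso⇒map isoρ)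

  map-π₂ : IsMap (π₂ {X} {Y})
  map-π₂ = map-⨾ (map-⊗ map-e map-id) (iso⇒map isoλ)

  map-pair : {f : Hom Z X} {g : Hom Z Y} → IsMap f → IsMap g → IsMap ⟨ f , g ⟩
  map-pair mf mg = map-⨾ map-d (map-⊗ mf mg)

  σ-I-I : σ X I I Y ≡ id _
  σ-I-I {X} {Y} = begin
    α⇒ X I (I ⊗₀ Y) ⨾ (id X ⊗₁ α⇐ I I Y) ⨾ (id X ⊗₁ (braid I I ⊗₁ id Y)) ⨾ (id X ⊗₁ α⇒ I I Y) ⨾ α⇐ X I (I ⊗₀ Y)
      ≡⟨ cong (λ z → α⇒ X I (I ⊗₀ Y) ⨾ (id X ⊗₁ α⇐ I I Y) ⨾ (id X ⊗₁ (z ⊗₁ id Y)) ⨾ (id X ⊗₁ α⇒ I I Y) ⨾ α⇐ X I (I ⊗₀ Y))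
           (trans braid-I-I (sym id⊗id)) ⟩
    α⇒ X I (I ⊗₀ Y) ⨾ (id X ⊗₁ α⇐ I I Y) ⨾ (id X ⊗₁ ((id I ⊗₁ id I) ⊗₁ id Y)) ⨾ (id X ⊗₁ α⇒ I I Y) ⨾ α⇐ X I (I ⊗₀ Y)
      ≡⟨ cong (λ z → α⇒ X I (I ⊗₀ Y) ⨾ (id X ⊗₁ α⇐ I I Y) ⨾ z ⨾ (id X ⊗₁ α⇒ I I Y) ⨾ α⇐ X I (I ⊗₀ Y))
           (trans (cong (id X ⊗₁_) (trans (cong (_⊗₁ id Y) id⊗id) id⊗id)) id⊗id) ⟩
    α⇒ X I (I ⊗₀ Y) ⨾ (id X ⊗₁ α⇐ I I Y) ⨾ id _ ⨾ (id X ⊗₁ α⇒ I I Y) ⨾ α⇐ X I (I ⊗₀ Y)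
      ≡⟨ cong (λ z → α⇒ X I (I ⊗₀ Y) ⨾ (id X ⊗₁ α⇐ I I Y) ⨾ z) (idˡ _) ⟩
    α⇒ X I (I ⊗₀ Y) ⨾ (id X ⊗₁ α⇐ I I Y) ⨾ (id X ⊗₁ α⇒ I I Y) ⨾ α⇐ X I (I ⊗₀ Y)
      ≡⟨ cong (α⇒ X I (I ⊗₀ Y) ⨾_) (pullˡ (trans (id⊗-⨾ _ _) (trans (cong (id X ⊗₁_) (α-iso₂ I I Y)) id⊗id))) ⟩
    α⇒ X I (I ⊗₀ Y) ⨾ id _ ⨾ α⇐ X I (I ⊗₀ Y)
      ≡⟨ trans (cong (α⇒ X I (I ⊗₀ Y) ⨾_) (idˡ _)) (α-iso₁ _ _ _) ⟩
    id _ ∎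

  pair-π₁π₂ : d (X ⊗₀ Y) ⨾ (π₁ ⊗₁ π₂) ≡ id (X ⊗₀ Y)
  pair-π₁π₂ {X} {Y} = begin
    d (X ⊗₀ Y) ⨾ (π₁ ⊗₁ π₂) ≡⟨ cong₂ _⨾_ (d-⊗ X Y) (⊗-⨾ _ _ _ _) ⟩
    ((d X ⊗₁ d Y) ⨾ σ X X Y Y) ⨾ ((id X ⊗₁ e Y) ⊗₁ (e X ⊗₁ id Y)) ⨾ (ρ⇒ X ⊗₁ λ⇒ Y)
      ≡⟨ trans (assoc _ _ _) (cong ((d X ⊗₁ d Y) ⨾_) (pullˡ (sym (σ-natural (id X) (e X) (e Y) (id Y))))) ⟩
    (d X ⊗₁ d Y) ⨾ (((id X ⊗₁ e X) ⊗₁ (e Y ⊗₁ id Y)) ⨾ σ X I I Y) ⨾ (ρ⇒ X ⊗₁ λ⇒ Y)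
      ≡⟨ cong (λ z → (d X ⊗₁ d Y) ⨾ (((id X ⊗₁ e X) ⊗₁ (e Y ⊗₁ id Y)) ⨾ z) ⨾ (ρ⇒ X ⊗₁ λ⇒ Y)) σ-I-I ⟩
    (d X ⊗₁ d Y) ⨾ (((id X ⊗₁ e X) ⊗₁ (e Y ⊗₁ id Y)) ⨾ id _) ⨾ (ρ⇒ X ⊗₁ λ⇒ Y)
      ≡⟨ cong (λ z → (d X ⊗₁ d Y) ⨾ z ⨾ (ρ⇒ X ⊗₁ λ⇒ Y)) (idʳ _) ⟩
    (d X ⊗₁ d Y) ⨾ ((id X ⊗₁ e X) ⊗₁ (e Y ⊗₁ id Y)) ⨾ (ρ⇒ X ⊗₁ λ⇒ Y)
      ≡⟨ pullˡ (trans (sym (⊗-⨾ _ _ _ _)) (cong₂ _⊗₁_ (d-unitʳ⇐ X) (d-unitˡ⇐ Y))) ⟩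
    (ρ⇐ X ⊗₁ λ⇐ Y) ⨾ (ρ⇒ X ⊗₁ λ⇒ Y) ≡⟨ proj₂ (iso-⊗ isoρ isoλ) ⟩
    id _ ∎

  -- Hence ⊗ is the cartesian product of maps.
  pair-η : {u : Hom Z (X ⊗₀ Y)} → u ⨾ d (X ⊗₀ Y) ≡ d Z ⨾ (u ⊗₁ u) → u ≡ ⟨ u ⨾ π₁ , u ⨾ π₂ ⟩
  pair-η {u = u} ud = begin
    u ≡⟨ sym (idʳ u) ⟩
    u ⨾ id _ ≡⟨ cong (u ⨾_) (sym pair-π₁π₂) ⟩
    u ⨾ d _ ⨾ (π₁ ⊗₁ π₂) ≡⟨ pullˡ ud ⟩
    (d _ ⨾ (u ⊗₁ u)) ⨾ (π₁ ⊗₁ π₂) ≡⟨ trans (assoc _ _ _) (cong (d _ ⨾_) (sym (⊗-⨾ _ _ _ _))) ⟩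
    ⟨ u ⨾ π₁ , u ⨾ π₂ ⟩ ∎

  π-jointly-monic : {u v : Hom Z (X ⊗₀ Y)} → IsMap u → IsMap v → u ⨾ π₁ ≡ v ⨾ π₁ → u ⨾ π₂ ≡ v ⨾ π₂ → u ≡ v
  π-jointly-monic (ud , _) (vd , _) e₁ e₂ = trans (pair-η ud) (trans (cong₂ ⟨_,_⟩ e₁ e₂) (sym (pair-η vd)))

  π²-jointly-monic : {u v : Hom W ((A ⊗₀ C) ⊗₀ (D ⊗₀ E))} → IsMap u → IsMap v →
        (u ⨾ π₁) ⨾ π₁ ≡ (v ⨾ π₁) ⨾ π₁ → (u ⨾ π₁) ⨾ π₂ ≡ (v ⨾ π₁) ⨾ π₂ →
        (u ⨾ π₂) ⨾ π₁ ≡ (v ⨾ π₂) ⨾ π₁ → (u ⨾ π₂) ⨾ π₂ ≡ (v ⨾ π₂) ⨾ π₂ → u ≡ v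
  π²-jointly-monic mu mv e11 e12 e21 e22 =
    π-jointly-monic mu mv (π-jointly-monic (map-⨾ mu map-π₁) (map-⨾ mv map-π₁) e11 e12) (π-jointly-monic (map-⨾ mu map-π₂) (map-⨾ mv map-π₂) e21 e22)

  pair-π₁ : {f : Hom Z X} {g : Hom Z Y} → g ⨾ e Y ≡ e Z → ⟨ f , g ⟩ ⨾ π₁ ≡ f
  pair-π₁ {Z} {X} {Y} {f} {g} ge = begin
    (d Z ⨾ (f ⊗₁ g)) ⨾ (id X ⊗₁ e Y) ⨾ ρ⇒ X ≡⟨ trans (assoc _ _ _) (cong (d Z ⨾_) (pullˡ (sym (⊗-⨾ _ _ _ _)))) ⟩
    d Z ⨾ ((f ⨾ id X) ⊗₁ (g ⨾ e Y)) ⨾ ρ⇒ X ≡⟨ cong (λ z → d Z ⨾ z ⨾ ρ⇒ X) (trans (cong₂ _⊗₁_ (idʳ f) ge) (serialize₂₁ f (e Z))) ⟩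
    d Z ⨾ ((id Z ⊗₁ e Z) ⨾ (f ⊗₁ id I)) ⨾ ρ⇒ X ≡⟨ cong (d Z ⨾_) (trans (assoc _ _ _) (cong ((id Z ⊗₁ e Z) ⨾_) (unitʳ-natural f))) ⟩
    d Z ⨾ (id Z ⊗₁ e Z) ⨾ ρ⇒ Z ⨾ f ≡⟨ trans (pullˡ³ (d-unitʳ Z)) (idˡ f) ⟩
    f ∎

  pair-π₂ : {f : Hom Z X} {g : Hom Z Y} → f ⨾ e X ≡ e Z → ⟨ f , g ⟩ ⨾ π₂ ≡ g
  pair-π₂ {Z} {X} {Y} {f} {g} fe = begin
    (d Z ⨾ (f ⊗₁ g)) ⨾ (e X ⊗₁ id Y) ⨾ λ⇒ Y ≡⟨ trans (assoc _ _ _) (cong (d Z ⨾_) (pullˡ (sym (⊗-⨾ _ _ _ _)))) ⟩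
    d Z ⨾ ((f ⨾ e X) ⊗₁ (g ⨾ id Y)) ⨾ λ⇒ Y ≡⟨ cong (λ z → d Z ⨾ z ⨾ λ⇒ Y) (trans (cong₂ _⊗₁_ fe (idʳ g)) (serialize₁₂ (e Z) g)) ⟩
    d Z ⨾ ((e Z ⊗₁ id Z) ⨾ (id I ⊗₁ g)) ⨾ λ⇒ Y ≡⟨ cong (d Z ⨾_) (trans (assoc _ _ _) (cong ((e Z ⊗₁ id Z) ⨾_) (unitˡ-natural g))) ⟩
    d Z ⨾ (e Z ⊗₁ id Z) ⨾ λ⇒ Z ⨾ g ≡⟨ trans (pullˡ³ (d-unitˡ Z)) (idˡ g) ⟩
    g ∎

  ⊗-π₁ : {f : Hom A X} {g : Hom C Y} → g ⨾ e Y ≡ e C → (f ⊗₁ g) ⨾ π₁ ≡ π₁ ⨾ f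
  ⊗-π₁ {A} {X} {C} {Y} {f} {g} ge = begin
    (f ⊗₁ g) ⨾ (id X ⊗₁ e Y) ⨾ ρ⇒ X ≡⟨ pullˡ (sym (⊗-⨾ _ _ _ _)) ⟩
    ((f ⨾ id X) ⊗₁ (g ⨾ e Y)) ⨾ ρ⇒ X ≡⟨ cong (_⨾ ρ⇒ X) (trans (cong₂ _⊗₁_ (idʳ f) ge) (serialize₂₁ f (e C))) ⟩
    ((id A ⊗₁ e C) ⨾ (f ⊗₁ id I)) ⨾ ρ⇒ X ≡⟨ trans (assoc _ _ _) (cong ((id A ⊗₁ e C) ⨾_) (unitʳ-natural f)) ⟩
    (id A ⊗₁ e C) ⨾ ρ⇒ A ⨾ f ≡⟨ sym (assoc _ _ _) ⟩
    π₁ ⨾ f ∎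

  ⊗-π₂ : {f : Hom A X} {g : Hom C Y} → f ⨾ e X ≡ e A → (f ⊗₁ g) ⨾ π₂ ≡ π₂ ⨾ g
  ⊗-π₂ {A} {X} {C} {Y} {f} {g} fe = begin
    (f ⊗₁ g) ⨾ (e X ⊗₁ id Y) ⨾ λ⇒ Y ≡⟨ pullˡ (sym (⊗-⨾ _ _ _ _)) ⟩
    ((f ⨾ e X) ⊗₁ (g ⨾ id Y)) ⨾ λ⇒ Y ≡⟨ cong (_⨾ λ⇒ Y) (trans (cong₂ _⊗₁_ fe (idʳ g)) (serialize₁₂ (e A) g)) ⟩
    ((e A ⊗₁ id C) ⨾ (id I ⊗₁ g)) ⨾ λ⇒ Y ≡⟨ trans (assoc _ _ _) (cong ((e A ⊗₁ id C) ⨾_) (unitˡ-natural g)) ⟩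
    (e A ⊗₁ id C) ⨾ λ⇒ C ⨾ g ≡⟨ sym (assoc _ _ _) ⟩
    π₂ ⨾ g ∎

  id⊗-π₁ : {x : Hom C D} → x ⨾ e D ≡ e C → (id A ⊗₁ x) ⨾ π₁ ≡ π₁
  id⊗-π₁ xe = trans (⊗-π₁ xe) (idʳ _)

  id⊗-π₂ : {x : Hom C D} → (id A ⊗₁ x) ⨾ π₂ ≡ π₂ ⨾ x
  id⊗-π₂ = ⊗-π₂ (idˡ _)

  ⊗id-π₁ : {x : Hom C D} → (x ⊗₁ id A) ⨾ π₁ ≡ π₁ ⨾ x
  ⊗id-π₁ = ⊗-π₁ (idˡ _)

  ⊗id-π₂ : {x : Hom C D} → x ⨾ e D ≡ e C → (x ⊗₁ id A) ⨾ π₂ ≡ π₂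
  ⊗id-π₂ xe = trans (⊗-π₂ xe) (idʳ _)




  α⇒-π₁ : α⇒ X Y Z ⨾ π₁ ≡ π₁ ⨾ π₁
  α⇒-π₁ {X} {Y} {Z} = trans lhs (sym rhs)
    where
    tgt : Hom ((X ⊗₀ Y) ⊗₀ Z) X
    tgt = ((id X ⊗₁ e Y) ⊗₁ e Z) ⨾ ρ⇒ (X ⊗₀ I) ⨾ ρ⇒ X
    lhs : α⇒ X Y Z ⨾ (id X ⊗₁ e (Y ⊗₀ Z)) ⨾ ρ⇒ X ≡ tgt
    lhs = begin
      α⇒ X Y Z ⨾ (id X ⊗₁ e (Y ⊗₀ Z)) ⨾ ρ⇒ X
        ≡⟨ cong (λ z → α⇒ X Y Z ⨾ (id X ⊗₁ z) ⨾ ρ⇒ X) (e-⊗ Y Z) ⟩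
      α⇒ X Y Z ⨾ (id X ⊗₁ ((e Y ⊗₁ e Z) ⨾ λ⇒ I)) ⨾ ρ⇒ X
        ≡⟨ cong (λ z → α⇒ X Y Z ⨾ z ⨾ ρ⇒ X) (sym (id⊗-⨾ _ _)) ⟩
      α⇒ X Y Z ⨾ ((id X ⊗₁ (e Y ⊗₁ e Z)) ⨾ (id X ⊗₁ λ⇒ I)) ⨾ ρ⇒ X
        ≡⟨ cong (α⇒ X Y Z ⨾_) (assoc _ _ _) ⟩
      α⇒ X Y Z ⨾ (id X ⊗₁ (e Y ⊗₁ e Z)) ⨾ (id X ⊗₁ λ⇒ I) ⨾ ρ⇒ X
        ≡⟨ pullˡ (sym (α-natural _ _ _)) ⟩
      (((id X ⊗₁ e Y) ⊗₁ e Z) ⨾ α⇒ X I I) ⨾ (id X ⊗₁ λ⇒ I) ⨾ ρ⇒ X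
        ≡⟨ trans (assoc _ _ _) (cong (((id X ⊗₁ e Y) ⊗₁ e Z) ⨾_) (pullˡ (triangle X I))) ⟩
      ((id X ⊗₁ e Y) ⊗₁ e Z) ⨾ (ρ⇒ X ⊗₁ id I) ⨾ ρ⇒ X
        ≡⟨ cong (((id X ⊗₁ e Y) ⊗₁ e Z) ⨾_) (unitʳ-natural _) ⟩
      tgt ∎
    rhs : ((id (X ⊗₀ Y) ⊗₁ e Z) ⨾ ρ⇒ (X ⊗₀ Y)) ⨾ (id X ⊗₁ e Y) ⨾ ρ⇒ X ≡ tgt
    rhs = begin
      ((id (X ⊗₀ Y) ⊗₁ e Z) ⨾ ρ⇒ (X ⊗₀ Y)) ⨾ (id X ⊗₁ e Y) ⨾ ρ⇒ X
        ≡⟨ trans (assoc _ _ _) (cong ((id (X ⊗₀ Y) ⊗₁ e Z) ⨾_) (pullˡ (sym (unitʳ-natural _)))) ⟩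
      (id (X ⊗₀ Y) ⊗₁ e Z) ⨾ (((id X ⊗₁ e Y) ⊗₁ id I) ⨾ ρ⇒ (X ⊗₀ I)) ⨾ ρ⇒ X
        ≡⟨ trans (cong ((id (X ⊗₀ Y) ⊗₁ e Z) ⨾_) (assoc _ _ _)) (pullˡ (sym (serialize₂₁ _ _))) ⟩
      tgt ∎

  α⇒-π₂ : α⇒ X Y Z ⨾ π₂ ≡ π₂ ⊗₁ id Z
  α⇒-π₂ {X} {Y} {Z} = begin
    α⇒ X Y Z ⨾ (e X ⊗₁ id (Y ⊗₀ Z)) ⨾ λ⇒ (Y ⊗₀ Z)
      ≡⟨ cong (λ z → α⇒ X Y Z ⨾ (e X ⊗₁ z) ⨾ λ⇒ (Y ⊗₀ Z)) (sym id⊗id) ⟩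
    α⇒ X Y Z ⨾ (e X ⊗₁ (id Y ⊗₁ id Z)) ⨾ λ⇒ (Y ⊗₀ Z)
      ≡⟨ pullˡ (sym (α-natural _ _ _)) ⟩
    (((e X ⊗₁ id Y) ⊗₁ id Z) ⨾ α⇒ I Y Z) ⨾ λ⇒ (Y ⊗₀ Z)
      ≡⟨ trans (assoc _ _ _) (cong (((e X ⊗₁ id Y) ⊗₁ id Z) ⨾_) (α⇒-λ⇒ Y Z)) ⟩
    ((e X ⊗₁ id Y) ⊗₁ id Z) ⨾ (λ⇒ Y ⊗₁ id Z) ≡⟨ ⊗id-⨾ _ _ ⟩
    π₂ ⊗₁ id Z ∎

  α⇐-π₂ : α⇐ X Y Z ⨾ π₂ ≡ π₂ ⨾ π₂
  α⇐-π₂ {X} {Y} {Z} = begin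
    α⇐ X Y Z ⨾ π₂ ≡⟨ cong (α⇐ X Y Z ⨾_) (sym q) ⟩
    α⇐ X Y Z ⨾ α⇒ X Y Z ⨾ π₂ ⨾ π₂ ≡⟨ cancelˡ (α-iso₂ _ _ _) ⟩
    π₂ ⨾ π₂ ∎
    where
    q : α⇒ X Y Z ⨾ π₂ ⨾ π₂ ≡ π₂
    q = trans (pullˡ α⇒-π₂) (trans (⊗-π₂ (total map-π₂)) (idʳ _))

  α⇐-π₁π₁ : α⇐ X Y Z ⨾ π₁ ⨾ π₁ ≡ π₁
  α⇐-π₁π₁ = trans (cong (α⇐ _ _ _ ⨾_) (sym α⇒-π₁)) (cancelˡ (α-iso₂ _ _ _))

  α⇐-π₁π₂ : α⇐ X Y Z ⨾ π₁ ⨾ π₂ ≡ π₂ ⨾ π₁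
  α⇐-π₁π₂ {X} {Y} {Z} = trans (cong (α⇐ _ _ _ ⨾_) (sym q)) (cancelˡ (α-iso₂ _ _ _))
    where
    q : α⇒ X Y Z ⨾ π₂ ⨾ π₁ ≡ π₁ ⨾ π₂
    q = trans (pullˡ α⇒-π₂) (⊗-π₁ (idˡ _))

  braid-π₁ : braid X Y ⨾ π₁ ≡ π₂
  braid-π₁ {X} {Y} = begin
    braid X Y ⨾ (id Y ⊗₁ e X) ⨾ ρ⇒ Y ≡⟨ pullˡ (sym (braid-natural (e X) (id Y))) ⟩
    ((e X ⊗₁ id Y) ⨾ braid I Y) ⨾ ρ⇒ Y ≡⟨ trans (assoc _ _ _) (cong ((e X ⊗₁ id Y) ⨾_) (braid-ρ⇒ Y)) ⟩
    π₂ ∎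

  braid-π₂ : braid X Y ⨾ π₂ ≡ π₁
  braid-π₂ {X} {Y} = begin
    braid X Y ⨾ (e Y ⊗₁ id X) ⨾ λ⇒ X ≡⟨ pullˡ (sym (braid-natural (id X) (e Y))) ⟩
    ((id X ⊗₁ e Y) ⨾ braid X I) ⨾ λ⇒ X ≡⟨ trans (assoc _ _ _) (cong ((id X ⊗₁ e Y) ⨾_) (braid-λ⇒ X)) ⟩
    π₁ ∎

  ρ⇒≡π₁ : ρ⇒ X ≡ π₁ {X} {I}
  ρ⇒≡π₁ {X} = sym (trans (cong (λ z → (id X ⊗₁ z) ⨾ ρ⇒ X) e-I) (trans (cong (_⨾ ρ⇒ X) id⊗id) (idˡ _)))

  α⇒-ρ⇒ : ∀ X Y → α⇒ X Y I ⨾ (id X ⊗₁ ρ⇒ Y) ≡ ρ⇒ (X ⊗₀ Y)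
  α⇒-ρ⇒ X Y = π-jointly-monic (map-⨾ map-α (map-⊗ map-id map-ρ)) map-ρ
    (begin
      (α⇒ X Y I ⨾ (id X ⊗₁ ρ⇒ Y)) ⨾ π₁ ≡⟨ trans (assoc _ _ _) (cong (α⇒ X Y I ⨾_) (id⊗-π₁ (total map-ρ))) ⟩
      α⇒ X Y I ⨾ π₁ ≡⟨ α⇒-π₁ ⟩
      π₁ ⨾ π₁ ≡⟨ cong (_⨾ π₁) (sym ρ⇒≡π₁) ⟩
      ρ⇒ (X ⊗₀ Y) ⨾ π₁ ∎)
    (begin
      (α⇒ X Y I ⨾ (id X ⊗₁ ρ⇒ Y)) ⨾ π₂ ≡⟨ trans (assoc _ _ _) (cong (α⇒ X Y I ⨾_) id⊗-π₂) ⟩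
      α⇒ X Y I ⨾ π₂ ⨾ ρ⇒ Y ≡⟨ pullˡ α⇒-π₂ ⟩
      (π₂ ⊗₁ id I) ⨾ ρ⇒ Y ≡⟨ unitʳ-natural _ ⟩
      ρ⇒ (X ⊗₀ Y) ⨾ π₂ ∎)

  α⇐-ρ⇒ : ∀ X Y → α⇐ X Y I ⨾ ρ⇒ (X ⊗₀ Y) ≡ id X ⊗₁ ρ⇒ Y
  α⇐-ρ⇒ X Y = trans (cong (α⇐ X Y I ⨾_) (sym (α⇒-ρ⇒ X Y))) (cancelˡ (α-iso₂ _ _ _))

  -- Rotates u says that u is ((a , c) , d) ↦ (c , (d , a)), in terms of projections.
  Rotates : Hom ((A ⊗₀ C) ⊗₀ D) (C ⊗₀ (D ⊗₀ A)) → Set ℓ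
  Rotates u = (u ⨾ π₁ ≡ π₁ ⨾ π₂) × ((u ⨾ π₂) ⨾ π₁ ≡ π₂) × ((u ⨾ π₂) ⨾ π₂ ≡ π₁ ⨾ π₁)

  Rotates-unique : {u v : Hom ((A ⊗₀ C) ⊗₀ D) (C ⊗₀ (D ⊗₀ A))} → IsMap u → IsMap v → Rotates u → Rotates v → u ≡ v
  Rotates-unique mu mv (u₁ , u₂₁ , u₂₂) (v₁ , v₂₁ , v₂₂) =
    π-jointly-monic mu mv (trans u₁ (sym v₁))
      (π-jointly-monic (map-⨾ mu map-π₂) (map-⨾ mv map-π₂) (trans u₂₁ (sym v₂₁)) (trans u₂₂ (sym v₂₂)))

  braid-α⇐-braid-rotates : ∀ A C D → Rotates (braid (A ⊗₀ C) D ⨾ α⇐ D A C ⨾ braid (D ⊗₀ A) C)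
  braid-α⇐-braid-rotates A C D = (begin
    (braid (A ⊗₀ C) D ⨾ α⇐ D A C ⨾ braid (D ⊗₀ A) C) ⨾ π₁ ≡⟨ assoc² ⟩
    braid (A ⊗₀ C) D ⨾ α⇐ D A C ⨾ braid (D ⊗₀ A) C ⨾ π₁ ≡⟨ cong (λ z → braid (A ⊗₀ C) D ⨾ α⇐ D A C ⨾ z) braid-π₁ ⟩
    braid (A ⊗₀ C) D ⨾ α⇐ D A C ⨾ π₂ ≡⟨ cong (braid (A ⊗₀ C) D ⨾_) α⇐-π₂ ⟩
    braid (A ⊗₀ C) D ⨾ π₂ ⨾ π₂ ≡⟨ pullˡ braid-π₂ ⟩
    π₁ ⨾ π₂ ∎) , (begin
    ((braid (A ⊗₀ C) D ⨾ α⇐ D A C ⨾ braid (D ⊗₀ A) C) ⨾ π₂) ⨾ π₁ ≡⟨ trans (assoc _ _ _) assoc² ⟩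
    braid (A ⊗₀ C) D ⨾ α⇐ D A C ⨾ braid (D ⊗₀ A) C ⨾ π₂ ⨾ π₁ ≡⟨ cong (λ z → braid (A ⊗₀ C) D ⨾ α⇐ D A C ⨾ z) (pullˡ braid-π₂) ⟩
    braid (A ⊗₀ C) D ⨾ α⇐ D A C ⨾ π₁ ⨾ π₁ ≡⟨ cong (braid (A ⊗₀ C) D ⨾_) α⇐-π₁π₁ ⟩
    braid (A ⊗₀ C) D ⨾ π₁ ≡⟨ braid-π₁ ⟩
    π₂ ∎) , (begin
    ((braid (A ⊗₀ C) D ⨾ α⇐ D A C ⨾ braid (D ⊗₀ A) C) ⨾ π₂) ⨾ π₂ ≡⟨ trans (assoc _ _ _) assoc² ⟩
    braid (A ⊗₀ C) D ⨾ α⇐ D A C ⨾ braid (D ⊗₀ A) C ⨾ π₂ ⨾ π₂ ≡⟨ cong (λ z → braid (A ⊗₀ C) D ⨾ α⇐ D A C ⨾ z) (pullˡ braid-π₂) ⟩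
    braid (A ⊗₀ C) D ⨾ α⇐ D A C ⨾ π₁ ⨾ π₂ ≡⟨ cong (braid (A ⊗₀ C) D ⨾_) α⇐-π₁π₂ ⟩
    braid (A ⊗₀ C) D ⨾ π₂ ⨾ π₁ ≡⟨ pullˡ braid-π₂ ⟩
    π₁ ⨾ π₁ ∎)

  braid-α⇒-braid-rotates : ∀ A C D → Rotates ((braid A C ⊗₁ id D) ⨾ α⇒ C A D ⨾ (id C ⊗₁ braid A D))
  braid-α⇒-braid-rotates A C D = (begin
    ((braid A C ⊗₁ id D) ⨾ α⇒ C A D ⨾ (id C ⊗₁ braid A D)) ⨾ π₁ ≡⟨ assoc² ⟩
    (braid A C ⊗₁ id D) ⨾ α⇒ C A D ⨾ (id C ⊗₁ braid A D) ⨾ π₁ ≡⟨ cong (λ z → (braid A C ⊗₁ id D) ⨾ α⇒ C A D ⨾ z) (id⊗-π₁ (total map-braid)) ⟩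
    (braid A C ⊗₁ id D) ⨾ α⇒ C A D ⨾ π₁ ≡⟨ cong ((braid A C ⊗₁ id D) ⨾_) α⇒-π₁ ⟩
    (braid A C ⊗₁ id D) ⨾ π₁ ⨾ π₁ ≡⟨ trans (pullˡ ⊗id-π₁) (assoc _ _ _) ⟩
    π₁ ⨾ braid A C ⨾ π₁ ≡⟨ cong (π₁ ⨾_) braid-π₁ ⟩
    π₁ ⨾ π₂ ∎) , (begin
    (((braid A C ⊗₁ id D) ⨾ α⇒ C A D ⨾ (id C ⊗₁ braid A D)) ⨾ π₂) ⨾ π₁ ≡⟨ trans (assoc _ _ _) assoc² ⟩
    (braid A C ⊗₁ id D) ⨾ α⇒ C A D ⨾ (id C ⊗₁ braid A D) ⨾ π₂ ⨾ π₁ ≡⟨ cong (λ z → (braid A C ⊗₁ id D) ⨾ α⇒ C A D ⨾ z) (trans (pullˡ id⊗-π₂) (assoc _ _ _)) ⟩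
    (braid A C ⊗₁ id D) ⨾ α⇒ C A D ⨾ π₂ ⨾ braid A D ⨾ π₁ ≡⟨ cong (λ z → (braid A C ⊗₁ id D) ⨾ α⇒ C A D ⨾ π₂ ⨾ z) braid-π₁ ⟩
    (braid A C ⊗₁ id D) ⨾ α⇒ C A D ⨾ π₂ ⨾ π₂ ≡⟨ cong ((braid A C ⊗₁ id D) ⨾_) (trans (pullˡ α⇒-π₂) (⊗id-π₂ (total map-π₂))) ⟩
    (braid A C ⊗₁ id D) ⨾ π₂ ≡⟨ ⊗id-π₂ (total map-braid) ⟩
    π₂ ∎) , (begin
    (((braid A C ⊗₁ id D) ⨾ α⇒ C A D ⨾ (id C ⊗₁ braid A D)) ⨾ π₂) ⨾ π₂ ≡⟨ trans (assoc _ _ _) assoc² ⟩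
    (braid A C ⊗₁ id D) ⨾ α⇒ C A D ⨾ (id C ⊗₁ braid A D) ⨾ π₂ ⨾ π₂ ≡⟨ cong (λ z → (braid A C ⊗₁ id D) ⨾ α⇒ C A D ⨾ z) (trans (pullˡ id⊗-π₂) (assoc _ _ _)) ⟩
    (braid A C ⊗₁ id D) ⨾ α⇒ C A D ⨾ π₂ ⨾ braid A D ⨾ π₂ ≡⟨ cong (λ z → (braid A C ⊗₁ id D) ⨾ α⇒ C A D ⨾ π₂ ⨾ z) braid-π₂ ⟩
    (braid A C ⊗₁ id D) ⨾ α⇒ C A D ⨾ π₂ ⨾ π₁ ≡⟨ cong ((braid A C ⊗₁ id D) ⨾_) (trans (pullˡ α⇒-π₂) ⊗id-π₁) ⟩
    (braid A C ⊗₁ id D) ⨾ π₁ ⨾ π₂ ≡⟨ trans (pullˡ ⊗id-π₁) (assoc _ _ _) ⟩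
    π₁ ⨾ braid A C ⨾ π₂ ≡⟨ cong (π₁ ⨾_) braid-π₂ ⟩
    π₁ ⨾ π₁ ∎)

  braid-α⇐-braid : ∀ A C D → braid (A ⊗₀ C) D ⨾ α⇐ D A C ⨾ braid (D ⊗₀ A) C
                             ≡ (braid A C ⊗₁ id D) ⨾ α⇒ C A D ⨾ (id C ⊗₁ braid A D)
  braid-α⇐-braid A C D =
    Rotates-unique (map-⨾ map-braid (map-⨾ map-α⇐ map-braid)) (map-⨾ (map-⊗ map-braid map-id) (map-⨾ map-α (map-⊗ map-id map-braid)))
      (braid-α⇐-braid-rotates A C D) (braid-α⇒-braid-rotates A C D)

  -- Conjugating by the symmetry turns the Frobenius law into its mirror image.
  frobenius⇐ : ∀ X → (id X ⊗₁ d X) ⨾ α⇐ X X X ⨾ (d* X ⊗₁ id X) ≡ d* X ⨾ d X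
  frobenius⇐ X = begin
    M ≡⟨ sym (cancelˡ (braid-inv X X)) ⟩
    braid X X ⨾ braid X X ⨾ M ≡⟨ cong (λ z → braid X X ⨾ braid X X ⨾ z) (sym (trans (cong (M ⨾_) (braid-inv X X)) (idʳ M))) ⟩
    braid X X ⨾ braid X X ⨾ M ⨾ braid X X ⨾ braid X X ≡⟨ cong (braid X X ⨾_) (trans (cong (braid X X ⨾_) (sym (assoc M _ _))) (sym (assoc _ _ _))) ⟩
    braid X X ⨾ (braid X X ⨾ M ⨾ braid X X) ⨾ braid X X ≡⟨ cong (λ z → braid X X ⨾ z ⨾ braid X X) (trans (cong (braid X X ⨾_) assoc²) bMb) ⟩
    braid X X ⨾ (d* X ⨾ d X) ⨾ braid X X ≡⟨ trans (cong (braid X X ⨾_) (assoc _ _ _)) (pullˡ (d*-comm X)) ⟩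
    d* X ⨾ d X ⨾ braid X X ≡⟨ cong (d* X ⨾_) (d-comm X) ⟩
    d* X ⨾ d X ∎
    where
    M : Hom (X ⊗₀ X) (X ⊗₀ X)
    M = (id X ⊗₁ d X) ⨾ α⇐ X X X ⨾ (d* X ⊗₁ id X)
    bMb : braid X X ⨾ (id X ⊗₁ d X) ⨾ α⇐ X X X ⨾ (d* X ⊗₁ id X) ⨾ braid X X ≡ d* X ⨾ d X
    bMb = begin
      braid X X ⨾ (id X ⊗₁ d X) ⨾ α⇐ X X X ⨾ (d* X ⊗₁ id X) ⨾ braid X X
        ≡⟨ trans (pullˡ (sym (braid-natural (d X) (id X)))) (assoc _ _ _) ⟩
      (d X ⊗₁ id X) ⨾ braid (X ⊗₀ X) X ⨾ α⇐ X X X ⨾ (d* X ⊗₁ id X) ⨾ braid X X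
        ≡⟨ cong (λ z → (d X ⊗₁ id X) ⨾ braid (X ⊗₀ X) X ⨾ α⇐ X X X ⨾ z) (braid-natural (d* X) (id X)) ⟩
      (d X ⊗₁ id X) ⨾ braid (X ⊗₀ X) X ⨾ α⇐ X X X ⨾ braid (X ⊗₀ X) X ⨾ (id X ⊗₁ d* X)
        ≡⟨ cong ((d X ⊗₁ id X) ⨾_) (pullˡ³ (braid-α⇐-braid X X X)) ⟩
      (d X ⊗₁ id X) ⨾ ((braid X X ⊗₁ id X) ⨾ α⇒ X X X ⨾ (id X ⊗₁ braid X X)) ⨾ (id X ⊗₁ d* X)
        ≡⟨ cong ((d X ⊗₁ id X) ⨾_) assoc² ⟩
      (d X ⊗₁ id X) ⨾ (braid X X ⊗₁ id X) ⨾ α⇒ X X X ⨾ (id X ⊗₁ braid X X) ⨾ (id X ⊗₁ d* X)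
        ≡⟨ pullˡ (trans (⊗id-⨾ _ _) (cong (_⊗₁ id X) (d-comm X))) ⟩
      (d X ⊗₁ id X) ⨾ α⇒ X X X ⨾ (id X ⊗₁ braid X X) ⨾ (id X ⊗₁ d* X)
        ≡⟨ cong (λ z → (d X ⊗₁ id X) ⨾ α⇒ X X X ⨾ z) (trans (id⊗-⨾ _ _) (cong (id X ⊗₁_) (d*-comm X))) ⟩
      (d X ⊗₁ id X) ⨾ α⇒ X X X ⨾ (id X ⊗₁ d* X) ≡⟨ frobenius X ⟩
      d* X ⨾ d X ∎

  σ-π₁π₁ : ∀ A C D E → σ A C D E ⨾ π₁ ⨾ π₁ ≡ π₁ ⨾ π₁
  σ-π₁π₁ A C D E = trans assoc⁴ (prepend (prepend (prepend (prepend α⇐-π₁π₁ (id⊗-π₁ (total map-α))) (id⊗-π₁ (total (map-⊗ map-braid map-id)))) (id⊗-π₁ (total map-α⇐))) α⇒-π₁)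

  σ-π₁π₂ : ∀ A C D E → σ A C D E ⨾ π₁ ⨾ π₂ ≡ π₂ ⨾ π₁
  σ-π₁π₂ A C D E = trans assoc⁴ (prepend (prepend (prepend (prepend α⇐-π₁π₂
       (trans (pullˡ id⊗-π₂) (trans (assoc _ _ _) (cong (π₂ ⨾_) α⇒-π₁))))
       (trans (pullˡ id⊗-π₂) (trans (assoc _ _ _) (cong (π₂ ⨾_) (trans (pullˡ ⊗id-π₁) (trans (assoc _ _ _) (cong (π₁ ⨾_) braid-π₁)))))))
       (trans (pullˡ id⊗-π₂) (trans (assoc _ _ _) (cong (π₂ ⨾_) α⇐-π₁π₂))))
       (trans (pullˡ α⇒-π₂) (pullˡ (⊗id-π₂ (total map-π₂)))))

  σ-π₂π₁ : ∀ A C D E → σ A C D E ⨾ π₂ ⨾ π₁ ≡ π₁ ⨾ π₂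
  σ-π₂π₁ A C D E = trans assoc⁴ (prepend (prepend (prepend (prepend (trans (pullˡ α⇐-π₂) (assoc _ _ _))
       (trans (pullˡ id⊗-π₂) (trans (assoc _ _ _) (cong (π₂ ⨾_) (trans (pullˡ α⇒-π₂) ⊗id-π₁)))))
       (trans (pullˡ id⊗-π₂) (trans (assoc _ _ _) (cong (π₂ ⨾_) (trans (pullˡ ⊗id-π₁) (trans (assoc _ _ _) (cong (π₁ ⨾_) braid-π₂)))))))
       (trans (pullˡ id⊗-π₂) (trans (assoc _ _ _) (cong (π₂ ⨾_) α⇐-π₁π₁))))
       (trans (pullˡ α⇒-π₂) ⊗id-π₁))

  σ-π₂π₂ : ∀ A C D E → σ A C D E ⨾ π₂ ⨾ π₂ ≡ π₂ ⨾ π₂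
  σ-π₂π₂ A C D E = trans assoc⁴ (prepend (prepend (prepend (prepend (trans (pullˡ α⇐-π₂) (assoc _ _ _))
       (trans (pullˡ id⊗-π₂) (trans (assoc _ _ _) (cong (π₂ ⨾_) (trans (pullˡ α⇒-π₂) (⊗id-π₂ (total map-π₂)))))))
       (trans (pullˡ id⊗-π₂) (trans (assoc _ _ _) (cong (π₂ ⨾_) (⊗id-π₂ (total map-braid))))))
       (trans (pullˡ id⊗-π₂) (trans (assoc _ _ _) (cong (π₂ ⨾_) α⇐-π₂))))
       (trans (pullˡ α⇒-π₂) (pullˡ (⊗id-π₂ (total map-π₂)))))

  map-σ : ∀ {A C D E} → IsMap (σ A C D E)
  map-σ = map-⨾ map-α (map-⨾ (map-⊗ map-id map-α⇐) (map-⨾ (map-⊗ map-id (map-⊗ map-braid map-id)) (map-⨾ (map-⊗ map-id map-α) map-α⇐)))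

  σ-involutive : ∀ A C D E → σ A C D E ⨾ σ A D C E ≡ id _
  σ-involutive A C D E = π²-jointly-monic (map-⨾ map-σ map-σ) map-id
    (trans assoc²ˡ (trans (cong (σ A C D E ⨾_) (σ-π₁π₁ A D C E)) (trans (σ-π₁π₁ A C D E) (sym (trans (assoc _ _ _) (idˡ _))))))
    (trans assoc²ˡ (trans (cong (σ A C D E ⨾_) (σ-π₁π₂ A D C E)) (trans (σ-π₂π₁ A C D E) (sym (trans (assoc _ _ _) (idˡ _))))))
    (trans assoc²ˡ (trans (cong (σ A C D E ⨾_) (σ-π₂π₁ A D C E)) (trans (σ-π₁π₂ A C D E) (sym (trans (assoc _ _ _) (idˡ _))))))
    (trans assoc²ˡ (trans (cong (σ A C D E ⨾_) (σ-π₂π₂ A D C E)) (trans (σ-π₂π₂ A C D E) (sym (trans (assoc _ _ _) (idˡ _))))))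

  d*-⊗ : ∀ A C → d* (A ⊗₀ C) ≡ σ A C A C ⨾ (d* A ⊗₁ d* C)
  d*-⊗ A C = ⊣-unique d⊣d* (⊣-resp-≡ (sym (d-⊗ A C)) (⊣-⨾ (⊣-⊗ d⊣d* d⊣d*) (iso⇒⊣ (σ-involutive A A C C , σ-involutive A C A C))))

  braid-σ : ∀ A C D E → (id (A ⊗₀ C) ⊗₁ braid D E) ⨾ σ A C E D
                     ≡ α⇒ A C (D ⊗₀ E) ⨾ (id A ⊗₁ α⇐ C D E) ⨾ (id A ⊗₁ braid (C ⊗₀ D) E) ⨾ α⇐ A E (C ⊗₀ D)
  braid-σ A C D E = π²-jointly-monic (map-⨾ (map-⊗ map-id map-braid) map-σ) (map-⨾ map-α (map-⨾ (map-⊗ map-id map-α⇐) (map-⨾ (map-⊗ map-id map-braid) map-α⇐)))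
    (trans assoc²ˡ (trans (cong (_ ⨾_) (σ-π₁π₁ A C E D)) (trans (pullˡ (id⊗-π₁ (total map-braid))) (sym r11))))
    (trans assoc²ˡ (trans (cong (_ ⨾_) (σ-π₁π₂ A C E D)) (trans (trans (pullˡ id⊗-π₂) (trans (assoc _ _ _) (cong (π₂ ⨾_) braid-π₁))) (sym r12))))
    (trans assoc²ˡ (trans (cong (_ ⨾_) (σ-π₂π₁ A C E D)) (trans (pullˡ (id⊗-π₁ (total map-braid))) (sym r21))))
    (trans assoc²ˡ (trans (cong (_ ⨾_) (σ-π₂π₂ A C E D)) (trans (trans (pullˡ id⊗-π₂) (trans (assoc _ _ _) (cong (π₂ ⨾_) braid-π₂))) (sym r22))))
    where
    r11 : ((α⇒ A C (D ⊗₀ E) ⨾ (id A ⊗₁ α⇐ C D E) ⨾ (id A ⊗₁ braid (C ⊗₀ D) E) ⨾ α⇐ A E (C ⊗₀ D)) ⨾ π₁) ⨾ π₁ ≡ π₁ ⨾ π₁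
    r11 = trans (trans (assoc _ _ _) assoc³) (prepend (prepend (prepend α⇐-π₁π₁ (id⊗-π₁ (total map-braid))) (id⊗-π₁ (total map-α⇐))) α⇒-π₁)
    r12 : ((α⇒ A C (D ⊗₀ E) ⨾ (id A ⊗₁ α⇐ C D E) ⨾ (id A ⊗₁ braid (C ⊗₀ D) E) ⨾ α⇐ A E (C ⊗₀ D)) ⨾ π₁) ⨾ π₂ ≡ π₂ ⨾ π₂
    r12 = trans (trans (assoc _ _ _) assoc³) (prepend (prepend (prepend α⇐-π₁π₂
           (trans (pullˡ id⊗-π₂) (trans (assoc _ _ _) (cong (π₂ ⨾_) braid-π₁))))
           (trans (pullˡ id⊗-π₂) (trans (assoc _ _ _) (cong (π₂ ⨾_) α⇐-π₂))))
           (trans (pullˡ α⇒-π₂) (pullˡ (⊗id-π₂ (total map-π₂)))))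
    r21 : ((α⇒ A C (D ⊗₀ E) ⨾ (id A ⊗₁ α⇐ C D E) ⨾ (id A ⊗₁ braid (C ⊗₀ D) E) ⨾ α⇐ A E (C ⊗₀ D)) ⨾ π₂) ⨾ π₁ ≡ π₁ ⨾ π₂
    r21 = trans (trans (assoc _ _ _) assoc³) (prepend (prepend (prepend (trans (pullˡ α⇐-π₂) (assoc _ _ _))
           (trans (pullˡ id⊗-π₂) (trans (assoc _ _ _) (cong (π₂ ⨾_) (pullˡ braid-π₂)))))
           (trans (pullˡ id⊗-π₂) (trans (assoc _ _ _) (cong (π₂ ⨾_) α⇐-π₁π₁))))
           (trans (pullˡ α⇒-π₂) ⊗id-π₁))
    r22 : ((α⇒ A C (D ⊗₀ E) ⨾ (id A ⊗₁ α⇐ C D E) ⨾ (id A ⊗₁ braid (C ⊗₀ D) E) ⨾ α⇐ A E (C ⊗₀ D)) ⨾ π₂) ⨾ π₂ ≡ π₂ ⨾ π₁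
    r22 = trans (trans (assoc _ _ _) assoc³) (prepend (prepend (prepend (trans (pullˡ α⇐-π₂) (assoc _ _ _))
           (trans (pullˡ id⊗-π₂) (trans (assoc _ _ _) (cong (π₂ ⨾_) (pullˡ braid-π₂)))))
           (trans (pullˡ id⊗-π₂) (trans (assoc _ _ _) (cong (π₂ ⨾_) α⇐-π₁π₂))))
           (trans (pullˡ α⇒-π₂) (pullˡ (⊗id-π₂ (total map-π₂)))))

module Transposition {o ℓ r : Level} (𝔹 : CartesianBicategory o ℓ r) where
  open Maps 𝔹 public
  open LRConstruction 𝔹 public using (ε; ε⁻¹)
  open ≡-Reasoning

  private variable
    W X Y : Obj

  cup : ∀ X → Hom I (X ⊗₀ X)
  cup X = e* X ⨾ d X

  cap : ∀ X → Hom (X ⊗₀ X) I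
  cap X = d* X ⨾ e X

  frobenius-cap : ∀ X → (id X ⊗₁ d X) ⨾ α⇐ X X X ⨾ (cap X ⊗₁ id X) ⨾ λ⇒ X ≡ d* X
  frobenius-cap X = begin
    (id X ⊗₁ d X) ⨾ α⇐ X X X ⨾ ((d* X ⨾ e X) ⊗₁ id X) ⨾ λ⇒ X
      ≡⟨ cong (λ z → (id X ⊗₁ d X) ⨾ α⇐ X X X ⨾ z) (trans (⨾-congˡ (⊗id-distrib _ _)) (assoc _ _ _)) ⟩
    (id X ⊗₁ d X) ⨾ α⇐ X X X ⨾ (d* X ⊗₁ id X) ⨾ (e X ⊗₁ id X) ⨾ λ⇒ X
      ≡⟨ trans (pullˡ³ (frobenius⇐ X)) (assoc _ _ _) ⟩
    d* X ⨾ d X ⨾ (e X ⊗₁ id X) ⨾ λ⇒ X ≡⟨ cong (d* X ⨾_) (d-unitˡ X) ⟩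
    d* X ⨾ id X ≡⟨ idʳ _ ⟩
    d* X ∎

  zigzag₁ : ∀ Y → ρ⇐ Y ⨾ (id Y ⊗₁ cup Y) ⨾ α⇐ Y Y Y ⨾ (cap Y ⊗₁ id Y) ⨾ λ⇒ Y ≡ id Y
  zigzag₁ Y = begin
    ρ⇐ Y ⨾ (id Y ⊗₁ (e* Y ⨾ d Y)) ⨾ α⇐ Y Y Y ⨾ ((d* Y ⨾ e Y) ⊗₁ id Y) ⨾ λ⇒ Y
      ≡⟨ cong₂ (λ u v → ρ⇐ Y ⨾ u ⨾ α⇐ Y Y Y ⨾ v ⨾ λ⇒ Y) (sym (id⊗-⨾ _ _)) (sym (⊗id-⨾ _ _)) ⟩
    ρ⇐ Y ⨾ ((id Y ⊗₁ e* Y) ⨾ (id Y ⊗₁ d Y)) ⨾ α⇐ Y Y Y ⨾ ((d* Y ⊗₁ id Y) ⨾ (e Y ⊗₁ id Y)) ⨾ λ⇒ Y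
      ≡⟨ cong (λ z → ρ⇐ Y ⨾ ((id Y ⊗₁ e* Y) ⨾ (id Y ⊗₁ d Y)) ⨾ α⇐ Y Y Y ⨾ z) (assoc _ _ _) ⟩
    ρ⇐ Y ⨾ ((id Y ⊗₁ e* Y) ⨾ (id Y ⊗₁ d Y)) ⨾ α⇐ Y Y Y ⨾ (d* Y ⊗₁ id Y) ⨾ (e Y ⊗₁ id Y) ⨾ λ⇒ Y
      ≡⟨ cong (ρ⇐ Y ⨾_) (assoc _ _ _) ⟩
    ρ⇐ Y ⨾ (id Y ⊗₁ e* Y) ⨾ (id Y ⊗₁ d Y) ⨾ α⇐ Y Y Y ⨾ (d* Y ⊗₁ id Y) ⨾ (e Y ⊗₁ id Y) ⨾ λ⇒ Y
      ≡⟨ cong (λ z → ρ⇐ Y ⨾ (id Y ⊗₁ e* Y) ⨾ z) (trans (pullˡ³ (frobenius⇐ Y)) (assoc _ _ _)) ⟩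
    ρ⇐ Y ⨾ (id Y ⊗₁ e* Y) ⨾ d* Y ⨾ d Y ⨾ (e Y ⊗₁ id Y) ⨾ λ⇒ Y
      ≡⟨ cong (λ z → ρ⇐ Y ⨾ (id Y ⊗₁ e* Y) ⨾ d* Y ⨾ z) (d-unitˡ Y) ⟩
    ρ⇐ Y ⨾ (id Y ⊗₁ e* Y) ⨾ d* Y ⨾ id Y
      ≡⟨ cong (λ z → ρ⇐ Y ⨾ (id Y ⊗₁ e* Y) ⨾ z) (idʳ _) ⟩
    ρ⇐ Y ⨾ (id Y ⊗₁ e* Y) ⨾ d* Y ≡⟨ d*-unitʳ Y ⟩
    id Y ∎

  zigzag₂ : ∀ Y → λ⇐ Y ⨾ (cup Y ⊗₁ id Y) ⨾ α⇒ Y Y Y ⨾ (id Y ⊗₁ cap Y) ⨾ ρ⇒ Y ≡ id Y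
  zigzag₂ Y = begin
    λ⇐ Y ⨾ ((e* Y ⨾ d Y) ⊗₁ id Y) ⨾ α⇒ Y Y Y ⨾ (id Y ⊗₁ (d* Y ⨾ e Y)) ⨾ ρ⇒ Y
      ≡⟨ cong₂ (λ u v → λ⇐ Y ⨾ u ⨾ α⇒ Y Y Y ⨾ v ⨾ ρ⇒ Y) (sym (⊗id-⨾ _ _)) (sym (id⊗-⨾ _ _)) ⟩
    λ⇐ Y ⨾ ((e* Y ⊗₁ id Y) ⨾ (d Y ⊗₁ id Y)) ⨾ α⇒ Y Y Y ⨾ ((id Y ⊗₁ d* Y) ⨾ (id Y ⊗₁ e Y)) ⨾ ρ⇒ Y
      ≡⟨ cong (λ z → λ⇐ Y ⨾ ((e* Y ⊗₁ id Y) ⨾ (d Y ⊗₁ id Y)) ⨾ α⇒ Y Y Y ⨾ z) (assoc _ _ _) ⟩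
    λ⇐ Y ⨾ ((e* Y ⊗₁ id Y) ⨾ (d Y ⊗₁ id Y)) ⨾ α⇒ Y Y Y ⨾ (id Y ⊗₁ d* Y) ⨾ (id Y ⊗₁ e Y) ⨾ ρ⇒ Y
      ≡⟨ cong (λ⇐ Y ⨾_) (assoc _ _ _) ⟩
    λ⇐ Y ⨾ (e* Y ⊗₁ id Y) ⨾ (d Y ⊗₁ id Y) ⨾ α⇒ Y Y Y ⨾ (id Y ⊗₁ d* Y) ⨾ (id Y ⊗₁ e Y) ⨾ ρ⇒ Y
      ≡⟨ cong (λ z → λ⇐ Y ⨾ (e* Y ⊗₁ id Y) ⨾ z) (trans (pullˡ³ (frobenius Y)) (assoc _ _ _)) ⟩
    λ⇐ Y ⨾ (e* Y ⊗₁ id Y) ⨾ d* Y ⨾ d Y ⨾ (id Y ⊗₁ e Y) ⨾ ρ⇒ Y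
      ≡⟨ cong (λ z → λ⇐ Y ⨾ (e* Y ⊗₁ id Y) ⨾ d* Y ⨾ z) (d-unitʳ Y) ⟩
    λ⇐ Y ⨾ (e* Y ⊗₁ id Y) ⨾ d* Y ⨾ id Y
      ≡⟨ cong (λ z → λ⇐ Y ⨾ (e* Y ⊗₁ id Y) ⨾ z) (idʳ _) ⟩
    λ⇐ Y ⨾ (e* Y ⊗₁ id Y) ⨾ d* Y ≡⟨ d*-unitˡ Y ⟩
    id Y ∎

  zigzag₂-⊗ : ∀ X Y → (ρ⇐ X ⊗₁ id Y) ⨾ ((id X ⊗₁ cup Y) ⊗₁ id Y) ⨾ (α⇐ X Y Y ⊗₁ id Y) ⨾ α⇒ (X ⊗₀ Y) Y Y
                    ⨾ (id (X ⊗₀ Y) ⊗₁ cap Y) ⨾ ρ⇒ (X ⊗₀ Y) ≡ id (X ⊗₀ Y)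
  zigzag₂-⊗ X Y = begin
    (ρ⇐ X ⊗₁ id Y) ⨾ ((id X ⊗₁ cup Y) ⊗₁ id Y) ⨾ (α⇐ X Y Y ⊗₁ id Y) ⨾ α⇒ (X ⊗₀ Y) Y Y ⨾ (id (X ⊗₀ Y) ⊗₁ cap Y) ⨾ ρ⇒ (X ⊗₀ Y)
      ≡⟨ trans (⨾-congˡ (sym (triangle⇐ X Y))) (assoc _ _ _) ⟩
    (id X ⊗₁ λ⇐ Y) ⨾ α⇐ X I Y ⨾ ((id X ⊗₁ cup Y) ⊗₁ id Y) ⨾ (α⇐ X Y Y ⊗₁ id Y) ⨾ α⇒ (X ⊗₀ Y) Y Y ⨾ (id (X ⊗₀ Y) ⊗₁ cap Y) ⨾ ρ⇒ (X ⊗₀ Y)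
      ≡⟨ cong ((id X ⊗₁ λ⇐ Y) ⨾_) (trans (pullˡ (sym (α⇐-natural (id X) (cup Y) (id Y)))) (assoc _ _ _)) ⟩
    (id X ⊗₁ λ⇐ Y) ⨾ (id X ⊗₁ (cup Y ⊗₁ id Y)) ⨾ α⇐ X (Y ⊗₀ Y) Y ⨾ (α⇐ X Y Y ⊗₁ id Y) ⨾ α⇒ (X ⊗₀ Y) Y Y ⨾ (id (X ⊗₀ Y) ⊗₁ cap Y) ⨾ ρ⇒ (X ⊗₀ Y)
      ≡⟨ cong (λ z → (id X ⊗₁ λ⇐ Y) ⨾ (id X ⊗₁ (cup Y ⊗₁ id Y)) ⨾ z) (trans (pullˡ³ (pentagon⇐ X Y Y Y)) (assoc _ _ _)) ⟩
    (id X ⊗₁ λ⇐ Y) ⨾ (id X ⊗₁ (cup Y ⊗₁ id Y)) ⨾ (id X ⊗₁ α⇒ Y Y Y) ⨾ α⇐ X Y (Y ⊗₀ Y) ⨾ (id (X ⊗₀ Y) ⊗₁ cap Y) ⨾ ρ⇒ (X ⊗₀ Y)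
      ≡⟨ cong (λ z → (id X ⊗₁ λ⇐ Y) ⨾ (id X ⊗₁ (cup Y ⊗₁ id Y)) ⨾ (id X ⊗₁ α⇒ Y Y Y) ⨾ z)
           (trans (cong (λ w → α⇐ X Y (Y ⊗₀ Y) ⨾ (w ⊗₁ cap Y) ⨾ ρ⇒ (X ⊗₀ Y)) (sym id⊗id))
           (trans (pullˡ (sym (α⇐-natural (id X) (id Y) (cap Y)))) (trans (assoc _ _ _) (cong ((id X ⊗₁ (id Y ⊗₁ cap Y)) ⨾_) (α⇐-ρ⇒ X Y))))) ⟩
    (id X ⊗₁ λ⇐ Y) ⨾ (id X ⊗₁ (cup Y ⊗₁ id Y)) ⨾ (id X ⊗₁ α⇒ Y Y Y) ⨾ (id X ⊗₁ (id Y ⊗₁ cap Y)) ⨾ (id X ⊗₁ ρ⇒ Y)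
      ≡⟨ cong₂ (λ u v → (id X ⊗₁ λ⇐ Y) ⨾ (id X ⊗₁ (cup Y ⊗₁ id Y)) ⨾ u ⨾ v) refl (id⊗-⨾ _ _) ⟩
    (id X ⊗₁ λ⇐ Y) ⨾ (id X ⊗₁ (cup Y ⊗₁ id Y)) ⨾ (id X ⊗₁ α⇒ Y Y Y) ⨾ (id X ⊗₁ ((id Y ⊗₁ cap Y) ⨾ ρ⇒ Y))
      ≡⟨ cong (λ z → (id X ⊗₁ λ⇐ Y) ⨾ (id X ⊗₁ (cup Y ⊗₁ id Y)) ⨾ z) (id⊗-⨾ _ _) ⟩
    (id X ⊗₁ λ⇐ Y) ⨾ (id X ⊗₁ (cup Y ⊗₁ id Y)) ⨾ (id X ⊗₁ (α⇒ Y Y Y ⨾ (id Y ⊗₁ cap Y) ⨾ ρ⇒ Y))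
      ≡⟨ cong ((id X ⊗₁ λ⇐ Y) ⨾_) (id⊗-⨾ _ _) ⟩
    (id X ⊗₁ λ⇐ Y) ⨾ (id X ⊗₁ (((e* Y ⨾ d Y) ⊗₁ id Y) ⨾ α⇒ Y Y Y ⨾ (id Y ⊗₁ (d* Y ⨾ e Y)) ⨾ ρ⇒ Y))
      ≡⟨ id⊗-⨾ _ _ ⟩
    id X ⊗₁ (λ⇐ Y ⨾ ((e* Y ⨾ d Y) ⊗₁ id Y) ⨾ α⇒ Y Y Y ⨾ (id Y ⊗₁ (d* Y ⨾ e Y)) ⨾ ρ⇒ Y)
      ≡⟨ cong (id X ⊗₁_) (zigzag₂ Y) ⟩
    id X ⊗₁ id Y ≡⟨ id⊗id ⟩
    id _ ∎

  ε-precomp : (S : Hom X W) (R : Hom (W ⊗₀ Y) I) → ε ((S ⊗₁ id Y) ⨾ R) ≡ S ⨾ ε R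
  ε-precomp {X} {W} {Y} S R = begin
    ρ⇐ X ⨾ (id X ⊗₁ cup Y) ⨾ α⇐ X Y Y ⨾ (((S ⊗₁ id Y) ⨾ R) ⊗₁ id Y) ⨾ λ⇒ Y
      ≡⟨ cong (λ z → ρ⇐ X ⨾ (id X ⊗₁ cup Y) ⨾ α⇐ X Y Y ⨾ z) (trans (cong (_⨾ λ⇒ Y) (sym (⊗id-⨾ _ _))) (assoc _ _ _)) ⟩
    ρ⇐ X ⨾ (id X ⊗₁ cup Y) ⨾ α⇐ X Y Y ⨾ ((S ⊗₁ id Y) ⊗₁ id Y) ⨾ (R ⊗₁ id Y) ⨾ λ⇒ Y
      ≡⟨ cong (λ z → ρ⇐ X ⨾ (id X ⊗₁ cup Y) ⨾ z) (trans (pullˡ (sym (α⇐-natural S (id Y) (id Y)))) (assoc _ _ _)) ⟩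
    ρ⇐ X ⨾ (id X ⊗₁ cup Y) ⨾ (S ⊗₁ (id Y ⊗₁ id Y)) ⨾ α⇐ W Y Y ⨾ (R ⊗₁ id Y) ⨾ λ⇒ Y
      ≡⟨ cong (λ z → ρ⇐ X ⨾ (id X ⊗₁ cup Y) ⨾ (S ⊗₁ z) ⨾ α⇐ W Y Y ⨾ (R ⊗₁ id Y) ⨾ λ⇒ Y) id⊗id ⟩
    ρ⇐ X ⨾ (id X ⊗₁ cup Y) ⨾ (S ⊗₁ id (Y ⊗₀ Y)) ⨾ α⇐ W Y Y ⨾ (R ⊗₁ id Y) ⨾ λ⇒ Y
      ≡⟨ cong (ρ⇐ X ⨾_) (trans (pullˡ (sym (interchange S (cup Y)))) (assoc _ _ _)) ⟩
    ρ⇐ X ⨾ (S ⊗₁ id I) ⨾ (id W ⊗₁ cup Y) ⨾ α⇐ W Y Y ⨾ (R ⊗₁ id Y) ⨾ λ⇒ Y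
      ≡⟨ trans (pullˡ (sym (ρ⇐-natural S))) (assoc _ _ _) ⟩
    S ⨾ ε R ∎

  ε-ε⁻¹ : (S : Hom X Y) → ε (ε⁻¹ S) ≡ S
  ε-ε⁻¹ {X} {Y} S = trans (ε-precomp S (d* Y ⨾ e Y)) (trans (cong (S ⨾_) (zigzag₁ Y)) (idʳ S))

  ε⁻¹-ε : (R : Hom (X ⊗₀ Y) I) → ε⁻¹ (ε R) ≡ R
  ε⁻¹-ε {X} {Y} R = begin
    (ε R ⊗₁ id Y) ⨾ d* Y ⨾ e Y
      ≡⟨ cong (_⨾ cap Y) (trans (⊗id-distrib _ _) (cong ((ρ⇐ X ⊗₁ id Y) ⨾_) (trans (⊗id-distrib _ _)
            (cong (((id X ⊗₁ cup Y) ⊗₁ id Y) ⨾_) (trans (⊗id-distrib _ _) (cong ((α⇐ X Y Y ⊗₁ id Y) ⨾_) (⊗id-distrib _ _))))))) ⟩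
    ((ρ⇐ X ⊗₁ id Y) ⨾ ((id X ⊗₁ cup Y) ⊗₁ id Y) ⨾ (α⇐ X Y Y ⊗₁ id Y) ⨾ ((R ⊗₁ id Y) ⊗₁ id Y) ⨾ (λ⇒ Y ⊗₁ id Y)) ⨾ cap Y
      ≡⟨ trans assoc⁴ (cong (λ z → (ρ⇐ X ⊗₁ id Y) ⨾ ((id X ⊗₁ cup Y) ⊗₁ id Y) ⨾ (α⇐ X Y Y ⊗₁ id Y) ⨾ z) T1) ⟩
    (ρ⇐ X ⊗₁ id Y) ⨾ ((id X ⊗₁ cup Y) ⊗₁ id Y) ⨾ (α⇐ X Y Y ⊗₁ id Y) ⨾ α⇒ (X ⊗₀ Y) Y Y ⨾ (id (X ⊗₀ Y) ⊗₁ cap Y) ⨾ ρ⇒ (X ⊗₀ Y) ⨾ R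
      ≡⟨ trans (sym assoc⁵) (⨾-congˡ (zigzag₂-⊗ X Y)) ⟩
    id _ ⨾ R ≡⟨ idˡ R ⟩
    R ∎
    where
    T1 : ((R ⊗₁ id Y) ⊗₁ id Y) ⨾ (λ⇒ Y ⊗₁ id Y) ⨾ cap Y ≡ α⇒ (X ⊗₀ Y) Y Y ⨾ (id (X ⊗₀ Y) ⊗₁ cap Y) ⨾ ρ⇒ (X ⊗₀ Y) ⨾ R
    RR : (R ⊗₁ id Y) ⊗₁ id Y ≡ α⇒ (X ⊗₀ Y) Y Y ⨾ (R ⊗₁ id (Y ⊗₀ Y)) ⨾ α⇐ I Y Y
    RR = sym (begin
      α⇒ (X ⊗₀ Y) Y Y ⨾ (R ⊗₁ id (Y ⊗₀ Y)) ⨾ α⇐ I Y Y ≡⟨ cong (λ z → α⇒ (X ⊗₀ Y) Y Y ⨾ (R ⊗₁ z) ⨾ α⇐ I Y Y) (sym id⊗id) ⟩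
      α⇒ (X ⊗₀ Y) Y Y ⨾ (R ⊗₁ (id Y ⊗₁ id Y)) ⨾ α⇐ I Y Y ≡⟨ cong (α⇒ (X ⊗₀ Y) Y Y ⨾_) (α⇐-natural R (id Y) (id Y)) ⟩
      α⇒ (X ⊗₀ Y) Y Y ⨾ α⇐ (X ⊗₀ Y) Y Y ⨾ ((R ⊗₁ id Y) ⊗₁ id Y) ≡⟨ cancelˡ (α-iso₁ _ _ _) ⟩
      (R ⊗₁ id Y) ⊗₁ id Y ∎)
    T1 = begin
      ((R ⊗₁ id Y) ⊗₁ id Y) ⨾ (λ⇒ Y ⊗₁ id Y) ⨾ cap Y ≡⟨ trans (⨾-congˡ RR) assoc² ⟩
      α⇒ (X ⊗₀ Y) Y Y ⨾ (R ⊗₁ id (Y ⊗₀ Y)) ⨾ α⇐ I Y Y ⨾ (λ⇒ Y ⊗₁ id Y) ⨾ cap Y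
        ≡⟨ cong (λ z → α⇒ (X ⊗₀ Y) Y Y ⨾ (R ⊗₁ id (Y ⊗₀ Y)) ⨾ z) (pullˡ (α⇐-λ⇒ Y Y)) ⟩
      α⇒ (X ⊗₀ Y) Y Y ⨾ (R ⊗₁ id (Y ⊗₀ Y)) ⨾ λ⇒ (Y ⊗₀ Y) ⨾ cap Y
        ≡⟨ cong (λ z → α⇒ (X ⊗₀ Y) Y Y ⨾ (R ⊗₁ id (Y ⊗₀ Y)) ⨾ z) (sym (unitˡ-natural (cap Y))) ⟩
      α⇒ (X ⊗₀ Y) Y Y ⨾ (R ⊗₁ id (Y ⊗₀ Y)) ⨾ (id I ⊗₁ cap Y) ⨾ λ⇒ I
        ≡⟨ cong (α⇒ (X ⊗₀ Y) Y Y ⨾_) (trans (pullˡ (interchange R (cap Y))) (assoc _ _ _)) ⟩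
      α⇒ (X ⊗₀ Y) Y Y ⨾ (id (X ⊗₀ Y) ⊗₁ cap Y) ⨾ (R ⊗₁ id I) ⨾ λ⇒ I
        ≡⟨ cong (λ z → α⇒ (X ⊗₀ Y) Y Y ⨾ (id (X ⊗₀ Y) ⊗₁ cap Y) ⨾ (R ⊗₁ id I) ⨾ z) λ⇒I≡ρ⇒I ⟩
      α⇒ (X ⊗₀ Y) Y Y ⨾ (id (X ⊗₀ Y) ⊗₁ cap Y) ⨾ (R ⊗₁ id I) ⨾ ρ⇒ I
        ≡⟨ cong (λ z → α⇒ (X ⊗₀ Y) Y Y ⨾ (id (X ⊗₀ Y) ⊗₁ cap Y) ⨾ z) (unitʳ-natural R) ⟩
      α⇒ (X ⊗₀ Y) Y Y ⨾ (id (X ⊗₀ Y) ⊗₁ cap Y) ⨾ ρ⇒ (X ⊗₀ Y) ⨾ R ∎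

module LRStructure {o ℓ r : Level} (𝔹 : CartesianBicategory o ℓ r) where
  open Transposition 𝔹
  open LRConstruction 𝔹 hiding (π₁; π₂; ⟨_,_⟩; ε; ε⁻¹)
  open ≡-Reasoning

  private variable
    W X Y Z X' Y' : Obj

  -- τ Y X Z is ((y , y') , (x , z)) ↦ ((x , y) , (y' , z)); θ-pairing shows that the
  -- reindexing in compLR is d Y ⊗ id followed by τ.
  τ : ∀ Y X Z → Hom ((Y ⊗₀ Y) ⊗₀ (X ⊗₀ Z)) ((X ⊗₀ Y) ⊗₀ (Y ⊗₀ Z))
  τ Y X Z = α⇐ (Y ⊗₀ Y) X Z ⨾ (braid (Y ⊗₀ Y) X ⊗₁ id Z) ⨾ (α⇐ X Y Y ⊗₁ id Z) ⨾ α⇒ (X ⊗₀ Y) Y Z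

  map-τ : ∀ {Y X Z} → IsMap (τ Y X Z)
  map-τ = map-⨾ map-α⇐ (map-⨾ (map-⊗ map-braid map-id) (map-⨾ (map-⊗ map-α⇐ map-id) map-α))

  τ-π₁π₁ : ∀ Y X Z → τ Y X Z ⨾ π₁ ⨾ π₁ ≡ π₂ ⨾ π₁
  τ-π₁π₁ Y X Z = begin
    τ Y X Z ⨾ π₁ ⨾ π₁ ≡⟨ assoc³ ⟩
    α⇐ (Y ⊗₀ Y) X Z ⨾ (braid (Y ⊗₀ Y) X ⊗₁ id Z) ⨾ (α⇐ X Y Y ⊗₁ id Z) ⨾ α⇒ (X ⊗₀ Y) Y Z ⨾ π₁ ⨾ π₁
      ≡⟨ cong (λ z → α⇐ (Y ⊗₀ Y) X Z ⨾ (braid (Y ⊗₀ Y) X ⊗₁ id Z) ⨾ (α⇐ X Y Y ⊗₁ id Z) ⨾ z) (trans (pullˡ α⇒-π₁) (assoc _ _ _)) ⟩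
    α⇐ (Y ⊗₀ Y) X Z ⨾ (braid (Y ⊗₀ Y) X ⊗₁ id Z) ⨾ (α⇐ X Y Y ⊗₁ id Z) ⨾ π₁ ⨾ π₁ ⨾ π₁
      ≡⟨ cong (λ z → α⇐ (Y ⊗₀ Y) X Z ⨾ (braid (Y ⊗₀ Y) X ⊗₁ id Z) ⨾ z) (trans (pullˡ ⊗id-π₁) (trans (assoc _ _ _) (cong (π₁ ⨾_) α⇐-π₁π₁))) ⟩
    α⇐ (Y ⊗₀ Y) X Z ⨾ (braid (Y ⊗₀ Y) X ⊗₁ id Z) ⨾ π₁ ⨾ π₁
      ≡⟨ cong (α⇐ (Y ⊗₀ Y) X Z ⨾_) (trans (pullˡ ⊗id-π₁) (trans (assoc _ _ _) (cong (π₁ ⨾_) braid-π₁))) ⟩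
    α⇐ (Y ⊗₀ Y) X Z ⨾ π₁ ⨾ π₂ ≡⟨ α⇐-π₁π₂ ⟩
    π₂ ⨾ π₁ ∎

  τ-π₁π₂ : ∀ Y X Z → τ Y X Z ⨾ π₁ ⨾ π₂ ≡ π₁ ⨾ π₁
  τ-π₁π₂ Y X Z = begin
    τ Y X Z ⨾ π₁ ⨾ π₂ ≡⟨ assoc³ ⟩
    α⇐ (Y ⊗₀ Y) X Z ⨾ (braid (Y ⊗₀ Y) X ⊗₁ id Z) ⨾ (α⇐ X Y Y ⊗₁ id Z) ⨾ α⇒ (X ⊗₀ Y) Y Z ⨾ π₁ ⨾ π₂
      ≡⟨ cong (λ z → α⇐ (Y ⊗₀ Y) X Z ⨾ (braid (Y ⊗₀ Y) X ⊗₁ id Z) ⨾ (α⇐ X Y Y ⊗₁ id Z) ⨾ z) (trans (pullˡ α⇒-π₁) (assoc _ _ _)) ⟩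
    α⇐ (Y ⊗₀ Y) X Z ⨾ (braid (Y ⊗₀ Y) X ⊗₁ id Z) ⨾ (α⇐ X Y Y ⊗₁ id Z) ⨾ π₁ ⨾ π₁ ⨾ π₂
      ≡⟨ cong (λ z → α⇐ (Y ⊗₀ Y) X Z ⨾ (braid (Y ⊗₀ Y) X ⊗₁ id Z) ⨾ z) (trans (pullˡ ⊗id-π₁) (trans (assoc _ _ _) (cong (π₁ ⨾_) α⇐-π₁π₂))) ⟩
    α⇐ (Y ⊗₀ Y) X Z ⨾ (braid (Y ⊗₀ Y) X ⊗₁ id Z) ⨾ π₁ ⨾ π₂ ⨾ π₁
      ≡⟨ cong (α⇐ (Y ⊗₀ Y) X Z ⨾_) (trans (pullˡ ⊗id-π₁) (trans (assoc _ _ _) (cong (π₁ ⨾_) (pullˡ braid-π₂)))) ⟩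
    α⇐ (Y ⊗₀ Y) X Z ⨾ π₁ ⨾ π₁ ⨾ π₁ ≡⟨ pullˡ³ α⇐-π₁π₁ ⟩
    π₁ ⨾ π₁ ∎

  τ-π₂π₁ : ∀ Y X Z → τ Y X Z ⨾ π₂ ⨾ π₁ ≡ π₁ ⨾ π₂
  τ-π₂π₁ Y X Z = begin
    τ Y X Z ⨾ π₂ ⨾ π₁ ≡⟨ assoc³ ⟩
    α⇐ (Y ⊗₀ Y) X Z ⨾ (braid (Y ⊗₀ Y) X ⊗₁ id Z) ⨾ (α⇐ X Y Y ⊗₁ id Z) ⨾ α⇒ (X ⊗₀ Y) Y Z ⨾ π₂ ⨾ π₁
      ≡⟨ cong (λ z → α⇐ (Y ⊗₀ Y) X Z ⨾ (braid (Y ⊗₀ Y) X ⊗₁ id Z) ⨾ (α⇐ X Y Y ⊗₁ id Z) ⨾ z) (trans (pullˡ α⇒-π₂) ⊗id-π₁) ⟩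
    α⇐ (Y ⊗₀ Y) X Z ⨾ (braid (Y ⊗₀ Y) X ⊗₁ id Z) ⨾ (α⇐ X Y Y ⊗₁ id Z) ⨾ π₁ ⨾ π₂
      ≡⟨ cong (λ z → α⇐ (Y ⊗₀ Y) X Z ⨾ (braid (Y ⊗₀ Y) X ⊗₁ id Z) ⨾ z) (trans (pullˡ ⊗id-π₁) (trans (assoc _ _ _) (cong (π₁ ⨾_) α⇐-π₂))) ⟩
    α⇐ (Y ⊗₀ Y) X Z ⨾ (braid (Y ⊗₀ Y) X ⊗₁ id Z) ⨾ π₁ ⨾ π₂ ⨾ π₂
      ≡⟨ cong (α⇐ (Y ⊗₀ Y) X Z ⨾_) (trans (pullˡ ⊗id-π₁) (trans (assoc _ _ _) (cong (π₁ ⨾_) (pullˡ braid-π₂)))) ⟩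
    α⇐ (Y ⊗₀ Y) X Z ⨾ π₁ ⨾ π₁ ⨾ π₂ ≡⟨ pullˡ³ α⇐-π₁π₁ ⟩
    π₁ ⨾ π₂ ∎

  τ-π₂π₂ : ∀ Y X Z → τ Y X Z ⨾ π₂ ⨾ π₂ ≡ π₂ ⨾ π₂
  τ-π₂π₂ Y X Z = begin
    τ Y X Z ⨾ π₂ ⨾ π₂ ≡⟨ assoc³ ⟩
    α⇐ (Y ⊗₀ Y) X Z ⨾ (braid (Y ⊗₀ Y) X ⊗₁ id Z) ⨾ (α⇐ X Y Y ⊗₁ id Z) ⨾ α⇒ (X ⊗₀ Y) Y Z ⨾ π₂ ⨾ π₂
      ≡⟨ cong (λ z → α⇐ (Y ⊗₀ Y) X Z ⨾ (braid (Y ⊗₀ Y) X ⊗₁ id Z) ⨾ (α⇐ X Y Y ⊗₁ id Z) ⨾ z) (trans (pullˡ α⇒-π₂) (⊗id-π₂ (total map-π₂))) ⟩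
    α⇐ (Y ⊗₀ Y) X Z ⨾ (braid (Y ⊗₀ Y) X ⊗₁ id Z) ⨾ (α⇐ X Y Y ⊗₁ id Z) ⨾ π₂
      ≡⟨ cong (λ z → α⇐ (Y ⊗₀ Y) X Z ⨾ (braid (Y ⊗₀ Y) X ⊗₁ id Z) ⨾ z) (⊗id-π₂ (total map-α⇐)) ⟩
    α⇐ (Y ⊗₀ Y) X Z ⨾ (braid (Y ⊗₀ Y) X ⊗₁ id Z) ⨾ π₂
      ≡⟨ cong (α⇐ (Y ⊗₀ Y) X Z ⨾_) (⊗id-π₂ (total map-braid)) ⟩
    α⇐ (Y ⊗₀ Y) X Z ⨾ π₂ ≡⟨ α⇐-π₂ ⟩
    π₂ ⨾ π₂ ∎

  τ-natural : (S : Hom X W) → (id (Y ⊗₀ Y) ⊗₁ (S ⊗₁ id Z)) ⨾ τ Y W Z ≡ τ Y X Z ⨾ ((S ⊗₁ id Y) ⊗₁ id (Y ⊗₀ Z))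
  τ-natural {X} {W} {Y} {Z} S =
    slide (α⇐-natural (id (Y ⊗₀ Y)) S (id Z))
   (slide (⊗-slideˡ (id Z) (braid-natural (id (Y ⊗₀ Y)) S))
   (slide (⊗-slideˡ (id Z) (α⇐-natural-id S))
          (α⇒-natural-id (S ⊗₁ id Y))))

  module _ {Y X Z : Obj} where
    θ : Hom (Y ⊗₀ (X ⊗₀ Z)) (X ⊗₀ (Y ⊗₀ Z))
    θ = ⟨ π₂ ⨾ π₁ , ⟨ π₁ , π₂ ⨾ π₂ ⟩ ⟩
    p₁₂ : Hom (X ⊗₀ (Y ⊗₀ Z)) (X ⊗₀ Y)
    p₁₂ = ⟨ π₁ , π₂ ⨾ π₁ ⟩
    p₂₃ : Hom (X ⊗₀ (Y ⊗₀ Z)) (Y ⊗₀ Z)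
    p₂₃ = ⟨ π₂ ⨾ π₁ , π₂ ⨾ π₂ ⟩

    map-θ : IsMap θ
    map-θ = map-pair (map-⨾ map-π₂ map-π₁) (map-pair map-π₁ (map-⨾ map-π₂ map-π₂))
    map-p₁₂ : IsMap p₁₂
    map-p₁₂ = map-pair map-π₁ (map-⨾ map-π₂ map-π₁)
    map-p₂₃ : IsMap p₂₃
    map-p₂₃ = map-pair (map-⨾ map-π₂ map-π₁) (map-⨾ map-π₂ map-π₂)

    θ-π₂ : θ ⨾ π₂ ≡ ⟨ π₁ , π₂ ⨾ π₂ ⟩
    θ-π₂ = pair-π₂ (total (map-⨾ map-π₂ map-π₁))

    θ-pairing : θ ⨾ d _ ⨾ (p₁₂ ⊗₁ p₂₃) ≡ (d Y ⊗₁ id (X ⊗₀ Z)) ⨾ τ Y X Z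
    θ-pairing = π²-jointly-monic (map-⨾ map-θ (map-pair map-p₁₂ map-p₂₃)) (map-⨾ (map-⊗ map-d map-id) map-τ)
      (trans l11 (sym r11)) (trans l12 (sym r12)) (trans l21 (sym r21)) (trans l22 (sym r22))
      where
      u v : Hom (Y ⊗₀ (X ⊗₀ Z)) ((X ⊗₀ Y) ⊗₀ (Y ⊗₀ Z))
      u = θ ⨾ ⟨ p₁₂ , p₂₃ ⟩
      v = (d Y ⊗₁ id (X ⊗₀ Z)) ⨾ τ Y X Z
      l11 : (u ⨾ π₁) ⨾ π₁ ≡ π₂ ⨾ π₁
      l11 = trans assoc²ˡ (trans (cong (θ ⨾_) (pullˡ (pair-π₁ (total map-p₂₃)))) (trans (cong (θ ⨾_) (pair-π₁ (total (map-⨾ map-π₂ map-π₁)))) (pair-π₁ (total (map-pair map-π₁ (map-⨾ map-π₂ map-π₂))))))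
      r11 : (v ⨾ π₁) ⨾ π₁ ≡ π₂ ⨾ π₁
      r11 = trans assoc²ˡ (trans (cong ((d Y ⊗₁ id (X ⊗₀ Z)) ⨾_) (τ-π₁π₁ Y X Z)) (pullˡ (⊗id-π₂ (total map-d))))
      l12 : (u ⨾ π₁) ⨾ π₂ ≡ π₁
      l12 = trans assoc²ˡ (trans (cong (θ ⨾_) (pullˡ (pair-π₁ (total map-p₂₃)))) (trans (cong (θ ⨾_) (pair-π₂ (total map-π₁))) (trans (pullˡ θ-π₂) (pair-π₁ (total (map-⨾ map-π₂ map-π₂))))))
      r12 : (v ⨾ π₁) ⨾ π₂ ≡ π₁
      r12 = trans assoc²ˡ (trans (cong ((d Y ⊗₁ id (X ⊗₀ Z)) ⨾_) (τ-π₁π₂ Y X Z)) (trans (pullˡ ⊗id-π₁) (trans (assoc _ _ _) (trans (cong (π₁ ⨾_) (d-unitʳ _)) (idʳ _)))))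
      l21 : (u ⨾ π₂) ⨾ π₁ ≡ π₁
      l21 = trans assoc²ˡ (trans (cong (θ ⨾_) (pullˡ (pair-π₂ (total map-p₁₂)))) (trans (cong (θ ⨾_) (pair-π₁ (total (map-⨾ map-π₂ map-π₂)))) (trans (pullˡ θ-π₂) (pair-π₁ (total (map-⨾ map-π₂ map-π₂))))))
      r21 : (v ⨾ π₂) ⨾ π₁ ≡ π₁
      r21 = trans assoc²ˡ (trans (cong ((d Y ⊗₁ id (X ⊗₀ Z)) ⨾_) (τ-π₂π₁ Y X Z)) (trans (pullˡ ⊗id-π₁) (trans (assoc _ _ _) (trans (cong (π₁ ⨾_) (d-unitˡ _)) (idʳ _)))))
      l22 : (u ⨾ π₂) ⨾ π₂ ≡ π₂ ⨾ π₂
      l22 = trans assoc²ˡ (trans (cong (θ ⨾_) (pullˡ (pair-π₂ (total map-p₁₂)))) (trans (cong (θ ⨾_) (pair-π₂ (total (map-⨾ map-π₂ map-π₁)))) (trans (pullˡ θ-π₂) (pair-π₂ (total map-π₁)))))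
      r22 : (v ⨾ π₂) ⨾ π₂ ≡ π₂ ⨾ π₂
      r22 = trans assoc²ˡ (trans (cong ((d Y ⊗₁ id (X ⊗₀ Z)) ⨾_) (τ-π₂π₂ Y X Z)) (pullˡ (⊗id-π₂ (total map-d))))

  frobenius-τ : ∀ Y Z → (d Y ⊗₁ id (Y ⊗₀ Z)) ⨾ τ Y Y Z ⨾ (d* Y ⊗₁ id (Y ⊗₀ Z)) ≡ α⇐ Y Y Z ⨾ ((d* Y ⨾ d Y) ⊗₁ id Z) ⨾ α⇒ Y Y Z
  frobenius-τ Y Z = begin
    (d Y ⊗₁ id (Y ⊗₀ Z)) ⨾ τ Y Y Z ⨾ (d* Y ⊗₁ id (Y ⊗₀ Z))
      ≡⟨ cong ((d Y ⊗₁ id (Y ⊗₀ Z)) ⨾_) assoc³ ⟩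
    (d Y ⊗₁ id (Y ⊗₀ Z)) ⨾ α⇐ (Y ⊗₀ Y) Y Z ⨾ (braid (Y ⊗₀ Y) Y ⊗₁ id Z) ⨾ (α⇐ Y Y Y ⊗₁ id Z) ⨾ α⇒ (Y ⊗₀ Y) Y Z ⨾ (d* Y ⊗₁ id (Y ⊗₀ Z))
      ≡⟨ trans (pullˡ (α⇐-natural-id (d Y))) (assoc _ _ _) ⟩
    α⇐ Y Y Z ⨾ ((d Y ⊗₁ id Y) ⊗₁ id Z) ⨾ (braid (Y ⊗₀ Y) Y ⊗₁ id Z) ⨾ (α⇐ Y Y Y ⊗₁ id Z) ⨾ α⇒ (Y ⊗₀ Y) Y Z ⨾ (d* Y ⊗₁ id (Y ⊗₀ Z))
      ≡⟨ cong (α⇐ Y Y Z ⨾_) (trans (pullˡ (⊗-slideˡ (id Z) (braid-natural (d Y) (id Y)))) (assoc _ _ _)) ⟩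
    α⇐ Y Y Z ⨾ (braid Y Y ⊗₁ id Z) ⨾ ((id Y ⊗₁ d Y) ⊗₁ id Z) ⨾ (α⇐ Y Y Y ⊗₁ id Z) ⨾ α⇒ (Y ⊗₀ Y) Y Z ⨾ (d* Y ⊗₁ id (Y ⊗₀ Z))
      ≡⟨ cong (λ z → α⇐ Y Y Z ⨾ (braid Y Y ⊗₁ id Z) ⨾ ((id Y ⊗₁ d Y) ⊗₁ id Z) ⨾ (α⇐ Y Y Y ⊗₁ id Z) ⨾ z) (sym (α⇒-natural-id (d* Y))) ⟩
    α⇐ Y Y Z ⨾ (braid Y Y ⊗₁ id Z) ⨾ ((id Y ⊗₁ d Y) ⊗₁ id Z) ⨾ (α⇐ Y Y Y ⊗₁ id Z) ⨾ ((d* Y ⊗₁ id Y) ⊗₁ id Z) ⨾ α⇒ Y Y Z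
      ≡⟨ cong (λ z → α⇐ Y Y Z ⨾ (braid Y Y ⊗₁ id Z) ⨾ z)
           (trans (cong (((id Y ⊗₁ d Y) ⊗₁ id Z) ⨾_) (pullˡ (⊗id-⨾ _ _))) (trans (pullˡ (⊗id-⨾ _ _)) (⨾-congˡ (cong (_⊗₁ id Z) (frobenius⇐ Y))))) ⟩
    α⇐ Y Y Z ⨾ (braid Y Y ⊗₁ id Z) ⨾ ((d* Y ⨾ d Y) ⊗₁ id Z) ⨾ α⇒ Y Y Z
      ≡⟨ cong (α⇐ Y Y Z ⨾_) (pullˡ (trans (⊗id-⨾ _ _) (cong (_⊗₁ id Z) (trans (sym (assoc _ _ _)) (⨾-congˡ (d*-comm Y)))))) ⟩
    α⇐ Y Y Z ⨾ ((d* Y ⨾ d Y) ⊗₁ id Z) ⨾ α⇒ Y Y Z ∎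

  cup-τ-cap : ∀ Y Z → λ⇐ (Y ⊗₀ Z) ⨾ (cup Y ⊗₁ id (Y ⊗₀ Z)) ⨾ τ Y Y Z ⨾ (cap Y ⊗₁ id (Y ⊗₀ Z)) ⨾ λ⇒ (Y ⊗₀ Z) ≡ id (Y ⊗₀ Z)
  cup-τ-cap Y Z = begin
    λ⇐ (Y ⊗₀ Z) ⨾ (cup Y ⊗₁ id (Y ⊗₀ Z)) ⨾ τ Y Y Z ⨾ (cap Y ⊗₁ id (Y ⊗₀ Z)) ⨾ λ⇒ (Y ⊗₀ Z)
      ≡⟨ cong₂ (λ u v → λ⇐ (Y ⊗₀ Z) ⨾ u ⨾ τ Y Y Z ⨾ v ⨾ λ⇒ (Y ⊗₀ Z)) (⊗id-distrib _ _) (⊗id-distrib _ _) ⟩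
    λ⇐ (Y ⊗₀ Z) ⨾ ((e* Y ⊗₁ id (Y ⊗₀ Z)) ⨾ (d Y ⊗₁ id (Y ⊗₀ Z))) ⨾ τ Y Y Z ⨾ ((d* Y ⊗₁ id (Y ⊗₀ Z)) ⨾ (e Y ⊗₁ id (Y ⊗₀ Z))) ⨾ λ⇒ (Y ⊗₀ Z)
      ≡⟨ cong (λ⇐ (Y ⊗₀ Z) ⨾_) (trans (assoc _ _ _) (cong ((e* Y ⊗₁ id (Y ⊗₀ Z)) ⨾_) (cong ((d Y ⊗₁ id (Y ⊗₀ Z)) ⨾_) (cong (τ Y Y Z ⨾_) (assoc _ _ _))))) ⟩
    λ⇐ (Y ⊗₀ Z) ⨾ (e* Y ⊗₁ id (Y ⊗₀ Z)) ⨾ (d Y ⊗₁ id (Y ⊗₀ Z)) ⨾ τ Y Y Z ⨾ (d* Y ⊗₁ id (Y ⊗₀ Z)) ⨾ (e Y ⊗₁ id (Y ⊗₀ Z)) ⨾ λ⇒ (Y ⊗₀ Z)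
      ≡⟨ cong (λ z → λ⇐ (Y ⊗₀ Z) ⨾ (e* Y ⊗₁ id (Y ⊗₀ Z)) ⨾ z) (trans (pullˡ³ (frobenius-τ Y Z)) assoc²) ⟩
    λ⇐ (Y ⊗₀ Z) ⨾ (e* Y ⊗₁ id (Y ⊗₀ Z)) ⨾ α⇐ Y Y Z ⨾ ((d* Y ⨾ d Y) ⊗₁ id Z) ⨾ α⇒ Y Y Z ⨾ (e Y ⊗₁ id (Y ⊗₀ Z)) ⨾ λ⇒ (Y ⊗₀ Z)
      ≡⟨ cong (λ z → λ⇐ (Y ⊗₀ Z) ⨾ (e* Y ⊗₁ id (Y ⊗₀ Z)) ⨾ α⇐ Y Y Z ⨾ ((d* Y ⨾ d Y) ⊗₁ id Z) ⨾ z)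
           (trans (pullˡ (sym (α⇒-natural-id (e Y)))) (trans (assoc _ _ _) (cong (((e Y ⊗₁ id Y) ⊗₁ id Z) ⨾_) (α⇒-λ⇒ Y Z)))) ⟩
    λ⇐ (Y ⊗₀ Z) ⨾ (e* Y ⊗₁ id (Y ⊗₀ Z)) ⨾ α⇐ Y Y Z ⨾ ((d* Y ⨾ d Y) ⊗₁ id Z) ⨾ ((e Y ⊗₁ id Y) ⊗₁ id Z) ⨾ (λ⇒ Y ⊗₁ id Z)
      ≡⟨ cong (λ⇐ (Y ⊗₀ Z) ⨾_) (trans (pullˡ (α⇐-natural-id (e* Y))) (assoc _ _ _)) ⟩
    λ⇐ (Y ⊗₀ Z) ⨾ α⇐ I Y Z ⨾ ((e* Y ⊗₁ id Y) ⊗₁ id Z) ⨾ ((d* Y ⨾ d Y) ⊗₁ id Z) ⨾ ((e Y ⊗₁ id Y) ⊗₁ id Z) ⨾ (λ⇒ Y ⊗₁ id Z)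
      ≡⟨ pullˡ (λ⇐-α⇐ Y Z) ⟩
    (λ⇐ Y ⊗₁ id Z) ⨾ ((e* Y ⊗₁ id Y) ⊗₁ id Z) ⨾ ((d* Y ⨾ d Y) ⊗₁ id Z) ⨾ ((e Y ⊗₁ id Y) ⊗₁ id Z) ⨾ (λ⇒ Y ⊗₁ id Z)
      ≡⟨ cong (λ z → (λ⇐ Y ⊗₁ id Z) ⨾ ((e* Y ⊗₁ id Y) ⊗₁ id Z) ⨾ ((d* Y ⨾ d Y) ⊗₁ id Z) ⨾ z) (⊗id-⨾ _ _) ⟩
    (λ⇐ Y ⊗₁ id Z) ⨾ ((e* Y ⊗₁ id Y) ⊗₁ id Z) ⨾ ((d* Y ⨾ d Y) ⊗₁ id Z) ⨾ (((e Y ⊗₁ id Y) ⨾ λ⇒ Y) ⊗₁ id Z)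
      ≡⟨ cong (λ z → (λ⇐ Y ⊗₁ id Z) ⨾ ((e* Y ⊗₁ id Y) ⊗₁ id Z) ⨾ z) (trans (⊗id-⨾ _ _) (cong (_⊗₁ id Z) (trans (assoc _ _ _) (trans (cong (d* Y ⨾_) (d-unitˡ Y)) (idʳ _))))) ⟩
    (λ⇐ Y ⊗₁ id Z) ⨾ ((e* Y ⊗₁ id Y) ⊗₁ id Z) ⨾ (d* Y ⊗₁ id Z)
      ≡⟨ cong ((λ⇐ Y ⊗₁ id Z) ⨾_) (⊗id-⨾ _ _) ⟩
    (λ⇐ Y ⊗₁ id Z) ⨾ (((e* Y ⊗₁ id Y) ⨾ d* Y) ⊗₁ id Z) ≡⟨ ⊗id-⨾ _ _ ⟩
    (λ⇐ Y ⨾ (e* Y ⊗₁ id Y) ⨾ d* Y) ⊗₁ id Z ≡⟨ cong (_⊗₁ id Z) (d*-unitˡ Y) ⟩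
    id Y ⊗₁ id Z ≡⟨ id⊗id ⟩
    id _ ∎

  cup-τ-cap⊗ : ∀ {Y Z} (g : Hom (Y ⊗₀ Z) I) → λ⇐ (Y ⊗₀ Z) ⨾ (cup Y ⊗₁ id (Y ⊗₀ Z)) ⨾ τ Y Y Z ⨾ (cap Y ⊗₁ g) ⨾ λ⇒ I ≡ g
  cup-τ-cap⊗ {Y} {Z} g = begin
    λ⇐ (Y ⊗₀ Z) ⨾ (cup Y ⊗₁ id (Y ⊗₀ Z)) ⨾ τ Y Y Z ⨾ (cap Y ⊗₁ g) ⨾ λ⇒ I
      ≡⟨ cong (λ z → λ⇐ (Y ⊗₀ Z) ⨾ (cup Y ⊗₁ id (Y ⊗₀ Z)) ⨾ τ Y Y Z ⨾ z)
          (trans (⨾-congˡ (serialize₁₂ (cap Y) g)) (trans (assoc _ _ _) (cong ((cap Y ⊗₁ id (Y ⊗₀ Z)) ⨾_) (unitˡ-natural g)))) ⟩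
    λ⇐ (Y ⊗₀ Z) ⨾ (cup Y ⊗₁ id (Y ⊗₀ Z)) ⨾ τ Y Y Z ⨾ (cap Y ⊗₁ id (Y ⊗₀ Z)) ⨾ λ⇒ (Y ⊗₀ Z) ⨾ g
      ≡⟨ trans (sym assoc⁴) (⨾-congˡ (cup-τ-cap Y Z)) ⟩
    id _ ⨾ g ≡⟨ idˡ g ⟩
    g ∎

  compLR-form : (f : HomLR X Y) (g : HomLR Y Z) →
    compLR f g ≡ λ⇐ (X ⊗₀ Z) ⨾ (cup Y ⊗₁ id (X ⊗₀ Z)) ⨾ τ Y X Z ⨾ (f ⊗₁ g) ⨾ λ⇒ I
  compLR-form {X} {Y} {Z} f g = begin
    compLR f g ≡⟨ refl ⟩
    λ⇐ (X ⊗₀ Z) ⨾ (e* Y ⊗₁ id (X ⊗₀ Z)) ⨾ θ {Y} {X} {Z} ⨾ d _ ⨾ ((p₁₂ {Y} {X} {Z} ⨾ f) ⊗₁ (p₂₃ {Y} {X} {Z} ⨾ g)) ⨾ λ⇒ I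
      ≡⟨ cong (λ z → λ⇐ (X ⊗₀ Z) ⨾ (e* Y ⊗₁ id (X ⊗₀ Z)) ⨾ θ {Y} {X} {Z} ⨾ d _ ⨾ z) (trans (⨾-congˡ (⊗-⨾ _ f _ g)) (assoc _ _ _)) ⟩
    λ⇐ (X ⊗₀ Z) ⨾ (e* Y ⊗₁ id (X ⊗₀ Z)) ⨾ θ {Y} {X} {Z} ⨾ d _ ⨾ (p₁₂ {Y} {X} {Z} ⊗₁ p₂₃ {Y} {X} {Z}) ⨾ (f ⊗₁ g) ⨾ λ⇒ I
      ≡⟨ cong (λ z → λ⇐ (X ⊗₀ Z) ⨾ (e* Y ⊗₁ id (X ⊗₀ Z)) ⨾ z) (trans (pullˡ³ θ-pairing) (assoc _ _ _)) ⟩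
    λ⇐ (X ⊗₀ Z) ⨾ (e* Y ⊗₁ id (X ⊗₀ Z)) ⨾ (d Y ⊗₁ id (X ⊗₀ Z)) ⨾ τ Y X Z ⨾ (f ⊗₁ g) ⨾ λ⇒ I
      ≡⟨ cong (λ⇐ (X ⊗₀ Z) ⨾_) (pullˡ (⊗id-⨾ _ _)) ⟩
    λ⇐ (X ⊗₀ Z) ⨾ (cup Y ⊗₁ id (X ⊗₀ Z)) ⨾ τ Y X Z ⨾ (f ⊗₁ g) ⨾ λ⇒ I ∎

  compLR-ε⁻¹ : (S : Hom X Y) (g : HomLR Y Z) → compLR (ε⁻¹ S) g ≡ (S ⊗₁ id Z) ⨾ g
  compLR-ε⁻¹ {X} {Y} {Z} S g = begin
    compLR (ε⁻¹ S) g ≡⟨ compLR-form (ε⁻¹ S) g ⟩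
    λ⇐ (X ⊗₀ Z) ⨾ (cup Y ⊗₁ id (X ⊗₀ Z)) ⨾ τ Y X Z ⨾ (((S ⊗₁ id Y) ⨾ cap Y) ⊗₁ g) ⨾ λ⇒ I
      ≡⟨ cong (λ z → λ⇐ (X ⊗₀ Z) ⨾ (cup Y ⊗₁ id (X ⊗₀ Z)) ⨾ τ Y X Z ⨾ z) (trans (⨾-congˡ (⊗-⨾ˡ _ _ _)) (assoc _ _ _)) ⟩
    λ⇐ (X ⊗₀ Z) ⨾ (cup Y ⊗₁ id (X ⊗₀ Z)) ⨾ τ Y X Z ⨾ ((S ⊗₁ id Y) ⊗₁ id (Y ⊗₀ Z)) ⨾ (cap Y ⊗₁ g) ⨾ λ⇒ I
      ≡⟨ cong (λ z → λ⇐ (X ⊗₀ Z) ⨾ (cup Y ⊗₁ id (X ⊗₀ Z)) ⨾ z) (trans (pullˡ (sym (τ-natural S))) (assoc _ _ _)) ⟩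
    λ⇐ (X ⊗₀ Z) ⨾ (cup Y ⊗₁ id (X ⊗₀ Z)) ⨾ (id (Y ⊗₀ Y) ⊗₁ (S ⊗₁ id Z)) ⨾ τ Y Y Z ⨾ (cap Y ⊗₁ g) ⨾ λ⇒ I
      ≡⟨ cong (λ⇐ (X ⊗₀ Z) ⨾_) (trans (pullˡ (interchange (cup Y) (S ⊗₁ id Z))) (assoc _ _ _)) ⟩
    λ⇐ (X ⊗₀ Z) ⨾ (id I ⊗₁ (S ⊗₁ id Z)) ⨾ (cup Y ⊗₁ id (Y ⊗₀ Z)) ⨾ τ Y Y Z ⨾ (cap Y ⊗₁ g) ⨾ λ⇒ I
      ≡⟨ trans (pullˡ (sym (λ⇐-natural (S ⊗₁ id Z)))) (assoc _ _ _) ⟩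
    (S ⊗₁ id Z) ⨾ λ⇐ (Y ⊗₀ Z) ⨾ (cup Y ⊗₁ id (Y ⊗₀ Z)) ⨾ τ Y Y Z ⨾ (cap Y ⊗₁ g) ⨾ λ⇒ I
      ≡⟨ cong ((S ⊗₁ id Z) ⨾_) (cup-τ-cap⊗ g) ⟩
    (S ⊗₁ id Z) ⨾ g ∎

  ε-comp : (f : HomLR X Y) (g : HomLR Y Z) → ε (compLR f g) ≡ ε f ⨾ ε g
  ε-comp f g = begin
    ε (compLR f g) ≡⟨ cong (λ z → ε (compLR z g)) (sym (ε⁻¹-ε f)) ⟩
    ε (compLR (ε⁻¹ (ε f)) g) ≡⟨ cong ε (compLR-ε⁻¹ (ε f) g) ⟩
    ε ((ε f ⊗₁ id _) ⨾ g) ≡⟨ ε-precomp (ε f) g ⟩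
    ε f ⨾ ε g ∎

  module _ {X X' Y Y' : Obj} where
    q₁₃ : Hom ((X ⊗₀ X') ⊗₀ (Y ⊗₀ Y')) (X ⊗₀ Y)
    q₁₃ = ⟨ π₁ ⨾ π₁ , π₂ ⨾ π₁ ⟩
    q₂₄ : Hom ((X ⊗₀ X') ⊗₀ (Y ⊗₀ Y')) (X' ⊗₀ Y')
    q₂₄ = ⟨ π₁ ⨾ π₂ , π₂ ⨾ π₂ ⟩
    map-q₁₃ : IsMap q₁₃
    map-q₁₃ = map-pair (map-⨾ map-π₁ map-π₁) (map-⨾ map-π₂ map-π₁)
    map-q₂₄ : IsMap q₂₄
    map-q₂₄ = map-pair (map-⨾ map-π₁ map-π₂) (map-⨾ map-π₂ map-π₂)

    q₁₃q₂₄-pairing : d _ ⨾ (q₁₃ ⊗₁ q₂₄) ≡ σ X X' Y Y'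
    q₁₃q₂₄-pairing = π²-jointly-monic (map-pair map-q₁₃ map-q₂₄) map-σ
      (trans (assoc _ _ _) (trans (pullˡ (pair-π₁ (total map-q₂₄))) (trans (pair-π₁ (total (map-⨾ map-π₂ map-π₁))) (sym (trans (assoc _ _ _) (σ-π₁π₁ _ _ _ _))))))
      (trans (assoc _ _ _) (trans (pullˡ (pair-π₁ (total map-q₂₄))) (trans (pair-π₂ (total (map-⨾ map-π₁ map-π₁))) (sym (trans (assoc _ _ _) (σ-π₁π₂ _ _ _ _))))))
      (trans (assoc _ _ _) (trans (pullˡ (pair-π₂ (total map-q₁₃))) (trans (pair-π₁ (total (map-⨾ map-π₂ map-π₂))) (sym (trans (assoc _ _ _) (σ-π₂π₁ _ _ _ _))))))
      (trans (assoc _ _ _) (trans (pullˡ (pair-π₂ (total map-q₁₃))) (trans (pair-π₂ (total (map-⨾ map-π₁ map-π₂))) (sym (trans (assoc _ _ _) (σ-π₂π₂ _ _ _ _))))))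

  tensorLR-form : (f : HomLR X Y) (g : HomLR X' Y') →
    tensorLR f g ≡ σ X X' Y Y' ⨾ (f ⊗₁ g) ⨾ λ⇒ I
  tensorLR-form {X} {Y} {X'} {Y'} f g = begin
    tensorLR f g ≡⟨ refl ⟩
    d _ ⨾ ((q₁₃ {X} {X'} {Y} {Y'} ⨾ f) ⊗₁ (q₂₄ {X} {X'} {Y} {Y'} ⨾ g)) ⨾ λ⇒ I
      ≡⟨ cong (d _ ⨾_) (trans (⨾-congˡ (⊗-⨾ _ f _ g)) (assoc _ _ _)) ⟩
    d _ ⨾ (q₁₃ {X} {X'} {Y} {Y'} ⊗₁ q₂₄ {X} {X'} {Y} {Y'}) ⨾ (f ⊗₁ g) ⨾ λ⇒ I
      ≡⟨ pullˡ q₁₃q₂₄-pairing ⟩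
    σ X X' Y Y' ⨾ (f ⊗₁ g) ⨾ λ⇒ I ∎

  tensorLR-ε⁻¹ : (S : Hom X Y) (T : Hom X' Y') → tensorLR (ε⁻¹ S) (ε⁻¹ T) ≡ ε⁻¹ (S ⊗₁ T)
  tensorLR-ε⁻¹ {X} {Y} {X'} {Y'} S T = begin
    tensorLR (ε⁻¹ S) (ε⁻¹ T) ≡⟨ tensorLR-form (ε⁻¹ S) (ε⁻¹ T) ⟩
    σ X X' Y Y' ⨾ (((S ⊗₁ id Y) ⨾ cap Y) ⊗₁ ((T ⊗₁ id Y') ⨾ cap Y')) ⨾ λ⇒ I
      ≡⟨ cong (σ X X' Y Y' ⨾_) (trans (⨾-congˡ (⊗-⨾ _ _ _ _)) (assoc _ _ _)) ⟩
    σ X X' Y Y' ⨾ ((S ⊗₁ id Y) ⊗₁ (T ⊗₁ id Y')) ⨾ (cap Y ⊗₁ cap Y') ⨾ λ⇒ I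
      ≡⟨ trans (pullˡ (sym (σ-natural S T (id Y) (id Y')))) (assoc _ _ _) ⟩
    ((S ⊗₁ T) ⊗₁ (id Y ⊗₁ id Y')) ⨾ σ Y Y' Y Y' ⨾ (cap Y ⊗₁ cap Y') ⨾ λ⇒ I
      ≡⟨ cong₂ (λ u v → ((S ⊗₁ T) ⊗₁ u) ⨾ σ Y Y' Y Y' ⨾ v) id⊗id
          (trans (⨾-congˡ (⊗-⨾ _ _ _ _)) (assoc _ _ _)) ⟩
    ((S ⊗₁ T) ⊗₁ id (Y ⊗₀ Y')) ⨾ σ Y Y' Y Y' ⨾ (d* Y ⊗₁ d* Y') ⨾ (e Y ⊗₁ e Y') ⨾ λ⇒ I
      ≡⟨ cong ((S ⊗₁ T) ⊗₁ id (Y ⊗₀ Y') ⨾_) (trans (sym (assoc _ _ _)) (cong₂ _⨾_ (sym (d*-⊗ Y Y')) (sym (e-⊗ Y Y')))) ⟩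
    ε⁻¹ (S ⊗₁ T) ∎

  ε-⊗ : (f : HomLR X Y) (g : HomLR X' Y') → ε (tensorLR f g) ≡ ε f ⊗₁ ε g
  ε-⊗ f g = begin
    ε (tensorLR f g) ≡⟨ cong₂ (λ u v → ε (tensorLR u v)) (sym (ε⁻¹-ε f)) (sym (ε⁻¹-ε g)) ⟩
    ε (tensorLR (ε⁻¹ (ε f)) (ε⁻¹ (ε g))) ≡⟨ cong ε (tensorLR-ε⁻¹ (ε f) (ε g)) ⟩
    ε (ε⁻¹ (ε f ⊗₁ ε g)) ≡⟨ ε-ε⁻¹ _ ⟩
    ε f ⊗₁ ε g ∎

  d*-I : d* I ≡ λ⇒ I
  d*-I = ⊣-unique d⊣d* (⊣-resp-≡ (sym d-I) (iso⇒⊣ (iso-sym isoλ)))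

  e*LR-ε⁻¹ : ∀ X → e*LR X ≡ ε⁻¹ (e* X)
  e*LR-ε⁻¹ X = begin
    braid I X ⨾ (e X ⊗₁ id I) ⨾ d* I ⨾ e I ≡⟨ pullˡ (sym (braid-natural (id I) (e X))) ⟩
    ((id I ⊗₁ e X) ⨾ braid I I) ⨾ d* I ⨾ e I ≡⟨ cong (λ z → ((id I ⊗₁ e X) ⨾ z) ⨾ d* I ⨾ e I) braid-I-I ⟩
    ((id I ⊗₁ e X) ⨾ id _) ⨾ d* I ⨾ e I ≡⟨ cong₂ (λ u v → u ⨾ v) (idʳ _) (cong₂ _⨾_ d*-I e-I) ⟩
    (id I ⊗₁ e X) ⨾ λ⇒ I ⨾ id I ≡⟨ cong ((id I ⊗₁ e X) ⨾_) (idʳ _) ⟩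
    (id I ⊗₁ e X) ⨾ λ⇒ I ≡⟨ unitˡ-natural (e X) ⟩
    λ⇒ X ⨾ e X ≡⟨ ⨾-congˡ (sym e*⊗id⨾d*) ⟩
    ((e* X ⊗₁ id X) ⨾ d* X) ⨾ e X ≡⟨ assoc _ _ _ ⟩
    ε⁻¹ (e* X) ∎
    where
    e*⊗id⨾d* : (e* X ⊗₁ id X) ⨾ d* X ≡ λ⇒ X
    e*⊗id⨾d* = iso-cancelˡ (iso-sym isoλ) (trans (d*-unitˡ X) (sym (unitˡ-iso₂ X)))

  d*LR-ε⁻¹ : ∀ X → d*LR X ≡ ε⁻¹ (d* X)
  d*LR-ε⁻¹ X = begin
    braid (X ⊗₀ X) X ⨾ (d X ⊗₁ id (X ⊗₀ X)) ⨾ d* (X ⊗₀ X) ⨾ e (X ⊗₀ X)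
      ≡⟨ trans (pullˡ (sym (braid-natural (id (X ⊗₀ X)) (d X)))) (assoc _ _ _) ⟩
    (id (X ⊗₀ X) ⊗₁ d X) ⨾ braid (X ⊗₀ X) (X ⊗₀ X) ⨾ d* (X ⊗₀ X) ⨾ e (X ⊗₀ X)
      ≡⟨ cong ((id (X ⊗₀ X) ⊗₁ d X) ⨾_) (pullˡ (d*-comm (X ⊗₀ X))) ⟩
    (id (X ⊗₀ X) ⊗₁ d X) ⨾ d* (X ⊗₀ X) ⨾ e (X ⊗₀ X)
      ≡⟨ cong ((id (X ⊗₀ X) ⊗₁ d X) ⨾_) (trans (cong₂ _⨾_ (d*-⊗ X X) (e-⊗ X X)) (trans (assoc _ _ _) (cong (σ X X X X ⨾_) (pullˡ (sym (⊗-⨾ _ _ _ _)))))) ⟩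
    (id (X ⊗₀ X) ⊗₁ d X) ⨾ σ X X X X ⨾ (cap X ⊗₁ cap X) ⨾ λ⇒ I
      ≡⟨ cong (λ z → (id (X ⊗₀ X) ⊗₁ d X) ⨾ σ X X X X ⨾ z) (⊗-λ⇒I (cap X) (cap X)) ⟩
    (id (X ⊗₀ X) ⊗₁ d X) ⨾ σ X X X X ⨾ (id (X ⊗₀ X) ⊗₁ cap X) ⨾ ρ⇒ (X ⊗₀ X) ⨾ cap X
      ≡⟨ ⨾-congˡ (trans (cong (id (X ⊗₀ X) ⊗₁_) (sym (d-comm X))) (id⊗-distrib _ _)) ⟩
    ((id (X ⊗₀ X) ⊗₁ d X) ⨾ (id (X ⊗₀ X) ⊗₁ braid X X)) ⨾ σ X X X X ⨾ (id (X ⊗₀ X) ⊗₁ cap X) ⨾ ρ⇒ (X ⊗₀ X) ⨾ cap X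
      ≡⟨ trans (assoc _ _ _) (cong ((id (X ⊗₀ X) ⊗₁ d X) ⨾_) (trans (pullˡ (braid-σ X X X X)) assoc³)) ⟩
    (id (X ⊗₀ X) ⊗₁ d X) ⨾ α⇒ X X (X ⊗₀ X) ⨾ (id X ⊗₁ α⇐ X X X) ⨾ (id X ⊗₁ braid (X ⊗₀ X) X) ⨾ α⇐ X X (X ⊗₀ X)
        ⨾ (id (X ⊗₀ X) ⊗₁ cap X) ⨾ ρ⇒ (X ⊗₀ X) ⨾ cap X
      ≡⟨ cong (λ z → (id (X ⊗₀ X) ⊗₁ d X) ⨾ α⇒ X X (X ⊗₀ X) ⨾ (id X ⊗₁ α⇐ X X X) ⨾ (id X ⊗₁ braid (X ⊗₀ X) X) ⨾ z)
           (trans (cong (λ w → α⇐ X X (X ⊗₀ X) ⨾ (w ⊗₁ cap X) ⨾ ρ⇒ (X ⊗₀ X) ⨾ cap X) (sym id⊗id))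
           (trans (pullˡ (sym (α⇐-natural (id X) (id X) (cap X)))) (trans (assoc _ _ _) (cong ((id X ⊗₁ (id X ⊗₁ cap X)) ⨾_) (pullˡ (α⇐-ρ⇒ X X)))))) ⟩
    (id (X ⊗₀ X) ⊗₁ d X) ⨾ α⇒ X X (X ⊗₀ X) ⨾ (id X ⊗₁ α⇐ X X X) ⨾ (id X ⊗₁ braid (X ⊗₀ X) X) ⨾ (id X ⊗₁ (id X ⊗₁ cap X)) ⨾ (id X ⊗₁ ρ⇒ X) ⨾ cap X
      ≡⟨ cong (λ z → (id (X ⊗₀ X) ⊗₁ d X) ⨾ α⇒ X X (X ⊗₀ X) ⨾ (id X ⊗₁ α⇐ X X X) ⨾ z)
           (trans (cong ((id X ⊗₁ braid (X ⊗₀ X) X) ⨾_) (pullˡ (id⊗-⨾ _ _))) (trans (pullˡ (id⊗-⨾ _ _)) (⨾-congˡ (cong (id X ⊗₁_) (braid-id⊗-ρ⇒ (cap X)))))) ⟩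
    (id (X ⊗₀ X) ⊗₁ d X) ⨾ α⇒ X X (X ⊗₀ X) ⨾ (id X ⊗₁ α⇐ X X X) ⨾ (id X ⊗₁ ((cap X ⊗₁ id X) ⨾ λ⇒ X)) ⨾ cap X
      ≡⟨ ⨾-congˡ (cong (_⊗₁ d X) (sym id⊗id)) ⟩
    ((id X ⊗₁ id X) ⊗₁ d X) ⨾ α⇒ X X (X ⊗₀ X) ⨾ (id X ⊗₁ α⇐ X X X) ⨾ (id X ⊗₁ ((cap X ⊗₁ id X) ⨾ λ⇒ X)) ⨾ cap X
      ≡⟨ trans (pullˡ (α-natural _ _ _)) (assoc _ _ _) ⟩
    α⇒ X X X ⨾ (id X ⊗₁ (id X ⊗₁ d X)) ⨾ (id X ⊗₁ α⇐ X X X) ⨾ (id X ⊗₁ ((cap X ⊗₁ id X) ⨾ λ⇒ X)) ⨾ cap X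
      ≡⟨ cong (α⇒ X X X ⨾_) (trans (cong ((id X ⊗₁ (id X ⊗₁ d X)) ⨾_) (pullˡ (id⊗-⨾ _ _))) (trans (pullˡ (id⊗-⨾ _ _)) (⨾-congˡ (cong (id X ⊗₁_) (frobenius-cap X))))) ⟩
    α⇒ X X X ⨾ (id X ⊗₁ d* X) ⨾ d* X ⨾ e X
      ≡⟨ cong (α⇒ X X X ⨾_) (pullˡ (sym (d*-assoc X))) ⟩
    α⇒ X X X ⨾ (α⇐ X X X ⨾ (d* X ⊗₁ id X) ⨾ d* X) ⨾ e X
      ≡⟨ cong (α⇒ X X X ⨾_) (trans assoc² (cong (α⇐ X X X ⨾_) (sym (assoc _ _ _)))) ⟩
    α⇒ X X X ⨾ α⇐ X X X ⨾ ((d* X ⊗₁ id X) ⨾ d* X) ⨾ e X ≡⟨ cancelˡ (α-iso₁ _ _ _) ⟩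
    ((d* X ⊗₁ id X) ⨾ d* X) ⨾ e X ≡⟨ assoc _ _ _ ⟩
    ε⁻¹ (d* X) ∎

  ε-id : ∀ X → ε (idLR X) ≡ id X
  ε-id X = trans (cong ε (sym (trans (⨾-congˡ id⊗id) (idˡ _)))) (ε-ε⁻¹ (id X))

  -- Γ f is ε⁻¹ f on the nose.
  ε-Γ : (f : Hom X Y) → ε (Γ f) ≡ f
  ε-Γ = ε-ε⁻¹

  ε-d* : ∀ X → ε (d*LR X) ≡ d* X
  ε-d* X = trans (cong ε (d*LR-ε⁻¹ X)) (ε-ε⁻¹ (d* X))

  ε-e* : ∀ X → ε (e*LR X) ≡ e* X
  ε-e* X = trans (cong ε (e*LR-ε⁻¹ X)) (ε-ε⁻¹ (e* X))

  ε-mono : ∀ {X Y} {R R' : Hom (X ⊗₀ Y) I} → R ≤ R' → ε R ≤ ε R'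
  ε-mono p = ≤-pre _ (≤-pre _ (≤-pre _ (≤-post _ (⊗-mono p (≤-refl _)))))

  ε⁻¹-mono : ∀ {X Y} {S S' : Hom X Y} → S ≤ S' → ε⁻¹ S ≤ ε⁻¹ S'
  ε⁻¹-mono p = ≤-post _ (⊗-mono p (≤-refl _))

-- F preserves ⊗₀ and I only up to F-⊗₀ and F-I, so F (ε R) is compared with ε (LRmor F R)
-- factor by factor through cast.
module Naturality {o ℓ r : Level} (𝔹 𝔹' : CartesianBicategory o ℓ r) (F : CBCMorphism 𝔹 𝔹') where
  private
    module B = Transposition 𝔹
    module B' = Transposition 𝔹'
  open CBCMorphism F
  open LRConstruction using (LRmor)
  open ≡-Reasoning

  cst : ∀ {A A' C C'} → A ≡ A' → C ≡ C' → B'.Hom A C → B'.Hom A' C'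
  cst = cast 𝔹 𝔹'

  cast-⨾ : ∀ {A A' C C' D D'} (p : A ≡ A') (q : C ≡ C') (s : D ≡ D') (f : B'.Hom A C) (g : B'.Hom C D) →
           cst p s (f B'.⨾ g) ≡ cst p q f B'.⨾ cst q s g
  cast-⨾ refl refl refl f g = refl

  cast-trans : ∀ {A A' A'' C C' C''} (p : A ≡ A') (p' : A' ≡ A'') (q : C ≡ C') (q' : C' ≡ C'') (f : B'.Hom A C) →
               cst (trans p p') (trans q q') f ≡ cst p' q' (cst p q f)
  cast-trans refl refl refl refl f = refl

  cast-id : ∀ {A A'} (p : A ≡ A') → cst p p (B'.id A) ≡ B'.id A'
  cast-id refl = refl

  castʳ-⊗ : ∀ {A D C C' E E'} (p : C ≡ C') (q : E ≡ E') (f : B'.Hom A D) (g : B'.Hom C E) →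
            cst (cong (A B'.⊗₀_) p) (cong (D B'.⊗₀_) q) (f B'.⊗₁ g) ≡ f B'.⊗₁ cst p q g
  castʳ-⊗ refl refl f g = refl

  castˡ-⊗ : ∀ {A D C C' E E'} (p : C ≡ C') (q : E ≡ E') (f : B'.Hom C E) (g : B'.Hom A D) →
            cst (cong (B'._⊗₀ A) p) (cong (B'._⊗₀ D) q) (f B'.⊗₁ g) ≡ cst p q f B'.⊗₁ g
  castˡ-⊗ refl refl f g = refl

  cast-inv : ∀ {A C A' C'} {f : B.Hom A C} {g : B.Hom C A} (p : F₀ A ≡ A') (q : F₀ C ≡ C') →
             B.Iso f g → {f' : B'.Hom A' C'} {g' : B'.Hom C' A'} → B'.Iso f' g' →
             cst p q (F₁ f) ≡ f' → cst q p (F₁ g) ≡ g'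
  cast-inv {A} {C} {A'} {C'} {f} {g} p q (fg , gf) {f'} {g'} (f'g' , g'f') e = begin
    u ≡⟨ sym (B'.idˡ u) ⟩
    B'.id _ B'.⨾ u ≡⟨ cong (B'._⨾ u) (sym g'f') ⟩
    (g' B'.⨾ f') B'.⨾ u ≡⟨ B'.assoc _ _ _ ⟩
    g' B'.⨾ f' B'.⨾ u ≡⟨ cong (g' B'.⨾_) f'u ⟩
    g' B'.⨾ B'.id _ ≡⟨ B'.idʳ g' ⟩
    g' ∎
    where
    u : B'.Hom C' A'
    u = cst q p (F₁ g)
    f'u : f' B'.⨾ u ≡ B'.id _
    f'u = begin
      f' B'.⨾ u ≡⟨ cong (B'._⨾ u) (sym e) ⟩
      cst p q (F₁ f) B'.⨾ u ≡⟨ sym (cast-⨾ p q p (F₁ f) (F₁ g)) ⟩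
      cst p p (F₁ f B'.⨾ F₁ g) ≡⟨ cong (cst p p) (sym (F-⨾ f g)) ⟩
      cst p p (F₁ (f B.⨾ g)) ≡⟨ cong (λ z → cst p p (F₁ z)) fg ⟩
      cst p p (F₁ (B.id _)) ≡⟨ cong (cst p p) (F-id _) ⟩
      cst p p (B'.id _) ≡⟨ cast-id p ⟩
      B'.id _ ∎

  F-⊗₁-castʳ : ∀ {A A' C C' D D'} (f : B.Hom A A') (g : B.Hom C D) (p : F₀ C ≡ C') (q : F₀ D ≡ D') →
               cst (trans (F-⊗₀ A C) (cong (F₀ A B'.⊗₀_) p)) (trans (F-⊗₀ A' D) (cong (F₀ A' B'.⊗₀_) q)) (F₁ (f B.⊗₁ g))
                 ≡ F₁ f B'.⊗₁ cst p q (F₁ g)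
  F-⊗₁-castʳ {A} {A'} {C} {D = D} f g p q = begin
    cst (trans (F-⊗₀ A C) (cong (F₀ A B'.⊗₀_) p)) (trans (F-⊗₀ A' D) (cong (F₀ A' B'.⊗₀_) q)) (F₁ (f B.⊗₁ g))
      ≡⟨ cast-trans (F-⊗₀ A C) (cong (F₀ A B'.⊗₀_) p) (F-⊗₀ A' D) (cong (F₀ A' B'.⊗₀_) q) _ ⟩
    cst (cong (F₀ A B'.⊗₀_) p) (cong (F₀ A' B'.⊗₀_) q) (cst (F-⊗₀ A C) (F-⊗₀ A' D) (F₁ (f B.⊗₁ g)))
      ≡⟨ cong (cst (cong (F₀ A B'.⊗₀_) p) (cong (F₀ A' B'.⊗₀_) q)) (F-⊗₁ f g) ⟩
    cst (cong (F₀ A B'.⊗₀_) p) (cong (F₀ A' B'.⊗₀_) q) (F₁ f B'.⊗₁ F₁ g)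
      ≡⟨ castʳ-⊗ p q _ _ ⟩
    F₁ f B'.⊗₁ cst p q (F₁ g) ∎

  F-⊗₁-castˡ : ∀ {A A' C C' D D'} (f : B.Hom C D) (g : B.Hom A A') (p : F₀ C ≡ C') (q : F₀ D ≡ D') →
               cst (trans (F-⊗₀ C A) (cong (B'._⊗₀ F₀ A) p)) (trans (F-⊗₀ D A') (cong (B'._⊗₀ F₀ A') q)) (F₁ (f B.⊗₁ g))
                 ≡ cst p q (F₁ f) B'.⊗₁ F₁ g
  F-⊗₁-castˡ {A} {A'} {C} {D = D} f g p q = begin
    cst (trans (F-⊗₀ C A) (cong (B'._⊗₀ F₀ A) p)) (trans (F-⊗₀ D A') (cong (B'._⊗₀ F₀ A') q)) (F₁ (f B.⊗₁ g))
      ≡⟨ cast-trans (F-⊗₀ C A) (cong (B'._⊗₀ F₀ A) p) (F-⊗₀ D A') (cong (B'._⊗₀ F₀ A') q) _ ⟩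
    cst (cong (B'._⊗₀ F₀ A) p) (cong (B'._⊗₀ F₀ A') q) (cst (F-⊗₀ C A) (F-⊗₀ D A') (F₁ (f B.⊗₁ g)))
      ≡⟨ cong (cst (cong (B'._⊗₀ F₀ A) p) (cong (B'._⊗₀ F₀ A') q)) (F-⊗₁ f g) ⟩
    cst (cong (B'._⊗₀ F₀ A) p) (cong (B'._⊗₀ F₀ A') q) (F₁ f B'.⊗₁ F₁ g)
      ≡⟨ castˡ-⊗ p q _ _ ⟩
    cst p q (F₁ f) B'.⊗₁ F₁ g ∎

  ε-natural : ∀ {X Y} (R : B.Hom (X B.⊗₀ Y) B.I) → F₁ (B.ε R) ≡ B'.ε (LRmor 𝔹 F R)
  ε-natural {X} {Y} R = begin
    F₁ (B.ε R) ≡⟨ trans (F-⨾ _ _) (cong (F₁ (B.ρ⇐ X) B'.⨾_) (trans (F-⨾ _ _) (cong (F₁ (B.id X B.⊗₁ (B.e* Y B.⨾ B.d Y)) B'.⨾_)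
                      (trans (F-⨾ _ _) (cong (F₁ (B.α⇐ X Y Y) B'.⨾_) (F-⨾ _ _)))))) ⟩
    F₁ (B.ρ⇐ X) B'.⨾ F₁ (B.id X B.⊗₁ (B.e* Y B.⨾ B.d Y)) B'.⨾ F₁ (B.α⇐ X Y Y) B'.⨾ F₁ (R B.⊗₁ B.id Y) B'.⨾ F₁ (B.λ⇒ Y)
      ≡⟨ trans (cast-⨾ refl P1 refl _ _) (B'.⨾-congʳ (trans (cast-⨾ P1 P2 refl _ _) (B'.⨾-congʳ (trans (cast-⨾ P2 P3 refl _ _)
           (B'.⨾-congʳ (cast-⨾ P3 P4 refl _ _)))))) ⟩
    cst refl P1 (F₁ (B.ρ⇐ X)) B'.⨾ cst P1 P2 (F₁ (B.id X B.⊗₁ (B.e* Y B.⨾ B.d Y))) B'.⨾ cst P2 P3 (F₁ (B.α⇐ X Y Y))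
      B'.⨾ cst P3 P4 (F₁ (R B.⊗₁ B.id Y)) B'.⨾ cst P4 refl (F₁ (B.λ⇒ Y))
      ≡⟨ cong₂ B'._⨾_ c1 (cong₂ B'._⨾_ c2 (cong₂ B'._⨾_ c3 (cong₂ B'._⨾_ c4 (F-unitˡ Y)))) ⟩
    B'.ε (cst (F-⊗₀ X Y) F-I (F₁ R)) ∎
    where
    P1 : F₀ (X B.⊗₀ B.I) ≡ F₀ X B'.⊗₀ B'.I
    P1 = trans (F-⊗₀ X B.I) (cong (F₀ X B'.⊗₀_) F-I)
    P2 : F₀ (X B.⊗₀ (Y B.⊗₀ Y)) ≡ F₀ X B'.⊗₀ (F₀ Y B'.⊗₀ F₀ Y)
    P2 = trans (F-⊗₀ X (Y B.⊗₀ Y)) (cong (F₀ X B'.⊗₀_) (F-⊗₀ Y Y))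
    P3 : F₀ ((X B.⊗₀ Y) B.⊗₀ Y) ≡ (F₀ X B'.⊗₀ F₀ Y) B'.⊗₀ F₀ Y
    P3 = trans (F-⊗₀ (X B.⊗₀ Y) Y) (cong (B'._⊗₀ F₀ Y) (F-⊗₀ X Y))
    P4 : F₀ (B.I B.⊗₀ Y) ≡ B'.I B'.⊗₀ F₀ Y
    P4 = trans (F-⊗₀ B.I Y) (cong (B'._⊗₀ F₀ Y) F-I)
    c1 : cst refl P1 (F₁ (B.ρ⇐ X)) ≡ B'.ρ⇐ (F₀ X)
    c1 = cast-inv P1 refl B.isoρ B'.isoρ (F-unitʳ X)
    c2 : cst P1 P2 (F₁ (B.id X B.⊗₁ (B.e* Y B.⨾ B.d Y))) ≡ B'.id (F₀ X) B'.⊗₁ (B'.e* (F₀ Y) B'.⨾ B'.d (F₀ Y))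
    c2 = trans (F-⊗₁-castʳ (B.id X) (B.e* Y B.⨾ B.d Y) F-I (F-⊗₀ Y Y))
               (cong₂ B'._⊗₁_ (F-id X) (trans (cong (cst F-I (F-⊗₀ Y Y)) (F-⨾ _ _))
                                            (trans (cast-⨾ F-I refl (F-⊗₀ Y Y) _ _) (cong₂ B'._⨾_ (F-e* Y) (F-d Y)))))
    c3 : cst P2 P3 (F₁ (B.α⇐ X Y Y)) ≡ B'.α⇐ (F₀ X) (F₀ Y) (F₀ Y)
    c3 = cast-inv P3 P2 B.isoα B'.isoα (F-α X Y Y)
    c4 : cst P3 P4 (F₁ (R B.⊗₁ B.id Y)) ≡ cst (F-⊗₀ X Y) F-I (F₁ R) B'.⊗₁ B'.id (F₀ Y)
    c4 = trans (F-⊗₁-castˡ R (B.id Y) (F-⊗₀ X Y) F-I) (cong (cst (F-⊗₀ X Y) F-I (F₁ R) B'.⊗₁_) (F-id Y))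

lemmaC2 : ∀ {o ℓ r : Level} (B : CartesianBicategory o ℓ r) → EpsilonNatIso B
lemmaC2 B = record
  { ε⁻¹-ε = ε⁻¹-ε
  ; ε-ε⁻¹ = ε-ε⁻¹
  ; ε-id = ε-id
  ; ε-comp = ε-comp
  ; ε-mono = ε-mono
  ; ε⁻¹-mono = ε⁻¹-mono
  ; ε-⊗ = ε-⊗
  ; ε-α = λ X Y Z → ε-Γ (α⇒ X Y Z)
  ; ε-unitˡ = λ X → ε-Γ (unitˡ⇒ X)
  ; ε-unitʳ = λ X → ε-Γ (unitʳ⇒ X)
  ; ε-braid = λ X Y → ε-Γ (braid X Y)
  ; ε-d = λ X → ε-Γ (d X)
  ; ε-e = λ X → ε-Γ (e X)
  ; ε-d* = ε-d*
  ; ε-e* = ε-e*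
  ; natural = λ B' F → Naturality.ε-natural B B' F
  }
  where
  open Transposition B
  open LRStructure B
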